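{- Let $p\neq3$ be a prime. Then $$\widehat{\lambda_p}(f_*)=\begin{cases}-\dfrac1{p^3}&\text{if } f_*\in\mathcal{O}^*_{(111)}\cup\mathcal{O}^*_{(12)}\cup\mathcal{O}^*_{(3)}\cup\mathcal{O}^*_{(1^21)},\\[2mm] \dfrac{p^2-1}{p^3}&\text{if } f_*\in\mathcal{O}^*_{(1^3)}\cup\mathcal{O}^*_{(0)}.\end{cases}$$ Moreover, $\widehat{\theta_{p^2}}(0)=1-\dfrac1{p^2}$.
   Context: Let $V(\mathbb{F}_p)$ be the space of binary cubic forms $ax^3+bx^2y+cxy^2+dy^3$ over $\mathbb{F}_p$. The splitting type of $f\in V(\mathbb{F}_p)$ is: $(111)$ if $f$ has three distinct roots in $\mathbb{P}^1(\mathbb{F}_p)$; $(12)$ if it has one root in $\mathbb{P}^1(\mathbb{F}_p)$ and a pair of conjugate roots over $\mathbb{F}_{p^2}$; $(3)$ if irreducible; $(1^21)$ if it has a double root and a simple root; $(1^3)$ if it has a triple root; $(0)$ if $f=0$. Define $\lambda_p(f)$ to be $2,0,-1,1,0,0$ and $\lambda_{p^2}(f)$ to be $3,1,0,1,0,0$ for splitting types $(111),(12),(3),(1^21),(1^3),(0)$ respectively, and $\theta_{p^2}=2\lambda_{p^2}-\lambda_p^2$. For $p\neq3$, identify the dual space $V^*(\mathbb{F}_p)$ with $V(\mathbb{F}_p)$ via the pairing $[f_1,f_2]=d_1a_2-\tfrac13c_1b_2+\tfrac13b_1c_2-a_1d_2\in\mathbb{F}_p$ (where $f_i=a_ix^3+b_ix^2y+c_ixy^2+d_iy^3$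 and $\tfrac13$ is the inverse of $3$ mod $p$), and let $\mathcal{O}^*_\sigma$ be the set of $f_*\in V^*(\mathbb{F}_p)$ of splitting type $\sigma$. The Fourier transform of $\phi:V(\mathbb{F}_p)\to\mathbb{C}$ is $\widehat\phi(f_*)=p^{ -4}\sum_{f\in V(\mathbb{F}_p)}e^{2\pi i[f,f_*]/p}\phi(f)$. -}

module Defs where

open import Data.Nat as ℕ using (ℕ; zero; suc; NonZero)
open import Data.Nat.DivMod using (_mod_)
open import Data.Fin using (Fin; toℕ; _≟_)
open import Data.Integer as ℤ using (ℤ; +_)
open import Data.Rational as ℚ using (ℚ; 0ℚ; 1ℚ; _/_)
open import Data.Product using (Σ; ∃; _×_; _,_)
open import Data.Sum using (_⊎_)
open import Relation.Nullary using (¬_; does)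
open import Relation.Binary.PropositionalEquality using (_≡_)
open import Data.Bool using (if_then_else_)

data SplitType : Set where
  s111 s12 s3 s1²1 s1³ s0 : SplitType

λp : SplitType → ℤ
λp s111 = + 2
λp s12  = + 0
λp s3   = ℤ.- (+ 1)
λp s1²1 = + 1
λp s1³  = + 0
λp s0   = + 0

λp² : SplitType → ℤ
λp² s111 = + 3
λp² s12  = + 1
λp² s3   = + 0
λp² s1²1 = + 1
λp² s1³  = + 0
λp² s0   = + 0

θp² : SplitType → ℤ
θp² σ = (+ 2) ℤ.* λp² σ ℤ.- λp σ ℤ.* λp σ

toℚ : ℤ → ℚ
toℚ z = z / 1

module _ (p : ℕ) .{{_ : NonZero p}} where

  Fp : Set
  Fp = Fin p

  infixl 6 _+ₚ_ _-ₚ_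
  infixl 7 _*ₚ_

  0ₚ : Fp
  0ₚ = 0 mod p

  _+ₚ_ : Fp → Fp → Fp
  x +ₚ y = (toℕ x ℕ.+ toℕ y) mod p

  _*ₚ_ : Fp → Fp → Fp
  x *ₚ y = (toℕ x ℕ.* toℕ y) mod p

  -ₚ_ : Fp → Fp
  -ₚ x = (p ℕ.∸ toℕ x) mod p

  _-ₚ_ : Fp → Fp → Fp
  x -ₚ y = x +ₚ (-ₚ y)

  -- linear form  u x + v y
  record Lin : Set where
    constructor lin
    field u v : Fp

  -- quadratic form  r x^2 + s x y + t y^2
  record Quad : Set where
    constructor quad
    field r s t : Fp

  -- binary cubic form  a x^3 + b x^2 y + c x y^2 + d y^3  (element of V(F_p))
  record Cubic : Set where
    constructor cubic
    field a b c d : Fp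

  zeroQ : Quad
  zeroQ = quad 0ₚ 0ₚ 0ₚ

  zeroC : Cubic
  zeroC = cubic 0ₚ 0ₚ 0ₚ 0ₚ

  NonzeroLin : Lin → Set
  NonzeroLin (lin u v) = ¬ ((u ≡ 0ₚ) × (v ≡ 0ₚ))

  -- two linear forms are proportional (define the same point of P^1)
  Prop : Lin → Lin → Set
  Prop (lin u₁ v₁) (lin u₂ v₂) = u₁ *ₚ v₂ ≡ u₂ *ₚ v₁

  mulLL : Lin → Lin → Quad
  mulLL (lin u₁ v₁) (lin u₂ v₂) =
    quad (u₁ *ₚ u₂) (u₁ *ₚ v₂ +ₚ v₁ *ₚ u₂) (v₁ *ₚ v₂)

  mulLQ : Lin → Quad → Cubic
  mulLQ (lin u v) (quad r s t) =
    cubic (u *ₚ r) (u *ₚ s +ₚ v *ₚ r) (u *ₚ t +ₚ v *ₚ s) (v *ₚ t)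

  IrredQ : Quad → Set
  IrredQ q = ¬ (q ≡ zeroQ) × ¬ (∃ λ L₁ → ∃ λ L₂ → q ≡ mulLL L₁ L₂)

  -- Splitting types.  Roots in P^1(F_p) of a binary form correspond to its
  -- linear factors over F_p (up to scalars).

  HasType : SplitType → Cubic → Set
  HasType s111 f = ∃ λ L₁ → ∃ λ L₂ → ∃ λ L₃ →
    NonzeroLin L₁ × NonzeroLin L₂ × NonzeroLin L₃ ×
    ¬ Prop L₁ L₂ × ¬ Prop L₁ L₃ × ¬ Prop L₂ L₃ ×
    f ≡ mulLQ L₁ (mulLL L₂ L₃)
  HasType s12 f = ∃ λ L → ∃ λ Q →
    NonzeroLin L × IrredQ Q × f ≡ mulLQ L Q
  -- irreducible: nonzero and no factorisation (any factorisation of a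
  -- cubic into positive-degree factors has a linear factor)
  HasType s3 f = ¬ (f ≡ zeroC) × ¬ (∃ λ L → ∃ λ Q → f ≡ mulLQ L Q)
  HasType s1²1 f = ∃ λ L₁ → ∃ λ L₂ → ∃ λ L₃ →
    NonzeroLin L₁ × NonzeroLin L₂ × NonzeroLin L₃ ×
    Prop L₁ L₂ × ¬ Prop L₁ L₃ ×
    f ≡ mulLQ L₁ (mulLL L₂ L₃)
  HasType s1³ f = ∃ λ L₁ → ∃ λ L₂ → ∃ λ L₃ →
    NonzeroLin L₁ × NonzeroLin L₂ × NonzeroLin L₃ ×
    Prop L₁ L₂ × Prop L₁ L₃ ×
    f ≡ mulLQ L₁ (mulLL L₂ L₃)
  HasType s0 f = f ≡ zeroC

  -- The pairing [f₁,f₂] = d₁a₂ - (1/3)c₁b₂ + (1/3)b₁c₂ - a₁d₂,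
  -- where i3 is the inverse of 3 mod p (supplied as a parameter).

  pairing : (i3 : Fp) → Cubic → Cubic → Fp
  pairing i3 (cubic a₁ b₁ c₁ d₁) (cubic a₂ b₂ c₂ d₂) =
    d₁ *ₚ a₂ -ₚ i3 *ₚ c₁ *ₚ b₂ +ₚ i3 *ₚ b₁ *ₚ c₂ -ₚ a₁ *ₚ d₂

  -- The cyclotomic field Q(ζ_p), ζ_p = e^{2πi/p}.  An element is given by
  -- a coefficient vector c : Fp → ℚ standing for Σ_t c(t) ζ_p^t.  For p
  -- prime the kernel of Q[C_p] → Q(ζ_p) is Q·(1 + ζ + … + ζ^{p-1}), so two
  -- coefficient vectors denote the same number iff their difference is
  -- constant.

  Cyc : Set
  Cyc = Fp → ℚ


  ratC : ℚ → Cyc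
  ratC r t = if does (t ≟ 0ₚ) then r else 0ℚ

infix 4 _≈ᶜ_
_≈ᶜ_ : {p : ℕ} .{{_ : NonZero p}} → Cyc p → Cyc p → Set
x ≈ᶜ y = ∃ λ k → ∀ t → x t ℚ.- y t ≡ k

sumFin : {n : ℕ} → (Fin n → ℚ) → ℚ
sumFin {zero}  g = 0ℚ
sumFin {suc n} g = g Fin.zero ℚ.+ sumFin (λ i → g (Fin.suc i))
  where import Data.Fin as Fin

module _ (p : ℕ) .{{_ : NonZero p}} where

  sumV : (Cubic p → ℚ) → ℚ
  sumV g = sumFin λ a → sumFin λ b → sumFin λ c → sumFin λ d → g (cubic a b c d)

  pinv : ℚ
  pinv = (+ 1) / p

  pℚ : ℚ
  pℚ = (+ p) / 1

  -- Fourier transform:  φ̂(f_*) = p^{-4} Σ_f ζ_p^{[f,f_*]} φ(f),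
  -- as an element of Q(ζ_p): coefficient of ζ_p^t is
  -- p^{-4} Σ_{f : [f,f_*] = t} φ(f).
  fourier : (i3 : Fp p) → (Cubic p → ℚ) → Cubic p → Cyc p
  fourier i3 φ f* t = (pinv ℚ.* pinv ℚ.* pinv ℚ.* pinv) ℚ.*
    sumV (λ f → if does (pairing p i3 f f* ≟ t) then φ f else 0ℚ)

module Submission where

-- Write ρ(f) and δ(f) for the numbers of roots and of multiple roots of f on
-- ℙ¹(F_p). Checking each splitting type, λ_p(f) = ρ(f) - 1 - p [f = 0] and
-- θ_{p²}(f) = 2 (ρ - δ) - (ρ - 1)² + p² [f = 0]. Since ρ(f) = Σ_P [f(P) = 0],
-- the coefficient of ζ^t in p⁴ λ̂_p(f*) is Σ_P N_P(t) - N(t) - p [t = 0],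
-- where N(t) counts the cubics f with [f, f*] = t and N_P(t) those that also
-- vanish at P. N(t) = p³ unless f* = 0, and N_P(t) = p² unless f* annihilates
-- the hyperplane {f(P) = 0}, when N_P(t) = p³ [t = 0]. As 3 is invertible,
-- f* annihilates it exactly when f* is a multiple of the cube of the linear
-- form vanishing at P: never for f* of type (111), (12), (3) or (1²1), only at
-- the root of f* for type (1³), and at every P for f* = 0. For θ at f* = 0 it
-- remains to count the cubics vanishing at one or two given points, or
-- vanishing doubly at one.

open import Defs
open import Data.Nat using (ℕ; NonZero)
open import Data.Nat.DivMod using (_%_)
open import Data.Nat.Primality using (Prime)
open import Data.Fin using (toℕ)
open import Data.Rational as ℚ using (ℚ; 1ℚ)
open import Data.Product using (_×_)
open import Data.Sum using (_⊎_)
open import Relation.Binary.PropositionalEquality using (_≡_; _≢_)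
open import Data.Nat as ℕ using (zero; suc)
import Data.Nat.Properties as ℕ
open import Data.Nat.DivMod using (_mod_; m<n⇒m%n≡m; %-distribˡ-+; %-distribˡ-*; n%n≡0; m*n%n≡0; [m+kn]%n≡m%n)
open import Data.Nat.Divisibility using (_∣_; ∣⇒≤; m%n≡0⇒n∣m; ∣1⇒≡1)
open import Data.Nat.Primality using (euclidsLemma; prime⇒nonTrivial)
open import Data.Nat.Coprimality using (prime⇒coprime; coprime-Bézout)
open import Data.Nat.GCD using (module Bézout)
open import Data.Fin as Fin using (Fin; _≟_)
open import Data.Fin.Properties using (toℕ-injective; toℕ-fromℕ<; toℕ<n; any?)
open import Data.Integer as ℤ using (ℤ; +_; -[1+_]; _◃_; sign; ∣_∣)
import Data.Integer.Properties as ℤ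
open import Data.Sign as Sign using (Sign)
open import Data.Rational as ℚ using (0ℚ; _/_; mkℚ; -_)
  renaming (_+_ to _⊕_; _*_ to _⊛_; _-_ to _⊖_)
import Data.Rational.Properties as ℚ
open import Data.Rational.Solver using (module +-*-Solver)
open import Data.Bool using (Bool; true; false; if_then_else_; _∨_; _∧_)
open import Data.Maybe using (Maybe; just; nothing)
open import Data.Empty using (⊥; ⊥-elim)
open import Data.Product using (Σ; ∃; _,_; proj₁; proj₂)
open import Data.Sum using (inj₁; inj₂; [_,_]; [_,_]′)
open import Function using (id)
open import Relation.Nullary using (¬_; Dec; yes; no; does)
open import Relation.Nullary.Decidable using (map′; _×-dec_; ¬?)
open import Relation.Binary.PropositionalEquality hiding ([_])
open import Algebra.Bundles using (CommutativeRing; CommutativeMonoid)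
open import Algebra.Structures using (IsCommutativeRing)
open import Algebra.Properties.CommutativeSemigroup (CommutativeMonoid.commutativeSemigroup ℚ.+-0-commutativeMonoid)
  using () renaming (interchange to ⊕-interchange)
import Algebra.Solver.Ring
import Algebra.Solver.Ring.AlmostCommutativeRing as ACR

module Sums where

  open ≡-Reasoning

  fromℕ : ℕ → ℚ
  fromℕ n = + n / 1

  private
    fromℕ-normal : ∀ n → fromℕ n ≡ mkℚ (+ n) 0 (λ c → ∣1⇒≡1 (proj₂ c))
    fromℕ-normal n = ℚ.normalize-coprime _

  fromℕ-suc : ∀ n → fromℕ (suc n) ≡ 1ℚ ⊕ fromℕ n
  fromℕ-suc n = sym (begin
    1ℚ ⊕ fromℕ n                                  ≡⟨ cong (1ℚ ⊕_) (fromℕ-normal n) ⟩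
    1ℚ ⊕ mkℚ (+ n) 0 (λ c → ∣1⇒≡1 (proj₂ c))      ≡⟨ ℚ./-cong {p₁ = (+ 1) ℤ.+ (+ n) ℤ.* (+ 1)} {q₁ = 1} {p₂ = + suc n} {q₂ = 1}
                                                         (cong (ℤ._+_ (+ 1)) (ℤ.*-identityʳ (+ n))) refl ⟩
    fromℕ (suc n)                                 ∎)

  fromℕ-injective : ∀ {m n} → fromℕ m ≡ fromℕ n → m ≡ n
  fromℕ-injective {m} {n} e =
    ℤ.+-injective (cong ℚ.numerator (trans (sym (fromℕ-normal m)) (trans e (fromℕ-normal n))))

  1/n*n≡1 : ∀ n .{{_ : NonZero n}} → ((+ 1) / n) ⊛ fromℕ n ≡ 1ℚ
  1/n*n≡1 (suc k) = begin
    ((+ 1) / suc k) ⊛ fromℕ (suc k)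
      ≡⟨ cong₂ _⊛_ (ℚ.normalize-coprime {1} {k} (λ c → ∣1⇒≡1 (proj₁ c))) (fromℕ-normal (suc k)) ⟩
    mkℚ (+ 1) k (λ c → ∣1⇒≡1 (proj₁ c)) ⊛ mkℚ (+ suc k) 0 (λ c → ∣1⇒≡1 (proj₂ c))
      ≡⟨ ℚ.*-inverseˡ (mkℚ (+ suc k) 0 (λ c → ∣1⇒≡1 (proj₂ c))) ⟩
    1ℚ ∎

  𝟙 : ∀ {a} {A : Set a} → Dec A → ℚ
  𝟙 d = if does d then 1ℚ else 0ℚ

  if-then-0≡𝟙* : ∀ {a} {A : Set a} (d : Dec A) x → (if does d then x else 0ℚ) ≡ 𝟙 d ⊛ x
  if-then-0≡𝟙* (yes _) x = sym (ℚ.*-identityˡ x)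
  if-then-0≡𝟙* (no _)  x = sym (ℚ.*-zeroˡ x)

  𝟙-cong : ∀ {a b} {A : Set a} {B : Set b} → (A → B) → (B → A) → (d : Dec A) (e : Dec B) → 𝟙 d ≡ 𝟙 e
  𝟙-cong f g (yes _) (yes _) = refl
  𝟙-cong f g (yes a) (no ¬b) with () ← ¬b (f a)
  𝟙-cong f g (no ¬a) (yes b) with () ← ¬a (g b)
  𝟙-cong f g (no _)  (no _)  = refl

  𝟙-yes : ∀ {a} {A : Set a} → A → (d : Dec A) → 𝟙 d ≡ 1ℚ
  𝟙-yes a (yes _) = refl
  𝟙-yes a (no ¬a) with () ← ¬a a

  𝟙-no : ∀ {a} {A : Set a} → ¬ A → (d : Dec A) → 𝟙 d ≡ 0ℚ
  𝟙-no ¬a (yes a) with () ← ¬a a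
  𝟙-no ¬a (no _) = refl

  𝟙-× : ∀ {a b} {A : Set a} {B : Set b} (d : Dec A) (e : Dec B) → 𝟙 (d ×-dec e) ≡ 𝟙 d ⊛ 𝟙 e
  𝟙-× (yes _) (yes _) = refl
  𝟙-× (yes _) (no _)  = refl
  𝟙-× (no _)  (yes _) = refl
  𝟙-× (no _)  (no _)  = refl

  sumFin-cong : ∀ {n} {f g : Fin n → ℚ} → (∀ i → f i ≡ g i) → sumFin f ≡ sumFin g
  sumFin-cong {zero} e = refl
  sumFin-cong {suc n} e = cong₂ _⊕_ (e Fin.zero) (sumFin-cong (λ i → e (Fin.suc i)))

  sumFin-+ : ∀ {n} (f g : Fin n → ℚ) → sumFin (λ i → f i ⊕ g i) ≡ sumFin f ⊕ sumFin g
  sumFin-+ {zero} f g = refl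
  sumFin-+ {suc n} f g = begin
    (f₀ ⊕ g₀) ⊕ sumFin (λ i → f (Fin.suc i) ⊕ g (Fin.suc i))  ≡⟨ cong ((f₀ ⊕ g₀) ⊕_) (sumFin-+ (λ i → f (Fin.suc i)) (λ i → g (Fin.suc i))) ⟩
    (f₀ ⊕ g₀) ⊕ (F' ⊕ G')                                     ≡⟨ ⊕-interchange f₀ g₀ F' G' ⟩
    (f₀ ⊕ F') ⊕ (g₀ ⊕ G')                                     ∎
    where
    f₀ = f Fin.zero
    g₀ = g Fin.zero
    F' = sumFin (λ i → f (Fin.suc i))
    G' = sumFin (λ i → g (Fin.suc i))

  sumFin-* : ∀ {n} c (f : Fin n → ℚ) → sumFin (λ i → c ⊛ f i) ≡ c ⊛ sumFin f
  sumFin-* {zero} c f = sym (ℚ.*-zeroʳ c)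
  sumFin-* {suc n} c f = begin
    c ⊛ f Fin.zero ⊕ sumFin (λ i → c ⊛ f (Fin.suc i))   ≡⟨ cong (c ⊛ f Fin.zero ⊕_) (sumFin-* c (λ i → f (Fin.suc i))) ⟩
    c ⊛ f Fin.zero ⊕ c ⊛ sumFin (λ i → f (Fin.suc i))   ≡⟨ sym (proj₁ ℚ.*-distrib-+ c (f Fin.zero) _) ⟩
    c ⊛ sumFin f                                        ∎

  sumFin-const : ∀ {n} c → sumFin {n} (λ _ → c) ≡ fromℕ n ⊛ c
  sumFin-const {zero} c = sym (ℚ.*-zeroˡ c)
  sumFin-const {suc n} c = begin
    c ⊕ sumFin {n} (λ _ → c)   ≡⟨ cong (c ⊕_) (sumFin-const {n} c) ⟩
    c ⊕ fromℕ n ⊛ c            ≡⟨ cong (_⊕ fromℕ n ⊛ c) (sym (ℚ.*-identityˡ c)) ⟩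
    1ℚ ⊛ c ⊕ fromℕ n ⊛ c       ≡⟨ sym (ℚ.*-distribʳ-+ c 1ℚ (fromℕ n)) ⟩
    (1ℚ ⊕ fromℕ n) ⊛ c         ≡⟨ cong (_⊛ c) (sym (fromℕ-suc n)) ⟩
    fromℕ (suc n) ⊛ c          ∎

  sumFin-0 : ∀ {n} → sumFin {n} (λ _ → 0ℚ) ≡ 0ℚ
  sumFin-0 {n} = trans (sumFin-const {n} 0ℚ) (ℚ.*-zeroʳ (fromℕ n))

  sumFin-swap : ∀ {m n} (f : Fin m → Fin n → ℚ) →
    sumFin (λ i → sumFin (λ j → f i j)) ≡ sumFin (λ j → sumFin (λ i → f i j))
  sumFin-swap {zero}  {n} f = sym (sumFin-0 {n})
  sumFin-swap {suc m} {n} f = begin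
    sumFin (f Fin.zero) ⊕ sumFin (λ i → sumFin (f (Fin.suc i)))
      ≡⟨ cong (sumFin (f Fin.zero) ⊕_) (sumFin-swap (λ i → f (Fin.suc i))) ⟩
    sumFin (f Fin.zero) ⊕ sumFin (λ j → sumFin (λ i → f (Fin.suc i) j))
      ≡⟨ sym (sumFin-+ (f Fin.zero) _) ⟩
    sumFin (λ j → f Fin.zero j ⊕ sumFin (λ i → f (Fin.suc i) j)) ∎

  sumFin-𝟙≟ : ∀ {n} (j : Fin n) (g : Fin n → ℚ) → sumFin (λ i → 𝟙 (i ≟ j) ⊛ g i) ≡ g j
  sumFin-𝟙≟ {suc n} Fin.zero g = begin
    1ℚ ⊛ g Fin.zero ⊕ sumFin (λ i → 0ℚ ⊛ g (Fin.suc i))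
      ≡⟨ cong₂ _⊕_ (ℚ.*-identityˡ (g Fin.zero)) (trans (sumFin-cong (λ i → ℚ.*-zeroˡ (g (Fin.suc i)))) (sumFin-0 {n})) ⟩
    g Fin.zero ⊕ 0ℚ ≡⟨ ℚ.+-identityʳ _ ⟩
    g Fin.zero ∎
  sumFin-𝟙≟ {suc n} (Fin.suc j) g = begin
    0ℚ ⊛ g Fin.zero ⊕ sumFin (λ i → 𝟙 (Fin.suc i ≟ Fin.suc j) ⊛ g (Fin.suc i))
      ≡⟨ cong₂ _⊕_ (ℚ.*-zeroˡ (g Fin.zero)) (sumFin-cong (λ i → cong (_⊛ g (Fin.suc i)) (𝟙-cong Fin.suc-injective (cong Fin.suc) (Fin.suc i ≟ Fin.suc j) (i ≟ j)))) ⟩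
    0ℚ ⊕ sumFin (λ i → 𝟙 (i ≟ j) ⊛ g (Fin.suc i))
      ≡⟨ ℚ.+-identityˡ _ ⟩
    sumFin (λ i → 𝟙 (i ≟ j) ⊛ g (Fin.suc i))
      ≡⟨ sumFin-𝟙≟ j (λ i → g (Fin.suc i)) ⟩
    g (Fin.suc j) ∎
    where import Data.Fin.Properties as Fin

  sumFin-neg : ∀ {n} (f : Fin n → ℚ) → sumFin (λ i → - f i) ≡ - sumFin f
  sumFin-neg {zero} f = refl
  sumFin-neg {suc n} f =
    trans (cong (- f Fin.zero ⊕_) (sumFin-neg (λ i → f (Fin.suc i)))) (sym (ℚ.neg-distrib-+ (f Fin.zero) _))

  sumFin-⊖ : ∀ {n} (f g : Fin n → ℚ) → sumFin (λ i → f i ⊖ g i) ≡ sumFin f ⊖ sumFin g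
  sumFin-⊖ f g = trans (sumFin-+ f (λ i → - g i)) (cong (sumFin f ⊕_) (sumFin-neg g))

module RationalIdentities where

  open Sums using (fromℕ)
  open +-*-Solver

  y+[x-y]≡x : ∀ x y → y ⊕ (x ⊖ y) ≡ x
  y+[x-y]≡x = solve 2 (λ x y → y :+ (x :- y) := x) refl

  distrib-λFormula : ∀ q x r z → x ⊛ (r ⊖ 1ℚ ⊖ q ⊛ z) ≡ x ⊛ r ⊖ x ⊖ q ⊛ (z ⊛ x)
  distrib-λFormula = solve 4 (λ q x r z → x :* (r :- con 1ℚ :- q :* z) := x :* r :- x :- q :* (z :* x)) refl

  -- The identities below hold modulo u P - 1: each proof exhibits the
  -- difference of the two sides as a multiple of it.
  private
    modulo-uP-1 : ∀ {L R} K u P → u ⊛ P ≡ 1ℚ → L ≡ R ⊕ K ⊛ (u ⊛ P ⊖ 1ℚ) → L ≡ R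
    modulo-uP-1 {L} {R} K u P uP≡1 e =
      trans e (trans (cong (λ w → R ⊕ K ⊛ (w ⊖ 1ℚ)) uP≡1) (solve 2 (λ R K → R :+ K :* (con 1ℚ :- con 1ℚ) := R) refl R K))

  fourier-generic : ∀ u P δ → u ⊛ P ≡ 1ℚ →
    u ⊛ u ⊛ u ⊛ u ⊛ ((P ⊕ 1ℚ) ⊛ (P ⊛ (P ⊛ 1ℚ)) ⊖ P ⊛ (P ⊛ (P ⊛ 1ℚ)) ⊖ P ⊛ δ) ⊖ δ ⊛ (ℚ.- (u ⊛ u ⊛ u))
      ≡ u ⊛ u ⊛ u ⊛ u ⊛ (P ⊛ P)
  fourier-generic u P δ uP≡1 = modulo-uP-1 (ℚ.- (δ ⊛ (u ⊛ u ⊛ u))) u P uP≡1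
    (solve 3 (λ u P δ → u :* u :* u :* u :* ((P :+ con 1ℚ) :* (P :* (P :* con 1ℚ)) :- P :* (P :* (P :* con 1ℚ)) :- P :* δ) :- δ :* (:- (u :* u :* u))
                        := u :* u :* u :* u :* (P :* P) :+ (:- (δ :* (u :* u :* u))) :* (u :* P :- con 1ℚ)) refl u P δ)

  fourier-1³ : ∀ u P δ → u ⊛ P ≡ 1ℚ →
    u ⊛ u ⊛ u ⊛ u ⊛ ((P ⊕ 1ℚ) ⊛ (P ⊛ (P ⊛ 1ℚ)) ⊕ (P ⊛ (P ⊛ (P ⊛ δ)) ⊖ P ⊛ (P ⊛ 1ℚ)) ⊖ P ⊛ (P ⊛ (P ⊛ 1ℚ)) ⊖ P ⊛ δ)
      ⊖ δ ⊛ ((P ⊛ P ⊖ 1ℚ) ⊛ (u ⊛ u ⊛ u)) ≡ 0ℚ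
  fourier-1³ u P δ uP≡1 = modulo-uP-1 (δ ⊛ (u ⊛ u ⊛ u) ⊛ (P ⊛ P ⊖ 1ℚ)) u P uP≡1
    (solve 3 (λ u P δ → u :* u :* u :* u :* ((P :+ con 1ℚ) :* (P :* (P :* con 1ℚ)) :+ (P :* (P :* (P :* δ)) :- P :* (P :* con 1ℚ))
                                             :- P :* (P :* (P :* con 1ℚ)) :- P :* δ) :- δ :* ((P :* P :- con 1ℚ) :* (u :* u :* u))
                        := con 0ℚ :+ (δ :* (u :* u :* u) :* (P :* P :- con 1ℚ)) :* (u :* P :- con 1ℚ)) refl u P δ)

  fourier-0 : ∀ u P δ → u ⊛ P ≡ 1ℚ →
    u ⊛ u ⊛ u ⊛ u ⊛ ((P ⊕ 1ℚ) ⊛ (P ⊛ (P ⊛ (P ⊛ δ))) ⊖ P ⊛ (P ⊛ (P ⊛ (P ⊛ δ))) ⊖ P ⊛ δ)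
      ⊖ δ ⊛ ((P ⊛ P ⊖ 1ℚ) ⊛ (u ⊛ u ⊛ u)) ≡ 0ℚ
  fourier-0 u P δ uP≡1 = modulo-uP-1 (δ ⊛ (u ⊛ u ⊛ u) ⊛ (P ⊛ P ⊖ 1ℚ)) u P uP≡1
    (solve 3 (λ u P δ → u :* u :* u :* u :* ((P :+ con 1ℚ) :* (P :* (P :* (P :* δ))) :- P :* (P :* (P :* (P :* δ))) :- P :* δ)
                        :- δ :* ((P :* P :- con 1ℚ) :* (u :* u :* u))
                        := con 0ℚ :+ (δ :* (u :* u :* u) :* (P :* P :- con 1ℚ)) :* (u :* P :- con 1ℚ)) refl u P δ)

  fourier-θ-at-0 : ∀ u P δ → u ⊛ P ≡ 1ℚ →
    u ⊛ u ⊛ u ⊛ u ⊛ (δ ⊛ (fromℕ 4 ⊛ ((P ⊕ 1ℚ) ⊛ (P ⊛ (P ⊛ (P ⊛ 1ℚ)))) ⊖ fromℕ 2 ⊛ ((P ⊕ 1ℚ) ⊛ (P ⊛ (P ⊛ 1ℚ)))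
        ⊖ (P ⊕ 1ℚ) ⊛ ((P ⊕ 1ℚ) ⊛ (P ⊛ (P ⊛ 1ℚ)) ⊕ (P ⊛ (P ⊛ (P ⊛ 1ℚ)) ⊖ P ⊛ (P ⊛ 1ℚ))) ⊖ P ⊛ (P ⊛ (P ⊛ (P ⊛ 1ℚ))) ⊕ P ⊛ P ⊛ 1ℚ))
      ⊖ δ ⊛ (1ℚ ⊖ u ⊛ u) ≡ 0ℚ
  fourier-θ-at-0 u P δ uP≡1 =
    modulo-uP-1 (δ ⊛ (u ⊛ u ⊛ u ⊛ P ⊛ P ⊛ P ⊕ u ⊛ u ⊛ P ⊛ P ⊕ u ⊛ P ⊕ 1ℚ ⊖ u ⊛ u ⊛ (u ⊛ P ⊕ 1ℚ))) u P uP≡1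
      (solve 3 (λ u P δ → u :* u :* u :* u :* (δ :* (con (fromℕ 4) :* ((P :+ con 1ℚ) :* (P :* (P :* (P :* con 1ℚ))))
                                                 :- con (fromℕ 2) :* ((P :+ con 1ℚ) :* (P :* (P :* con 1ℚ)))
                                                 :- (P :+ con 1ℚ) :* ((P :+ con 1ℚ) :* (P :* (P :* con 1ℚ)) :+ (P :* (P :* (P :* con 1ℚ)) :- P :* (P :* con 1ℚ)))
                                                 :- P :* (P :* (P :* (P :* con 1ℚ))) :+ P :* P :* con 1ℚ))
                          :- δ :* (con 1ℚ :- u :* u)
                          := con 0ℚ :+ (δ :* (u :* u :* u :* P :* P :* P :+ u :* u :* P :* P :+ u :* P :+ con 1ℚ :- u :* u :* (u :* P :+ con 1ℚ)))
                                       :* (u :* P :- con 1ℚ)) refl u P δ)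

  θFormula-expanded : ∀ q r d z → fromℕ 2 ⊛ (r ⊖ d) ⊖ (r ⊖ 1ℚ) ⊛ (r ⊖ 1ℚ) ⊕ q ⊛ q ⊛ z ≡ fromℕ 4 ⊛ r ⊖ fromℕ 2 ⊛ d ⊖ r ⊛ r ⊖ 1ℚ ⊕ q ⊛ q ⊛ z
  θFormula-expanded = solve 4 (λ q r d z → con (fromℕ 2) :* (r :- d) :- (r :- con 1ℚ) :* (r :- con 1ℚ) :+ q :* q :* z
                                           := con (fromℕ 4) :* r :- con (fromℕ 2) :* d :- r :* r :- con 1ℚ :+ q :* q :* z) refl

module ZMod (p : ℕ) .{{_ : NonZero p}} where

  F : Set
  F = Fp p

  infixl 6 _+'_
  infixl 7 _*'_

  _+'_ _*'_ : F → F → F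
  _+'_ = _+ₚ_ p
  _*'_ = _*ₚ_ p

  -'_ : F → F
  -'_ = -ₚ_ p

  0' 1' : F
  0' = 0ₚ p
  1' = 1 mod p

  ι : ℕ → F
  ι n = n mod p

  toℕ-ι : ∀ n → toℕ (ι n) ≡ n % p
  toℕ-ι n = toℕ-fromℕ< _

  ι-toℕ : ∀ x → ι (toℕ x) ≡ x
  ι-toℕ x = toℕ-injective (trans (toℕ-ι (toℕ x)) (m<n⇒m%n≡m (toℕ<n x)))

  ι-≡ : ∀ m n → m % p ≡ n % p → ι m ≡ ι n
  ι-≡ m n e = toℕ-injective (trans (toℕ-ι m) (trans e (sym (toℕ-ι n))))

  ι-+ : ∀ m n → ι m +' ι n ≡ ι (m ℕ.+ n)
  ι-+ m n = ι-≡ _ _ (trans (cong₂ (λ a b → (a ℕ.+ b) % p) (toℕ-ι m) (toℕ-ι n)) (sym (%-distribˡ-+ m n p)))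

  ι-* : ∀ m n → ι m *' ι n ≡ ι (m ℕ.* n)
  ι-* m n = ι-≡ _ _ (trans (cong₂ (λ a b → (a ℕ.* b) % p) (toℕ-ι m) (toℕ-ι n)) (sym (%-distribˡ-* m n p)))

  ι-p : ι p ≡ 0'
  ι-p = ι-≡ p 0 (trans (n%n≡0 p) (sym (m<n⇒m%n≡m (ℕ.>-nonZero⁻¹ p))))

  private
    module Laws where
      open ≡-Reasoning

      +-assoc : ∀ x y z → (x +' y) +' z ≡ x +' (y +' z)
      +-assoc x y z = begin
        (x +' y) +' z                    ≡⟨ cong ((x +' y) +'_) (sym (ι-toℕ z)) ⟩
        ι (toℕ x ℕ.+ toℕ y) +' ι (toℕ z) ≡⟨ ι-+ _ _ ⟩
        ι (toℕ x ℕ.+ toℕ y ℕ.+ toℕ z)    ≡⟨ cong ι (ℕ.+-assoc (toℕ x) _ _) ⟩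
        ι (toℕ x ℕ.+ (toℕ y ℕ.+ toℕ z))  ≡⟨ sym (ι-+ _ _) ⟩
        ι (toℕ x) +' (y +' z)            ≡⟨ cong (_+' (y +' z)) (ι-toℕ x) ⟩
        x +' (y +' z)                    ∎

      *-assoc : ∀ x y z → (x *' y) *' z ≡ x *' (y *' z)
      *-assoc x y z = begin
        (x *' y) *' z                    ≡⟨ cong ((x *' y) *'_) (sym (ι-toℕ z)) ⟩
        ι (toℕ x ℕ.* toℕ y) *' ι (toℕ z) ≡⟨ ι-* _ _ ⟩
        ι (toℕ x ℕ.* toℕ y ℕ.* toℕ z)    ≡⟨ cong ι (ℕ.*-assoc (toℕ x) _ _) ⟩
        ι (toℕ x ℕ.* (toℕ y ℕ.* toℕ z))  ≡⟨ sym (ι-* _ _) ⟩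
        ι (toℕ x) *' (y *' z)            ≡⟨ cong (_*' (y *' z)) (ι-toℕ x) ⟩
        x *' (y *' z)                    ∎

      +-comm : ∀ x y → x +' y ≡ y +' x
      +-comm x y = cong ι (ℕ.+-comm (toℕ x) (toℕ y))

      *-comm : ∀ x y → x *' y ≡ y *' x
      *-comm x y = cong ι (ℕ.*-comm (toℕ x) (toℕ y))

      +-identityˡ : ∀ x → 0' +' x ≡ x
      +-identityˡ x = begin
        0' +' x           ≡⟨ cong (0' +'_) (sym (ι-toℕ x)) ⟩
        ι 0 +' ι (toℕ x)  ≡⟨ ι-+ 0 (toℕ x) ⟩
        ι (toℕ x)         ≡⟨ ι-toℕ x ⟩
        x                 ∎

      *-identityˡ : ∀ x → 1' *' x ≡ x
      *-identityˡ x = begin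
        1' *' x           ≡⟨ cong (1' *'_) (sym (ι-toℕ x)) ⟩
        ι 1 *' ι (toℕ x)  ≡⟨ ι-* 1 (toℕ x) ⟩
        ι (1 ℕ.* toℕ x)   ≡⟨ cong ι (ℕ.*-identityˡ (toℕ x)) ⟩
        ι (toℕ x)         ≡⟨ ι-toℕ x ⟩
        x                 ∎

      *-distribˡ-+ : ∀ x y z → x *' (y +' z) ≡ (x *' y) +' (x *' z)
      *-distribˡ-+ x y z = begin
        x *' (y +' z)                       ≡⟨ cong (_*' (y +' z)) (sym (ι-toℕ x)) ⟩
        ι (toℕ x) *' ι (toℕ y ℕ.+ toℕ z)    ≡⟨ ι-* _ _ ⟩
        ι (toℕ x ℕ.* (toℕ y ℕ.+ toℕ z))     ≡⟨ cong ι (ℕ.*-distribˡ-+ (toℕ x) (toℕ y) (toℕ z)) ⟩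
        ι (toℕ x ℕ.* toℕ y ℕ.+ toℕ x ℕ.* toℕ z) ≡⟨ sym (ι-+ _ _) ⟩
        (x *' y) +' (x *' z)                ∎

      -‿inverseˡ : ∀ x → (-' x) +' x ≡ 0'
      -‿inverseˡ x = begin
        (-' x) +' x                ≡⟨ cong ((-' x) +'_) (sym (ι-toℕ x)) ⟩
        ι (p ℕ.∸ toℕ x) +' ι (toℕ x) ≡⟨ ι-+ _ _ ⟩
        ι (p ℕ.∸ toℕ x ℕ.+ toℕ x)    ≡⟨ cong ι (ℕ.m∸n+n≡m (ℕ.<⇒≤ (toℕ<n x))) ⟩
        ι p                        ≡⟨ ι-p ⟩
        0'                         ∎

  isCommutativeRing : IsCommutativeRing _≡_ _+'_ _*'_ -'_ 0' 1'
  isCommutativeRing = record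
    { isRing = record
      { +-isAbelianGroup = record
        { isGroup = record
          { isMonoid = record
            { isSemigroup = record
              { isMagma = record { isEquivalence = isEquivalence ; ∙-cong = cong₂ _+'_ }
              ; assoc = +-assoc }
            ; identity = +-identityˡ , λ x → trans (+-comm x 0') (+-identityˡ x) }
          ; inverse = -‿inverseˡ , λ x → trans (+-comm x (-' x)) (-‿inverseˡ x)
          ; ⁻¹-cong = cong -'_ }
        ; comm = +-comm }
      ; *-cong = cong₂ _*'_
      ; *-assoc = *-assoc
      ; *-identity = *-identityˡ , λ x → trans (*-comm x 1') (*-identityˡ x)
      ; distrib = *-distribˡ-+ , λ x y z →
          trans (*-comm (y +' z) x) (trans (*-distribˡ-+ x y z) (cong₂ _+'_ (*-comm x y) (*-comm x z))) }
    ; *-comm = *-comm }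
    where open Laws

  commutativeRing : CommutativeRing _ _
  commutativeRing = record { isCommutativeRing = isCommutativeRing }

  open CommutativeRing commutativeRing public
    using (+-comm; *-comm; +-identityˡ; +-identityʳ; *-identityˡ; *-identityʳ; zeroˡ; zeroʳ)

  ⟦_⟧ℤ : ℤ → F
  ⟦ + n ⟧ℤ     = ι n
  ⟦ -[1+ n ] ⟧ℤ = -' ι (suc n)

  -- ⟦_⟧ℤ is a ring morphism, which lets the ring solver use integer constants.
  private
    module Morphism where
      open CommutativeRing commutativeRing using (ring; +-abelianGroup; +-assoc; *-assoc; -‿inverseʳ)
      open import Algebra.Properties.Ring ring using (-1*x≈-x; -‿distribʳ-*)
      open import Algebra.Properties.AbelianGroup +-abelianGroup using (⁻¹-∙-comm; ε⁻¹≈ε; ⁻¹-involutive)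
      open ≡-Reasoning

      ⊖-hom : ∀ m n → ⟦ m ℤ.⊖ n ⟧ℤ ≡ ι m +' -' ι n
      ⊖-hom m zero = trans (cong ⟦_⟧ℤ (ℤ.⊖-≥ {m} {0} ℕ.z≤n))
        (sym (trans (cong (ι m +'_) ε⁻¹≈ε) (+-identityʳ (ι m))))
      ⊖-hom zero (suc n) = trans (cong ⟦_⟧ℤ (ℤ.⊖-< {0} {suc n} (ℕ.s≤s ℕ.z≤n))) (sym (+-identityˡ (-' ι (suc n))))
      ⊖-hom (suc m) (suc n) = begin
        ⟦ suc m ℤ.⊖ suc n ⟧ℤ                ≡⟨ cong ⟦_⟧ℤ (ℤ.[1+m]⊖[1+n]≡m⊖n m n) ⟩
        ⟦ m ℤ.⊖ n ⟧ℤ                        ≡⟨ ⊖-hom m n ⟩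
        ι m +' -' ι n                     ≡⟨ sym (cancel (ι 1) (ι m) (ι n)) ⟩
        (ι 1 +' ι m) +' -' (ι 1 +' ι n)   ≡⟨ cong₂ (λ a b → a +' -' b) (ι-+ 1 m) (ι-+ 1 n) ⟩
        ι (suc m) +' -' ι (suc n)         ∎
        where
        cancel : ∀ a b c → (a +' b) +' -' (a +' c) ≡ b +' -' c
        cancel a b c = begin
          (a +' b) +' -' (a +' c)      ≡⟨ cong ((a +' b) +'_) (sym (⁻¹-∙-comm a c)) ⟩
          (a +' b) +' (-' a +' -' c)   ≡⟨ +-assoc a b _ ⟩
          a +' (b +' (-' a +' -' c))   ≡⟨ cong (a +'_) (sym (+-assoc b (-' a) (-' c))) ⟩
          a +' ((b +' -' a) +' -' c)   ≡⟨ cong (λ w → a +' (w +' -' c)) (+-comm b (-' a)) ⟩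
          a +' ((-' a +' b) +' -' c)   ≡⟨ cong (a +'_) (+-assoc (-' a) b (-' c)) ⟩
          a +' (-' a +' (b +' -' c))   ≡⟨ sym (+-assoc a (-' a) _) ⟩
          (a +' -' a) +' (b +' -' c)   ≡⟨ cong (_+' (b +' -' c)) (-‿inverseʳ a) ⟩
          0' +' (b +' -' c)            ≡⟨ +-identityˡ _ ⟩
          b +' -' c                    ∎

      +-hom : ∀ i j → ⟦ i ℤ.+ j ⟧ℤ ≡ ⟦ i ⟧ℤ +' ⟦ j ⟧ℤ
      +-hom (+ m) (+ n) = sym (ι-+ m n)
      +-hom (+ m) -[1+ n ] = ⊖-hom m (suc n)
      +-hom -[1+ m ] (+ n) = trans (⊖-hom n (suc m)) (+-comm (ι n) (-' ι (suc m)))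
      +-hom -[1+ m ] -[1+ n ] = begin
        -' ι (suc (suc (m ℕ.+ n)))    ≡⟨ cong (λ k → -' ι (suc k)) (sym (ℕ.+-suc m n)) ⟩
        -' ι (suc m ℕ.+ suc n)        ≡⟨ cong -'_ (sym (ι-+ (suc m) (suc n))) ⟩
        -' (ι (suc m) +' ι (suc n))   ≡⟨ sym (⁻¹-∙-comm (ι (suc m)) (ι (suc n))) ⟩
        -' ι (suc m) +' -' ι (suc n)  ∎

      -‿hom : ∀ i → ⟦ ℤ.- i ⟧ℤ ≡ -' ⟦ i ⟧ℤ
      -‿hom (+ zero) = sym ε⁻¹≈ε
      -‿hom (+ suc n) = refl
      -‿hom -[1+ n ] = sym (⁻¹-involutive (ι (suc n)))

      ⟦_⟧ₛ : Sign → F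
      ⟦ Sign.+ ⟧ₛ = 1'
      ⟦ Sign.- ⟧ₛ = -' 1'

      ◃-hom : ∀ s n → ⟦ s ◃ n ⟧ℤ ≡ ⟦ s ⟧ₛ *' ι n
      ◃-hom s zero = sym (zeroʳ ⟦ s ⟧ₛ)
      ◃-hom Sign.+ (suc n) = sym (*-identityˡ (ι (suc n)))
      ◃-hom Sign.- (suc n) = sym (-1*x≈-x (ι (suc n)))

      sign-hom : ∀ s t → ⟦ s Sign.* t ⟧ₛ ≡ ⟦ s ⟧ₛ *' ⟦ t ⟧ₛ
      sign-hom Sign.+ Sign.+ = sym (*-identityˡ 1')
      sign-hom Sign.+ Sign.- = sym (*-identityˡ (-' 1'))
      sign-hom Sign.- Sign.+ = sym (*-identityʳ (-' 1'))
      sign-hom Sign.- Sign.- = begin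
        1'                 ≡⟨ sym (⁻¹-involutive 1') ⟩
        -' (-' 1')         ≡⟨ cong -'_ (sym (*-identityʳ (-' 1'))) ⟩
        -' (-' 1' *' 1')   ≡⟨ -‿distribʳ-* (-' 1') 1' ⟩
        -' 1' *' -' 1'     ∎

      *-hom : ∀ i j → ⟦ i ℤ.* j ⟧ℤ ≡ ⟦ i ⟧ℤ *' ⟦ j ⟧ℤ
      *-hom i j = begin
        ⟦ (sign i Sign.* sign j) ◃ (∣ i ∣ ℕ.* ∣ j ∣) ⟧ℤ
          ≡⟨ ◃-hom (sign i Sign.* sign j) (∣ i ∣ ℕ.* ∣ j ∣) ⟩
        ⟦ sign i Sign.* sign j ⟧ₛ *' ι (∣ i ∣ ℕ.* ∣ j ∣)
          ≡⟨ cong₂ _*'_ (sign-hom (sign i) (sign j)) (sym (ι-* ∣ i ∣ ∣ j ∣)) ⟩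
        (⟦ sign i ⟧ₛ *' ⟦ sign j ⟧ₛ) *' (ι ∣ i ∣ *' ι ∣ j ∣)
          ≡⟨ interchange ⟦ sign i ⟧ₛ ⟦ sign j ⟧ₛ (ι ∣ i ∣) (ι ∣ j ∣) ⟩
        (⟦ sign i ⟧ₛ *' ι ∣ i ∣) *' (⟦ sign j ⟧ₛ *' ι ∣ j ∣)
          ≡⟨ cong₂ _*'_ (sym (◃-hom (sign i) ∣ i ∣)) (sym (◃-hom (sign j) ∣ j ∣)) ⟩
        ⟦ sign i ◃ ∣ i ∣ ⟧ℤ *' ⟦ sign j ◃ ∣ j ∣ ⟧ℤ
          ≡⟨ cong₂ (λ a b → ⟦ a ⟧ℤ *' ⟦ b ⟧ℤ) (ℤ.◃-inverse i) (ℤ.◃-inverse j) ⟩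
        ⟦ i ⟧ℤ *' ⟦ j ⟧ℤ ∎
        where
        interchange : ∀ a b c d → (a *' b) *' (c *' d) ≡ (a *' c) *' (b *' d)
        interchange a b c d = begin
          (a *' b) *' (c *' d)   ≡⟨ *-assoc a b _ ⟩
          a *' (b *' (c *' d))   ≡⟨ cong (a *'_) (sym (*-assoc b c d)) ⟩
          a *' ((b *' c) *' d)   ≡⟨ cong (λ w → a *' (w *' d)) (*-comm b c) ⟩
          a *' ((c *' b) *' d)   ≡⟨ cong (a *'_) (*-assoc c b d) ⟩
          a *' (c *' (b *' d))   ≡⟨ sym (*-assoc a c _) ⟩
          (a *' c) *' (b *' d)   ∎

  private
    almostCommutativeRing : ACR.AlmostCommutativeRing _ _
    almostCommutativeRing = ACR.fromCommutativeRing commutativeRing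

    ⟦⟧-morphism : ACR._-Raw-AlmostCommutative⟶_ ℤ.+-*-rawRing almostCommutativeRing
    ⟦⟧-morphism = record
      { ⟦_⟧ = ⟦_⟧ℤ ; +-homo = +-hom ; *-homo = *-hom ; -‿homo = -‿hom
      ; 0-homo = refl ; 1-homo = refl }
      where open Morphism

    ⟦⟧-≟ : ∀ (i j : ℤ) → Maybe (⟦ i ⟧ℤ ≡ ⟦ j ⟧ℤ)
    ⟦⟧-≟ i j with i ℤ.≟ j
    ... | yes e = just (cong ⟦_⟧ℤ e)
    ... | no _  = nothing

  module Solver = Algebra.Solver.Ring ℤ.+-*-rawRing almostCommutativeRing ⟦⟧-morphism ⟦⟧-≟

module PrimeField (p : ℕ) .{{_ : NonZero p}} (prime : Prime p) where

  open ZMod p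
  open Solver
  open ≡-Reasoning

  private
    1<p : 1 ℕ.< p
    1<p = ℕ.nonTrivial⇒n>1 p {{prime⇒nonTrivial prime}}

    toℕ-0' : toℕ 0' ≡ 0
    toℕ-0' = trans (toℕ-ι 0) (m<n⇒m%n≡m (ℕ.>-nonZero⁻¹ p))

    ≡0'⇒toℕ≡0 : ∀ {x} → x ≡ 0' → toℕ x ≡ 0
    ≡0'⇒toℕ≡0 refl = toℕ-0'

    toℕ≡0⇒≡0' : ∀ {x} → toℕ x ≡ 0 → x ≡ 0'
    toℕ≡0⇒≡0' e = toℕ-injective (trans e (sym toℕ-0'))

    ∣⇒≡0 : ∀ {m} → m ℕ.< p → p ∣ m → m ≡ 0
    ∣⇒≡0 {zero} _ _ = refl
    ∣⇒≡0 {suc m} m<p p∣m = ⊥-elim (ℕ.<-irrefl refl (ℕ.<-≤-trans m<p (∣⇒≤ p∣m)))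

  1'≢0' : 1' ≢ 0'
  1'≢0' e with trans (sym (trans (toℕ-ι 1) (m<n⇒m%n≡m 1<p))) (≡0'⇒toℕ≡0 e)
  ... | ()

  *-≡0 : ∀ x y → x *' y ≡ 0' → x ≡ 0' ⊎ y ≡ 0'
  *-≡0 x y e with euclidsLemma (toℕ x) (toℕ y) prime
                    (m%n≡0⇒n∣m _ p (trans (sym (toℕ-ι (toℕ x ℕ.* toℕ y))) (≡0'⇒toℕ≡0 e)))
  ... | inj₁ p∣x = inj₁ (toℕ≡0⇒≡0' (∣⇒≡0 (toℕ<n x) p∣x))
  ... | inj₂ p∣y = inj₂ (toℕ≡0⇒≡0' (∣⇒≡0 (toℕ<n y) p∣y))

  *-≢0 : ∀ {x y} → x ≢ 0' → y ≢ 0' → x *' y ≢ 0'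
  *-≢0 {x} {y} x≢0 y≢0 e with *-≡0 x y e
  ... | inj₁ x≡0 = x≢0 x≡0
  ... | inj₂ y≡0 = y≢0 y≡0

  inverse : ∀ x → x ≢ 0' → Σ F λ y → x *' y ≡ 1'
  inverse x x≢0 with coprime-Bézout (prime⇒coprime prime {{ℕ.≢-nonZero (λ e → x≢0 (toℕ≡0⇒≡0' e))}} (toℕ<n x))
  ... | Bézout.+- a b eq = -' ι b , (begin
    x *' -' ι b                                 ≡⟨ solve 2 (λ X B → X :* (:- B) := con (+ 0) :- B :* X) refl x (ι b) ⟩
    0' +' -' (ι b *' x)                         ≡⟨ cong (λ w → w +' -' (ι b *' x)) (sym 1+bx≡0) ⟩
    (ι 1 +' ι b *' x) +' -' (ι b *' x)          ≡⟨ solve 2 (λ O Y → (O :+ Y) :- Y := O) refl (ι 1) (ι b *' x) ⟩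
    1'                                          ∎)
    where
    1+bx≡0 : ι 1 +' ι b *' x ≡ 0'
    1+bx≡0 = begin
      ι 1 +' ι b *' x           ≡⟨ cong (λ w → ι 1 +' ι b *' w) (sym (ι-toℕ x)) ⟩
      ι 1 +' ι b *' ι (toℕ x)   ≡⟨ cong (ι 1 +'_) (ι-* b (toℕ x)) ⟩
      ι 1 +' ι (b ℕ.* toℕ x)    ≡⟨ ι-+ 1 _ ⟩
      ι (1 ℕ.+ b ℕ.* toℕ x)     ≡⟨ cong ι eq ⟩
      ι (a ℕ.* p)               ≡⟨ ι-≡ _ _ (trans (m*n%n≡0 a p) (sym (m<n⇒m%n≡m (ℕ.>-nonZero⁻¹ p)))) ⟩
      0'                        ∎
  ... | Bézout.-+ a b eq = ι b , (begin
    x *' ι b              ≡⟨ *-comm x (ι b) ⟩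
    ι b *' x              ≡⟨ cong (ι b *'_) (sym (ι-toℕ x)) ⟩
    ι b *' ι (toℕ x)      ≡⟨ ι-* b (toℕ x) ⟩
    ι (b ℕ.* toℕ x)       ≡⟨ cong ι (sym eq) ⟩
    ι (1 ℕ.+ a ℕ.* p)     ≡⟨ ι-≡ _ 1 ([m+kn]%n≡m%n 1 a p) ⟩
    1'                    ∎)

  -- Junk value: 0' ⁻¹ = 0'.
  _⁻¹ : F → F
  x ⁻¹ with x ≟ 0'
  ... | yes _   = 0'
  ... | no x≢0 = proj₁ (inverse x x≢0)

  ⁻¹-inverseʳ : ∀ x → x ≢ 0' → x *' x ⁻¹ ≡ 1'
  ⁻¹-inverseʳ x x≢0 with x ≟ 0'
  ... | yes x≡0  = ⊥-elim (x≢0 x≡0)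
  ... | no x≢0′ = proj₂ (inverse x x≢0′)

  ⟦3⟧-inverse : ∀ i3 → (3 ℕ.* toℕ i3) % p ≡ 1 → ⟦ + 3 ⟧ℤ *' i3 ≡ 1'
  ⟦3⟧-inverse i3 h = begin
    ι 3 *' i3             ≡⟨ cong (ι 3 *'_) (sym (ι-toℕ i3)) ⟩
    ι 3 *' ι (toℕ i3)     ≡⟨ ι-* 3 (toℕ i3) ⟩
    ι (3 ℕ.* toℕ i3)      ≡⟨ ι-≡ _ _ (trans h (sym (m<n⇒m%n≡m 1<p))) ⟩
    1'                    ∎

module AffineCounts (p : ℕ) .{{_ : NonZero p}} (prime : Prime p) where

  open Sums
  open ZMod p
  open PrimeField p prime
  open Solver
  open ≡-Reasoning

  ∑ : (F → ℚ) → ℚ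
  ∑ = sumFin {p}

  p^_ : ℕ → ℚ
  p^ zero = 1ℚ
  p^ suc n = pℚ p ⊛ p^ n

  ∑-const : ∀ c → ∑ (λ _ → c) ≡ pℚ p ⊛ c
  ∑-const = sumFin-const {p}

  count₁-≢0 : ∀ α β t → α ≢ 0' → ∑ (λ y → 𝟙 (α *' y +' β ≟ t)) ≡ 1ℚ
  count₁-≢0 α β t α≢0 = begin
    ∑ (λ y → 𝟙 (α *' y +' β ≟ t))  ≡⟨ sumFin-cong (λ y → trans (𝟙-cong (solved y) (solves y) (α *' y +' β ≟ t) (y ≟ y₀))
                                                             (sym (ℚ.*-identityʳ (𝟙 (y ≟ y₀))))) ⟩
    ∑ (λ y → 𝟙 (y ≟ y₀) ⊛ 1ℚ)      ≡⟨ sumFin-𝟙≟ y₀ (λ _ → 1ℚ) ⟩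
    1ℚ                             ∎
    where
    α⁻¹α : α *' α ⁻¹ ≡ 1'
    α⁻¹α = ⁻¹-inverseʳ α α≢0
    y₀ = α ⁻¹ *' (t +' -' β)
    solved : ∀ y → α *' y +' β ≡ t → y ≡ y₀
    solved y e = begin
      y                              ≡⟨ solve 1 (λ y → y := con (+ 1) :* y) refl y ⟩
      1' *' y                        ≡⟨ cong (_*' y) (sym α⁻¹α) ⟩
      (α *' α ⁻¹) *' y               ≡⟨ solve 4 (λ a i y b → (a :* i) :* y := i :* ((a :* y :+ b) :- b)) refl α (α ⁻¹) y β ⟩
      α ⁻¹ *' ((α *' y +' β) +' -' β) ≡⟨ cong (λ w → α ⁻¹ *' (w +' -' β)) e ⟩
      y₀                             ∎
    solves : ∀ y → y ≡ y₀ → α *' y +' β ≡ t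
    solves y refl = begin
      α *' (α ⁻¹ *' (t +' -' β)) +' β   ≡⟨ solve 4 (λ a i t b → a :* (i :* (t :- b)) :+ b := (a :* i) :* (t :- b) :+ b) refl α (α ⁻¹) t β ⟩
      (α *' α ⁻¹) *' (t +' -' β) +' β   ≡⟨ cong (λ w → w *' (t +' -' β) +' β) α⁻¹α ⟩
      1' *' (t +' -' β) +' β            ≡⟨ solve 2 (λ t b → con (+ 1) :* (t :- b) :+ b := t) refl t β ⟩
      t                                 ∎

  count₁-≡0 : ∀ α β t → α ≡ 0' → ∑ (λ y → 𝟙 (α *' y +' β ≟ t)) ≡ pℚ p ⊛ 𝟙 (β ≟ t)
  count₁-≡0 α β t refl = trans (sumFin-cong (λ y → cong (λ w → 𝟙 (w ≟ t)) (solve 2 (λ y b → con (+ 0) :* y :+ b := b) refl y β)))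
                               (∑-const (𝟙 (β ≟ t)))

  -- Sum out the variables from the last one: a variable with coefficient 0
  -- contributes a factor p, and the first one met with a nonzero coefficient is
  -- determined by the remaining ones, which are then free.
  private
    step : ∀ {a} {A : Set a} → Dec A → ℚ → ℚ → ℚ
    step d x c = if does d then pℚ p ⊛ x else c

    ∑-step : ∀ {a} {A : Set a} (d : Dec A) (X : F → ℚ) c → ∑ (λ y → step d (X y) c) ≡ step d (∑ X) (pℚ p ⊛ c)
    ∑-step (yes _) X c = sumFin-* (pℚ p) X
    ∑-step (no _)  X c = ∑-const c

    count₁ : ∀ α β t → ∑ (λ y → 𝟙 (α *' y +' β ≟ t)) ≡ step (α ≟ 0') (𝟙 (β ≟ t)) 1ℚ
    count₁ α β t with α ≟ 0'
    ... | yes α≡0 = count₁-≡0 α β t α≡0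
    ... | no α≢0  = count₁-≢0 α β t α≢0

    count₂ : ∀ α₁ α₂ β t → ∑ (λ y₁ → ∑ (λ y₂ → 𝟙 (α₁ *' y₁ +' α₂ *' y₂ +' β ≟ t)))
                           ≡ step (α₂ ≟ 0') (step (α₁ ≟ 0') (𝟙 (β ≟ t)) 1ℚ) (p^ 1)
    count₂ α₁ α₂ β t = begin
      ∑ (λ y₁ → ∑ (λ y₂ → 𝟙 (α₁ *' y₁ +' α₂ *' y₂ +' β ≟ t)))
        ≡⟨ sumFin-cong (λ y₁ → trans (sumFin-cong (λ y₂ → cong (λ w → 𝟙 (w ≟ t)) (shuffle y₁ y₂))) (count₁ α₂ (α₁ *' y₁ +' β) t)) ⟩
      ∑ (λ y₁ → step (α₂ ≟ 0') (𝟙 (α₁ *' y₁ +' β ≟ t)) 1ℚ)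
        ≡⟨ ∑-step (α₂ ≟ 0') (λ y₁ → 𝟙 (α₁ *' y₁ +' β ≟ t)) 1ℚ ⟩
      step (α₂ ≟ 0') (∑ (λ y₁ → 𝟙 (α₁ *' y₁ +' β ≟ t))) (p^ 1)
        ≡⟨ cong (λ w → step (α₂ ≟ 0') w (p^ 1)) (count₁ α₁ β t) ⟩
      step (α₂ ≟ 0') (step (α₁ ≟ 0') (𝟙 (β ≟ t)) 1ℚ) (p^ 1) ∎
      where
      shuffle : ∀ y₁ y₂ → α₁ *' y₁ +' α₂ *' y₂ +' β ≡ α₂ *' y₂ +' (α₁ *' y₁ +' β)
      shuffle y₁ y₂ = solve 5 (λ a b x y c → a :* x :+ b :* y :+ c := b :* y :+ (a :* x :+ c)) refl α₁ α₂ y₁ y₂ β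

    count₃ : ∀ α₁ α₂ α₃ β t → ∑ (λ y₁ → ∑ (λ y₂ → ∑ (λ y₃ → 𝟙 (α₁ *' y₁ +' α₂ *' y₂ +' α₃ *' y₃ +' β ≟ t))))
                              ≡ step (α₃ ≟ 0') (step (α₂ ≟ 0') (step (α₁ ≟ 0') (𝟙 (β ≟ t)) 1ℚ) (p^ 1)) (p^ 2)
    count₃ α₁ α₂ α₃ β t = begin
      ∑ (λ y₁ → ∑ (λ y₂ → ∑ (λ y₃ → 𝟙 (α₁ *' y₁ +' α₂ *' y₂ +' α₃ *' y₃ +' β ≟ t))))
        ≡⟨ sumFin-cong (λ y₁ → trans (sumFin-cong (λ y₂ → trans (sumFin-cong (λ y₃ → cong (λ w → 𝟙 (w ≟ t)) (shuffle y₁ y₂ y₃)))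
                                                                 (count₁ α₃ (α₁ *' y₁ +' α₂ *' y₂ +' β) t)))
                                     (∑-step (α₃ ≟ 0') (λ y₂ → 𝟙 (α₁ *' y₁ +' α₂ *' y₂ +' β ≟ t)) 1ℚ)) ⟩
      ∑ (λ y₁ → step (α₃ ≟ 0') (∑ (λ y₂ → 𝟙 (α₁ *' y₁ +' α₂ *' y₂ +' β ≟ t))) (p^ 1))
        ≡⟨ ∑-step (α₃ ≟ 0') (λ y₁ → ∑ (λ y₂ → 𝟙 (α₁ *' y₁ +' α₂ *' y₂ +' β ≟ t))) (p^ 1) ⟩
      step (α₃ ≟ 0') (∑ (λ y₁ → ∑ (λ y₂ → 𝟙 (α₁ *' y₁ +' α₂ *' y₂ +' β ≟ t)))) (p^ 2)
        ≡⟨ cong (λ w → step (α₃ ≟ 0') w (p^ 2)) (count₂ α₁ α₂ β t) ⟩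
      step (α₃ ≟ 0') (step (α₂ ≟ 0') (step (α₁ ≟ 0') (𝟙 (β ≟ t)) 1ℚ) (p^ 1)) (p^ 2) ∎
      where
      shuffle : ∀ y₁ y₂ y₃ → α₁ *' y₁ +' α₂ *' y₂ +' α₃ *' y₃ +' β ≡ α₃ *' y₃ +' (α₁ *' y₁ +' α₂ *' y₂ +' β)
      shuffle y₁ y₂ y₃ = solve 7 (λ a b c x y z d → a :* x :+ b :* y :+ c :* z :+ d := c :* z :+ (a :* x :+ b :* y :+ d))
                                refl α₁ α₂ α₃ y₁ y₂ y₃ β

    count₄ : ∀ α₁ α₂ α₃ α₄ β t →
      ∑ (λ y₁ → ∑ (λ y₂ → ∑ (λ y₃ → ∑ (λ y₄ → 𝟙 (α₁ *' y₁ +' α₂ *' y₂ +' α₃ *' y₃ +' α₄ *' y₄ +' β ≟ t)))))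
        ≡ step (α₄ ≟ 0') (step (α₃ ≟ 0') (step (α₂ ≟ 0') (step (α₁ ≟ 0') (𝟙 (β ≟ t)) 1ℚ) (p^ 1)) (p^ 2)) (p^ 3)
    count₄ α₁ α₂ α₃ α₄ β t = begin
      ∑ (λ y₁ → ∑ (λ y₂ → ∑ (λ y₃ → ∑ (λ y₄ → 𝟙 (α₁ *' y₁ +' α₂ *' y₂ +' α₃ *' y₃ +' α₄ *' y₄ +' β ≟ t)))))
        ≡⟨ sumFin-cong (λ y₁ → trans (sumFin-cong (λ y₂ → inner y₁ y₂))
                                     (∑-step (α₄ ≟ 0') (λ y₂ → ∑ (λ y₃ → E y₁ y₂ y₃)) (p^ 1))) ⟩
      ∑ (λ y₁ → step (α₄ ≟ 0') (∑ (λ y₂ → ∑ (λ y₃ → E y₁ y₂ y₃))) (p^ 2))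
        ≡⟨ ∑-step (α₄ ≟ 0') (λ y₁ → ∑ (λ y₂ → ∑ (λ y₃ → E y₁ y₂ y₃))) (p^ 2) ⟩
      step (α₄ ≟ 0') (∑ (λ y₁ → ∑ (λ y₂ → ∑ (λ y₃ → E y₁ y₂ y₃)))) (p^ 3)
        ≡⟨ cong (λ w → step (α₄ ≟ 0') w (p^ 3)) (count₃ α₁ α₂ α₃ β t) ⟩
      step (α₄ ≟ 0') (step (α₃ ≟ 0') (step (α₂ ≟ 0') (step (α₁ ≟ 0') (𝟙 (β ≟ t)) 1ℚ) (p^ 1)) (p^ 2)) (p^ 3) ∎
      where
      E : F → F → F → ℚ
      E y₁ y₂ y₃ = 𝟙 (α₁ *' y₁ +' α₂ *' y₂ +' α₃ *' y₃ +' β ≟ t)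
      shuffle : ∀ y₁ y₂ y₃ y₄ → α₁ *' y₁ +' α₂ *' y₂ +' α₃ *' y₃ +' α₄ *' y₄ +' β
                               ≡ α₄ *' y₄ +' (α₁ *' y₁ +' α₂ *' y₂ +' α₃ *' y₃ +' β)
      shuffle y₁ y₂ y₃ y₄ = solve 9 (λ a b c e x y z w d → a :* x :+ b :* y :+ c :* z :+ e :* w :+ d
                                                         := e :* w :+ (a :* x :+ b :* y :+ c :* z :+ d))
                                   refl α₁ α₂ α₃ α₄ y₁ y₂ y₃ y₄ β
      inner : ∀ y₁ y₂ → ∑ (λ y₃ → ∑ (λ y₄ → 𝟙 (α₁ *' y₁ +' α₂ *' y₂ +' α₃ *' y₃ +' α₄ *' y₄ +' β ≟ t)))
                        ≡ step (α₄ ≟ 0') (∑ (λ y₃ → E y₁ y₂ y₃)) (p^ 1)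
      inner y₁ y₂ = trans (sumFin-cong (λ y₃ → trans (sumFin-cong (λ y₄ → cong (λ w → 𝟙 (w ≟ t)) (shuffle y₁ y₂ y₃ y₄)))
                                                     (count₁ α₄ (α₁ *' y₁ +' α₂ *' y₂ +' α₃ *' y₃ +' β) t)))
                          (∑-step (α₄ ≟ 0') (E y₁ y₂) 1ℚ)

  count₃-≢0 : ∀ α₁ α₂ α₃ β t → ¬ (α₁ ≡ 0' × α₂ ≡ 0' × α₃ ≡ 0') →
    ∑ (λ y₁ → ∑ (λ y₂ → ∑ (λ y₃ → 𝟙 (α₁ *' y₁ +' α₂ *' y₂ +' α₃ *' y₃ +' β ≟ t)))) ≡ p^ 2
  count₃-≢0 α₁ α₂ α₃ β t ¬α≡0 = trans (count₃ α₁ α₂ α₃ β t) (evaluate (α₃ ≟ 0') (α₂ ≟ 0') (α₁ ≟ 0'))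
    where
    evaluate : (d₃ : Dec (α₃ ≡ 0')) (d₂ : Dec (α₂ ≡ 0')) (d₁ : Dec (α₁ ≡ 0')) → step d₃ (step d₂ (step d₁ (𝟙 (β ≟ t)) 1ℚ) (p^ 1)) (p^ 2) ≡ p^ 2
    evaluate (no _)   _        _        = refl
    evaluate (yes _)  (no _)   _        = refl
    evaluate (yes _)  (yes _)  (no _)   = refl
    evaluate (yes e₃) (yes e₂) (yes e₁) = ⊥-elim (¬α≡0 (e₁ , e₂ , e₃))

  count₃-≡0 : ∀ α₁ α₂ α₃ β t → α₁ ≡ 0' → α₂ ≡ 0' → α₃ ≡ 0' →
    ∑ (λ y₁ → ∑ (λ y₂ → ∑ (λ y₃ → 𝟙 (α₁ *' y₁ +' α₂ *' y₂ +' α₃ *' y₃ +' β ≟ t)))) ≡ pℚ p ⊛ (pℚ p ⊛ (pℚ p ⊛ 𝟙 (β ≟ t)))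
  count₃-≡0 α₁ α₂ α₃ β t e₁ e₂ e₃ = trans (count₃ α₁ α₂ α₃ β t) (evaluate (α₃ ≟ 0') (α₂ ≟ 0') (α₁ ≟ 0'))
    where
    evaluate : (d₃ : Dec (α₃ ≡ 0')) (d₂ : Dec (α₂ ≡ 0')) (d₁ : Dec (α₁ ≡ 0')) →
               step d₃ (step d₂ (step d₁ (𝟙 (β ≟ t)) 1ℚ) (p^ 1)) (p^ 2) ≡ pℚ p ⊛ (pℚ p ⊛ (pℚ p ⊛ 𝟙 (β ≟ t)))
    evaluate (yes _) (yes _) (yes _) = refl
    evaluate (no ¬e₃) _ _ = ⊥-elim (¬e₃ e₃)
    evaluate (yes _) (no ¬e₂) _ = ⊥-elim (¬e₂ e₂)
    evaluate (yes _) (yes _) (no ¬e₁) = ⊥-elim (¬e₁ e₁)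

  count₄-≢0 : ∀ α₁ α₂ α₃ α₄ β t → ¬ (α₁ ≡ 0' × α₂ ≡ 0' × α₃ ≡ 0' × α₄ ≡ 0') →
    ∑ (λ y₁ → ∑ (λ y₂ → ∑ (λ y₃ → ∑ (λ y₄ → 𝟙 (α₁ *' y₁ +' α₂ *' y₂ +' α₃ *' y₃ +' α₄ *' y₄ +' β ≟ t))))) ≡ p^ 3
  count₄-≢0 α₁ α₂ α₃ α₄ β t ¬α≡0 = trans (count₄ α₁ α₂ α₃ α₄ β t) (evaluate (α₄ ≟ 0') (α₃ ≟ 0') (α₂ ≟ 0') (α₁ ≟ 0'))
    where
    evaluate : (d₄ : Dec (α₄ ≡ 0')) (d₃ : Dec (α₃ ≡ 0')) (d₂ : Dec (α₂ ≡ 0')) (d₁ : Dec (α₁ ≡ 0')) →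
                step d₄ (step d₃ (step d₂ (step d₁ (𝟙 (β ≟ t)) 1ℚ) (p^ 1)) (p^ 2)) (p^ 3) ≡ p^ 3
    evaluate (no _)   _        _        _        = refl
    evaluate (yes _)  (no _)   _        _        = refl
    evaluate (yes _)  (yes _)  (no _)   _        = refl
    evaluate (yes _)  (yes _)  (yes _)  (no _)   = refl
    evaluate (yes e₄) (yes e₃) (yes e₂) (yes e₁) = ⊥-elim (¬α≡0 (e₁ , e₂ , e₃ , e₄))

  count₄-≡0 : ∀ α₁ α₂ α₃ α₄ β t → α₁ ≡ 0' → α₂ ≡ 0' → α₃ ≡ 0' → α₄ ≡ 0' →
    ∑ (λ y₁ → ∑ (λ y₂ → ∑ (λ y₃ → ∑ (λ y₄ → 𝟙 (α₁ *' y₁ +' α₂ *' y₂ +' α₃ *' y₃ +' α₄ *' y₄ +' β ≟ t)))))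
      ≡ pℚ p ⊛ (pℚ p ⊛ (pℚ p ⊛ (pℚ p ⊛ 𝟙 (β ≟ t))))
  count₄-≡0 α₁ α₂ α₃ α₄ β t e₁ e₂ e₃ e₄ = trans (count₄ α₁ α₂ α₃ α₄ β t) (evaluate (α₄ ≟ 0') (α₃ ≟ 0') (α₂ ≟ 0') (α₁ ≟ 0'))
    where
    evaluate : (d₄ : Dec (α₄ ≡ 0')) (d₃ : Dec (α₃ ≡ 0')) (d₂ : Dec (α₂ ≡ 0')) (d₁ : Dec (α₁ ≡ 0')) →
                step d₄ (step d₃ (step d₂ (step d₁ (𝟙 (β ≟ t)) 1ℚ) (p^ 1)) (p^ 2)) (p^ 3)
                  ≡ pℚ p ⊛ (pℚ p ⊛ (pℚ p ⊛ (pℚ p ⊛ 𝟙 (β ≟ t))))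
    evaluate (yes _)  (yes _)  (yes _)  (yes _)  = refl
    evaluate (no ¬e₄) _        _        _        = ⊥-elim (¬e₄ e₄)
    evaluate (yes _)  (no ¬e₃) _        _        = ⊥-elim (¬e₃ e₃)
    evaluate (yes _)  (yes _)  (no ¬e₂) _        = ⊥-elim (¬e₂ e₂)
    evaluate (yes _)  (yes _)  (yes _)  (no ¬e₁) = ⊥-elim (¬e₁ e₁)

module ProjectiveLine (p : ℕ) .{{_ : NonZero p}} (prime : Prime p) where

  open Sums
  open ZMod p
  open PrimeField p prime
  open AffineCounts p prime using (∑; ∑-const)
  open Solver
  open ≡-Reasoning

  data ℙ¹ : Set where
    fin : F → ℙ¹
    ∞   : ℙ¹

  fin-injective : ∀ {x y} → fin x ≡ fin y → x ≡ y
  fin-injective refl = refl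

  _≟ℙ_ : (P Q : ℙ¹) → Dec (P ≡ Q)
  fin x ≟ℙ fin y = map′ (cong fin) fin-injective (x ≟ y)
  fin x ≟ℙ ∞     = no λ ()
  ∞     ≟ℙ fin y = no λ ()
  ∞     ≟ℙ ∞     = yes refl

  ∑ℙ : (ℙ¹ → ℚ) → ℚ
  ∑ℙ g = ∑ (λ x → g (fin x)) ⊕ g ∞

  ∑ℙ-cong : ∀ {f g : ℙ¹ → ℚ} → (∀ P → f P ≡ g P) → ∑ℙ f ≡ ∑ℙ g
  ∑ℙ-cong e = cong₂ _⊕_ (sumFin-cong (λ x → e (fin x))) (e ∞)

  ∑ℙ-+ : ∀ (f g : ℙ¹ → ℚ) → ∑ℙ (λ P → f P ⊕ g P) ≡ ∑ℙ f ⊕ ∑ℙ g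
  ∑ℙ-+ f g = begin
    ∑ (λ x → f (fin x) ⊕ g (fin x)) ⊕ (f ∞ ⊕ g ∞)            ≡⟨ cong (_⊕ (f ∞ ⊕ g ∞)) (sumFin-+ (λ x → f (fin x)) (λ x → g (fin x))) ⟩
    (∑ (λ x → f (fin x)) ⊕ ∑ (λ x → g (fin x))) ⊕ (f ∞ ⊕ g ∞) ≡⟨ ⊕-interchange (∑ (λ x → f (fin x))) (∑ (λ x → g (fin x))) (f ∞) (g ∞) ⟩
    ∑ℙ f ⊕ ∑ℙ g                                               ∎

  ∑ℙ-* : ∀ c (f : ℙ¹ → ℚ) → ∑ℙ (λ P → c ⊛ f P) ≡ c ⊛ ∑ℙ f
  ∑ℙ-* c f = trans (cong (_⊕ (c ⊛ f ∞)) (sumFin-* c (λ x → f (fin x))))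
                   (sym (proj₁ ℚ.*-distrib-+ c (∑ (λ x → f (fin x))) (f ∞)))

  ∑ℙ-const : ∀ c → ∑ℙ (λ _ → c) ≡ (pℚ p ⊕ 1ℚ) ⊛ c
  ∑ℙ-const c = begin
    ∑ (λ _ → c) ⊕ c      ≡⟨ cong (_⊕ c) (∑-const c) ⟩
    pℚ p ⊛ c ⊕ c         ≡⟨ cong (pℚ p ⊛ c ⊕_) (sym (ℚ.*-identityˡ c)) ⟩
    pℚ p ⊛ c ⊕ 1ℚ ⊛ c    ≡⟨ sym (ℚ.*-distribʳ-+ c (pℚ p) 1ℚ) ⟩
    (pℚ p ⊕ 1ℚ) ⊛ c      ∎

  ∑ℙ-0 : ∑ℙ (λ _ → 0ℚ) ≡ 0ℚ
  ∑ℙ-0 = trans (∑ℙ-const 0ℚ) (ℚ.*-zeroʳ (pℚ p ⊕ 1ℚ))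

  ∑ℙ-𝟙≟ : ∀ Q (g : ℙ¹ → ℚ) → ∑ℙ (λ P → 𝟙 (P ≟ℙ Q) ⊛ g P) ≡ g Q
  ∑ℙ-𝟙≟ (fin y) g = begin
    ∑ (λ x → 𝟙 (x ≟ y) ⊛ g (fin x)) ⊕ 0ℚ ⊛ g ∞ ≡⟨ cong₂ _⊕_ (sumFin-𝟙≟ y (λ x → g (fin x))) (ℚ.*-zeroˡ (g ∞)) ⟩
    g (fin y) ⊕ 0ℚ                              ≡⟨ ℚ.+-identityʳ (g (fin y)) ⟩
    g (fin y)                                   ∎
  ∑ℙ-𝟙≟ ∞ g = begin
    ∑ (λ x → 0ℚ ⊛ g (fin x)) ⊕ 1ℚ ⊛ g ∞  ≡⟨ cong₂ _⊕_ (trans (sumFin-cong (λ x → ℚ.*-zeroˡ (g (fin x)))) (sumFin-0 {p}))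
                                                      (ℚ.*-identityˡ (g ∞)) ⟩
    0ℚ ⊕ g ∞                             ≡⟨ ℚ.+-identityˡ (g ∞) ⟩
    g ∞                                  ∎

  -- A form is evaluated at fin x as at (x, 1) and differentiated in x there;
  -- at ∞ it is evaluated at (1, 0) and differentiated in y.
  valL derL : ℙ¹ → Lin p → F
  valL (fin x) (lin u v) = u *' x +' v
  valL ∞       (lin u v) = u
  derL (fin x) (lin u v) = u
  derL ∞       (lin u v) = v

  valQ derQ : ℙ¹ → Quad p → F
  valQ (fin x) (quad r s t) = r *' x *' x +' s *' x +' t
  valQ ∞       (quad r s t) = r
  derQ (fin x) (quad r s t) = ⟦ + 2 ⟧ℤ *' r *' x +' s
  derQ ∞       (quad r s t) = s

  valC derC : ℙ¹ → Cubic p → F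
  valC (fin x) (cubic a b c d) = a *' x *' x *' x +' b *' x *' x +' c *' x +' d
  valC ∞       (cubic a b c d) = a
  derC (fin x) (cubic a b c d) = ⟦ + 3 ⟧ℤ *' a *' x *' x +' ⟦ + 2 ⟧ℤ *' b *' x +' c
  derC ∞       (cubic a b c d) = b

  valQ-mulLL : ∀ P L₁ L₂ → valQ P (mulLL p L₁ L₂) ≡ valL P L₁ *' valL P L₂
  valQ-mulLL (fin x) (lin u₁ v₁) (lin u₂ v₂) =
    solve 5 (λ x u₁ v₁ u₂ v₂ → (u₁ :* u₂) :* x :* x :+ (u₁ :* v₂ :+ v₁ :* u₂) :* x :+ v₁ :* v₂ := (u₁ :* x :+ v₁) :* (u₂ :* x :+ v₂))
            refl x u₁ v₁ u₂ v₂
  valQ-mulLL ∞ (lin u₁ v₁) (lin u₂ v₂) = refl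

  derQ-mulLL : ∀ P L₁ L₂ → derQ P (mulLL p L₁ L₂) ≡ derL P L₁ *' valL P L₂ +' valL P L₁ *' derL P L₂
  derQ-mulLL (fin x) (lin u₁ v₁) (lin u₂ v₂) =
    solve 5 (λ x u₁ v₁ u₂ v₂ → con (+ 2) :* (u₁ :* u₂) :* x :+ (u₁ :* v₂ :+ v₁ :* u₂) := u₁ :* (u₂ :* x :+ v₂) :+ (u₁ :* x :+ v₁) :* u₂)
            refl x u₁ v₁ u₂ v₂
  derQ-mulLL ∞ (lin u₁ v₁) (lin u₂ v₂) = solve 4 (λ u₁ v₁ u₂ v₂ → u₁ :* v₂ :+ v₁ :* u₂ := v₁ :* u₂ :+ u₁ :* v₂) refl u₁ v₁ u₂ v₂

  valC-mulLQ : ∀ P L Q → valC P (mulLQ p L Q) ≡ valL P L *' valQ P Q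
  valC-mulLQ (fin x) (lin u v) (quad r s t) =
    solve 6 (λ x u v r s t → (u :* r) :* x :* x :* x :+ (u :* s :+ v :* r) :* x :* x :+ (u :* t :+ v :* s) :* x :+ v :* t
                             := (u :* x :+ v) :* (r :* x :* x :+ s :* x :+ t)) refl x u v r s t
  valC-mulLQ ∞ (lin u v) (quad r s t) = refl

  derC-mulLQ : ∀ P L Q → derC P (mulLQ p L Q) ≡ derL P L *' valQ P Q +' valL P L *' derQ P Q
  derC-mulLQ (fin x) (lin u v) (quad r s t) =
    solve 6 (λ x u v r s t → con (+ 3) :* (u :* r) :* x :* x :+ con (+ 2) :* (u :* s :+ v :* r) :* x :+ (u :* t :+ v :* s)
                             := u :* (r :* x :* x :+ s :* x :+ t) :+ (u :* x :+ v) :* (con (+ 2) :* r :* x :+ s)) refl x u v r s t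
  derC-mulLQ ∞ (lin u v) (quad r s t) = solve 4 (λ u v r s → u :* s :+ v :* r := v :* r :+ u :* s) refl u v r s

  vanishingAt : ℙ¹ → Lin p
  vanishingAt (fin x) = lin 1' (-' x)
  vanishingAt ∞       = lin 0' 1'

  vanishingAt-nonzero : ∀ P → NonzeroLin p (vanishingAt P)
  vanishingAt-nonzero (fin x) (e , _) = 1'≢0' e
  vanishingAt-nonzero ∞       (_ , e) = 1'≢0' e

  root : Lin p → ℙ¹
  root (lin u v) with u ≟ 0'
  ... | yes _ = ∞
  ... | no _  = fin (-' v *' u ⁻¹)

  private
    u≡0⇒v≡0 : ∀ {u v} x → u *' x +' v ≡ 0' → u ≡ 0' → v ≡ 0'
    u≡0⇒v≡0 {u} {v} x e refl = trans (solve 2 (λ x v → v := con (+ 0) :* x :+ v) refl x v) e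

  root-vanishes : ∀ L → NonzeroLin p L → valL (root L) L ≡ 0'
  root-vanishes (lin u v) L≢0 with u ≟ 0'
  ... | yes u≡0 = u≡0
  ... | no u≢0  = begin
    u *' (-' v *' u ⁻¹) +' v       ≡⟨ solve 3 (λ u v i → u :* (:- v :* i) :+ v := v :- (u :* i) :* v) refl u v (u ⁻¹) ⟩
    v +' -' ((u *' u ⁻¹) *' v)     ≡⟨ cong (λ w → v +' -' (w *' v)) (⁻¹-inverseʳ u u≢0) ⟩
    v +' -' (1' *' v)              ≡⟨ solve 1 (λ v → v :- con (+ 1) :* v := con (+ 0)) refl v ⟩
    0'                             ∎

  vanishes⇒≡root : ∀ L → NonzeroLin p L → ∀ P → valL P L ≡ 0' → P ≡ root L
  vanishes⇒≡root (lin u v) L≢0 P e with u ≟ 0'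
  vanishes⇒≡root (lin u v) L≢0 (fin x) e | yes u≡0 = ⊥-elim (L≢0 (u≡0 , u≡0⇒v≡0 x e u≡0))
  vanishes⇒≡root (lin u v) L≢0 ∞       e | yes u≡0 = refl
  vanishes⇒≡root (lin u v) L≢0 ∞       e | no u≢0  = ⊥-elim (u≢0 e)
  vanishes⇒≡root (lin u v) L≢0 (fin x) e | no u≢0  = cong fin (begin
    x                                  ≡⟨ solve 1 (λ x → x := con (+ 1) :* x) refl x ⟩
    1' *' x                            ≡⟨ cong (_*' x) (sym (⁻¹-inverseʳ u u≢0)) ⟩
    (u *' u ⁻¹) *' x                   ≡⟨ solve 4 (λ u i x v → (u :* i) :* x := :- (v :- (u :* x :+ v)) :* i) refl u (u ⁻¹) x v ⟩
    -' (v +' -' (u *' x +' v)) *' u ⁻¹ ≡⟨ cong (λ w → -' (v +' -' w) *' u ⁻¹) e ⟩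
    -' (v +' -' 0') *' u ⁻¹            ≡⟨ solve 2 (λ v i → :- (v :- con (+ 0)) :* i := :- v :* i) refl v (u ⁻¹) ⟩
    -' v *' u ⁻¹                       ∎)

  ∑ℙ-roots-lin : ∀ L → NonzeroLin p L → ∑ℙ (λ P → 𝟙 (valL P L ≟ 0')) ≡ 1ℚ
  ∑ℙ-roots-lin L L≢0 = begin
    ∑ℙ (λ P → 𝟙 (valL P L ≟ 0'))         ≡⟨ ∑ℙ-cong (λ P → trans (𝟙-cong (vanishes⇒≡root L L≢0 P) (λ { refl → root-vanishes L L≢0 })
                                                                            (valL P L ≟ 0') (P ≟ℙ root L))
                                                                    (sym (ℚ.*-identityʳ _))) ⟩
    ∑ℙ (λ P → 𝟙 (P ≟ℙ root L) ⊛ 1ℚ)      ≡⟨ ∑ℙ-𝟙≟ (root L) (λ _ → 1ℚ) ⟩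
    1ℚ                                   ∎

  derL≢0-at-root : ∀ L → NonzeroLin p L → ∀ P → valL P L ≡ 0' → derL P L ≢ 0'
  derL≢0-at-root (lin u v) L≢0 (fin x) e u≡0 = L≢0 (u≡0 , u≡0⇒v≡0 x e u≡0)
  derL≢0-at-root (lin u v) L≢0 ∞       e v≡0 = L≢0 (e , v≡0)

  common-root⇒Prop : ∀ L₁ L₂ P → valL P L₁ ≡ 0' → valL P L₂ ≡ 0' → Prop p L₁ L₂
  common-root⇒Prop (lin u₁ v₁) (lin u₂ v₂) (fin x) e₁ e₂ = begin
    u₁ *' v₂
      ≡⟨ solve 5 (λ u₁ v₁ u₂ v₂ x → u₁ :* v₂ := u₁ :* (u₂ :* x :+ v₂) :- u₂ :* (u₁ :* x :+ v₁) :+ u₂ :* v₁) refl u₁ v₁ u₂ v₂ x ⟩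
    u₁ *' (u₂ *' x +' v₂) +' -' (u₂ *' (u₁ *' x +' v₁)) +' u₂ *' v₁
      ≡⟨ cong₂ (λ a b → u₁ *' a +' -' (u₂ *' b) +' u₂ *' v₁) e₂ e₁ ⟩
    u₁ *' 0' +' -' (u₂ *' 0') +' u₂ *' v₁
      ≡⟨ solve 3 (λ u₁ u₂ w → u₁ :* con (+ 0) :- u₂ :* con (+ 0) :+ w := w) refl u₁ u₂ (u₂ *' v₁) ⟩
    u₂ *' v₁ ∎
  common-root⇒Prop (lin u₁ v₁) (lin u₂ v₂) ∞ refl refl = solve 2 (λ a b → con (+ 0) :* a := con (+ 0) :* b) refl v₂ v₁

  Prop-sym : ∀ L₁ L₂ → Prop p L₁ L₂ → Prop p L₂ L₁
  Prop-sym (lin u₁ v₁) (lin u₂ v₂) = sym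

  Prop⇒root : ∀ L₁ L₂ → NonzeroLin p L₁ → Prop p L₁ L₂ → ∀ P → valL P L₁ ≡ 0' → valL P L₂ ≡ 0'
  Prop⇒root (lin u₁ v₁) (lin u₂ v₂) L₁≢0 prop (fin x) e₁ =
    [ (λ u₁≡0 → ⊥-elim (L₁≢0 (u₁≡0 , u≡0⇒v≡0 x e₁ u₁≡0))) , (λ e → e) ] (*-≡0 u₁ (u₂ *' x +' v₂) key)
    where
    key : u₁ *' (u₂ *' x +' v₂) ≡ 0'
    key = begin
      u₁ *' (u₂ *' x +' v₂)
        ≡⟨ solve 5 (λ u₁ v₁ u₂ v₂ x → u₁ :* (u₂ :* x :+ v₂) := u₂ :* (u₁ :* x :+ v₁) :+ (u₁ :* v₂ :- u₂ :* v₁)) refl u₁ v₁ u₂ v₂ x ⟩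
      u₂ *' (u₁ *' x +' v₁) +' (u₁ *' v₂ +' -' (u₂ *' v₁))
        ≡⟨ cong₂ (λ a b → u₂ *' a +' (b +' -' (u₂ *' v₁))) e₁ prop ⟩
      u₂ *' 0' +' (u₂ *' v₁ +' -' (u₂ *' v₁))
        ≡⟨ solve 2 (λ u w → u :* con (+ 0) :+ (w :- w) := con (+ 0)) refl u₂ (u₂ *' v₁) ⟩
      0' ∎
  Prop⇒root (lin u₁ v₁) (lin u₂ v₂) L₁≢0 prop ∞ refl =
    [ (λ e → e) , (λ v₁≡0 → ⊥-elim (L₁≢0 (refl , v₁≡0))) ] (*-≡0 u₂ v₁ (trans (sym prop) (solve 1 (λ a → con (+ 0) :* a := con (+ 0)) refl v₂)))

  quotientC : ℙ¹ → Cubic p → Quad p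
  quotientC (fin x) (cubic a b c d) = quad a (b +' a *' x) (c +' b *' x +' a *' x *' x)
  quotientC ∞       (cubic a b c d) = quad b c d

  cubic-cong : ∀ {a b c d a' b' c' d' : F} → a ≡ a' → b ≡ b' → c ≡ c' → d ≡ d' → cubic {p} a b c d ≡ cubic a' b' c' d'
  cubic-cong refl refl refl refl = refl

  quad-cong : ∀ {r s t r' s' t' : F} → r ≡ r' → s ≡ s' → t ≡ t' → quad {p} r s t ≡ quad r' s' t'
  quad-cong refl refl refl = refl

  factorC : ∀ P f → valC P f ≡ 0' → f ≡ mulLQ p (vanishingAt P) (quotientC P f)
  factorC (fin x) (cubic a b c d) e = cubic-cong
    (solve 1 (λ a → a := con (+ 1) :* a) refl a)
    (solve 3 (λ a b x → b := con (+ 1) :* (b :+ a :* x) :+ (:- x) :* a) refl a b x)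
    (solve 4 (λ a b c x → c := con (+ 1) :* (c :+ b :* x :+ a :* x :* x) :+ (:- x) :* (b :+ a :* x)) refl a b c x)
    (begin
      d                                                   ≡⟨ solve 5 (λ a b c d x → d := (a :* x :* x :* x :+ b :* x :* x :+ c :* x :+ d) :+ (:- x) :* (c :+ b :* x :+ a :* x :* x))
                                                                     refl a b c d x ⟩
      valC (fin x) (cubic a b c d) +' -' x *' (c +' b *' x +' a *' x *' x) ≡⟨ cong (_+' -' x *' (c +' b *' x +' a *' x *' x)) e ⟩
      0' +' -' x *' (c +' b *' x +' a *' x *' x)          ≡⟨ +-identityˡ _ ⟩
      -' x *' (c +' b *' x +' a *' x *' x)                ∎)
  factorC ∞ (cubic a b c d) e = cubic-cong
    (trans e (solve 1 (λ b → con (+ 0) := con (+ 0) :* b) refl b))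
    (solve 2 (λ b c → b := con (+ 0) :* c :+ con (+ 1) :* b) refl b c)
    (solve 2 (λ c d → c := con (+ 0) :* d :+ con (+ 1) :* c) refl c d)
    (solve 1 (λ d → d := con (+ 1) :* d) refl d)

  quotientQ : ℙ¹ → Quad p → Lin p
  quotientQ (fin x) (quad r s t) = lin r (s +' r *' x)
  quotientQ ∞       (quad r s t) = lin s t

  factorQ : ∀ P q → valQ P q ≡ 0' → q ≡ mulLL p (vanishingAt P) (quotientQ P q)
  factorQ (fin x) (quad r s t) e = quad-cong
    (solve 1 (λ a → a := con (+ 1) :* a) refl r)
    (solve 3 (λ r s x → s := con (+ 1) :* (s :+ r :* x) :+ (:- x) :* r) refl r s x)
    (begin
      t                                           ≡⟨ solve 4 (λ r s t x → t := (r :* x :* x :+ s :* x :+ t) :+ (:- x) :* (s :+ r :* x)) refl r s t x ⟩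
      valQ (fin x) (quad r s t) +' -' x *' (s +' r *' x) ≡⟨ cong (_+' -' x *' (s +' r *' x)) e ⟩
      0' +' -' x *' (s +' r *' x)                 ≡⟨ +-identityˡ _ ⟩
      -' x *' (s +' r *' x)                       ∎)
  factorQ ∞ (quad r s t) e = quad-cong
    (trans e (solve 1 (λ b → con (+ 0) := con (+ 0) :* b) refl s))
    (solve 2 (λ b c → b := con (+ 0) :* c :+ con (+ 1) :* b) refl s t)
    (solve 1 (λ d → d := con (+ 1) :* d) refl t)

module RootCounts (p : ℕ) .{{_ : NonZero p}} (prime : Prime p) where

  open Sums
  open ZMod p
  open PrimeField p prime
  open ProjectiveLine p prime
  open Solver
  open ≡-Reasoning

  #roots : Cubic p → ℚ
  #roots f = ∑ℙ (λ P → 𝟙 (valC P f ≟ 0'))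

  #multipleRoots : Cubic p → ℚ
  #multipleRoots f = ∑ℙ (λ P → 𝟙 ((valC P f ≟ 0') ×-dec (derC P f ≟ 0')))

  rootCount multipleRootCount : SplitType → ℕ
  rootCount s111 = 3
  rootCount s12  = 1
  rootCount s3   = 0
  rootCount s1²1 = 2
  rootCount s1³  = 1
  rootCount s0   = suc p
  multipleRootCount s111 = 0
  multipleRootCount s12  = 0
  multipleRootCount s3   = 0
  multipleRootCount s1²1 = 1
  multipleRootCount s1³  = 1
  multipleRootCount s0   = suc p

  -- At a point, a product of three linear forms vanishes iff one factor does,
  -- and vanishes doubly iff two factors do, since a nonzero linear form has
  -- a nonzero derivative at its root.
  private
    χ : Bool → ℚ
    χ b = if b then 1ℚ else 0ℚ

    any₃ twoOf₃ : Bool → Bool → Bool → Bool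
    any₃ b₁ b₂ b₃ = b₁ ∨ b₂ ∨ b₃
    twoOf₃ b₁ b₂ b₃ = (b₁ ∧ b₂) ∨ (b₁ ∧ b₃) ∨ (b₂ ∧ b₃)

    module Product₃ (z₁ z₂ z₃ w₁ w₂ w₃ : F) where
      val der : F
      val = z₁ *' (z₂ *' z₃)
      der = w₁ *' (z₂ *' z₃) +' z₁ *' (w₂ *' z₃ +' z₂ *' w₃)

      𝟙-val : 𝟙 (val ≟ 0') ≡ χ (any₃ (does (z₁ ≟ 0')) (does (z₂ ≟ 0')) (does (z₃ ≟ 0')))
      𝟙-val with z₁ ≟ 0' | z₂ ≟ 0' | z₃ ≟ 0'
      ... | yes refl | _        | _        = 𝟙-yes (solve 2 (λ a b → con (+ 0) :* (a :* b) := con (+ 0)) refl z₂ z₃) (val ≟ 0')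
      ... | no _     | yes refl | _        = 𝟙-yes (solve 2 (λ a b → a :* (con (+ 0) :* b) := con (+ 0)) refl z₁ z₃) (val ≟ 0')
      ... | no _     | no _     | yes refl = 𝟙-yes (solve 2 (λ a b → a :* (b :* con (+ 0)) := con (+ 0)) refl z₁ z₂) (val ≟ 0')
      ... | no z₁≢0  | no z₂≢0  | no z₃≢0  = 𝟙-no (*-≢0 z₁≢0 (*-≢0 z₂≢0 z₃≢0)) (val ≟ 0')

      𝟙-val-der : (z₁ ≡ 0' → w₁ ≢ 0') → (z₂ ≡ 0' → w₂ ≢ 0') → (z₃ ≡ 0' → w₃ ≢ 0') →
        𝟙 ((val ≟ 0') ×-dec (der ≟ 0')) ≡ χ (twoOf₃ (does (z₁ ≟ 0')) (does (z₂ ≟ 0')) (does (z₃ ≟ 0')))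
      𝟙-val-der h₁ h₂ h₃ with z₁ ≟ 0' | z₂ ≟ 0' | z₃ ≟ 0'
      ... | yes refl | yes refl | _ = 𝟙-yes
        (solve 1 (λ c → con (+ 0) :* (con (+ 0) :* c) := con (+ 0)) refl z₃ ,
         solve 4 (λ a c b d → a :* (con (+ 0) :* c) :+ con (+ 0) :* (b :* c :+ con (+ 0) :* d) := con (+ 0)) refl w₁ z₃ w₂ w₃) ((val ≟ 0') ×-dec (der ≟ 0'))
      ... | yes refl | no _ | yes refl = 𝟙-yes
        (solve 1 (λ b → con (+ 0) :* (b :* con (+ 0)) := con (+ 0)) refl z₂ ,
         solve 4 (λ a b c d → a :* (b :* con (+ 0)) :+ con (+ 0) :* (c :* con (+ 0) :+ b :* d) := con (+ 0)) refl w₁ z₂ w₂ w₃) ((val ≟ 0') ×-dec (der ≟ 0'))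
      ... | no _ | yes refl | yes refl = 𝟙-yes
        (solve 1 (λ a → a :* (con (+ 0) :* con (+ 0)) := con (+ 0)) refl z₁ ,
         solve 4 (λ a b c d → a :* (con (+ 0) :* con (+ 0)) :+ b :* (c :* con (+ 0) :+ con (+ 0) :* d) := con (+ 0)) refl w₁ z₁ w₂ w₃) ((val ≟ 0') ×-dec (der ≟ 0'))
      ... | yes refl | no z₂≢0 | no z₃≢0 = 𝟙-no (λ (_ , e) → *-≢0 (h₁ refl) (*-≢0 z₂≢0 z₃≢0)
        (trans (solve 5 (λ a b c d e → a :* (b :* c) := a :* (b :* c) :+ con (+ 0) :* (d :* c :+ b :* e)) refl w₁ z₂ z₃ w₂ w₃) e)) ((val ≟ 0') ×-dec (der ≟ 0'))
      ... | no z₁≢0 | yes refl | no z₃≢0 = 𝟙-no (λ (_ , e) → *-≢0 z₁≢0 (*-≢0 (h₂ refl) z₃≢0)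
        (trans (solve 5 (λ a b c d e → b :* (d :* c) := a :* (con (+ 0) :* c) :+ b :* (d :* c :+ con (+ 0) :* e)) refl w₁ z₁ z₃ w₂ w₃) e)) ((val ≟ 0') ×-dec (der ≟ 0'))
      ... | no z₁≢0 | no z₂≢0 | yes refl = 𝟙-no (λ (_ , e) → *-≢0 z₁≢0 (*-≢0 z₂≢0 (h₃ refl))
        (trans (solve 5 (λ a b c d e → b :* (c :* e) := a :* (c :* con (+ 0)) :+ b :* (d :* con (+ 0) :+ c :* e)) refl w₁ z₁ z₂ w₂ w₃) e)) ((val ≟ 0') ×-dec (der ≟ 0'))
      ... | no z₁≢0 | no z₂≢0 | no z₃≢0 = 𝟙-no (λ (e , _) → *-≢0 z₁≢0 (*-≢0 z₂≢0 z₃≢0) e) ((val ≟ 0') ×-dec (der ≟ 0'))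

    valC-mul₃ : ∀ P L₁ L₂ L₃ → valC P (mulLQ p L₁ (mulLL p L₂ L₃)) ≡ Product₃.val (valL P L₁) (valL P L₂) (valL P L₃) (derL P L₁) (derL P L₂) (derL P L₃)
    valC-mul₃ P L₁ L₂ L₃ = trans (valC-mulLQ P L₁ (mulLL p L₂ L₃)) (cong (valL P L₁ *'_) (valQ-mulLL P L₂ L₃))

    derC-mul₃ : ∀ P L₁ L₂ L₃ → derC P (mulLQ p L₁ (mulLL p L₂ L₃)) ≡ Product₃.der (valL P L₁) (valL P L₂) (valL P L₃) (derL P L₁) (derL P L₂) (derL P L₃)
    derC-mul₃ P L₁ L₂ L₃ = trans (derC-mulLQ P L₁ (mulLL p L₂ L₃))
                                 (cong₂ (λ a b → derL P L₁ *' a +' valL P L₁ *' b) (valQ-mulLL P L₂ L₃) (derQ-mulLL P L₂ L₃))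

    vanishes? : ℙ¹ → Lin p → Bool
    vanishes? P L = does (valL P L ≟ 0')

    𝟙-root-mul₃ : ∀ L₁ L₂ L₃ P → 𝟙 (valC P (mulLQ p L₁ (mulLL p L₂ L₃)) ≟ 0') ≡ χ (any₃ (vanishes? P L₁) (vanishes? P L₂) (vanishes? P L₃))
    𝟙-root-mul₃ L₁ L₂ L₃ P = trans (cong (λ w → 𝟙 (w ≟ 0')) (valC-mul₃ P L₁ L₂ L₃))
                                   (Product₃.𝟙-val (valL P L₁) (valL P L₂) (valL P L₃) (derL P L₁) (derL P L₂) (derL P L₃))

    𝟙-multipleRoot-mul₃ : ∀ L₁ L₂ L₃ → NonzeroLin p L₁ → NonzeroLin p L₂ → NonzeroLin p L₃ → ∀ P →
      𝟙 ((valC P (mulLQ p L₁ (mulLL p L₂ L₃)) ≟ 0') ×-dec (derC P (mulLQ p L₁ (mulLL p L₂ L₃)) ≟ 0'))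
        ≡ χ (twoOf₃ (vanishes? P L₁) (vanishes? P L₂) (vanishes? P L₃))
    𝟙-multipleRoot-mul₃ L₁ L₂ L₃ L₁≢0 L₂≢0 L₃≢0 P =
      trans (cong₂ (λ a b → 𝟙 ((a ≟ 0') ×-dec (b ≟ 0'))) (valC-mul₃ P L₁ L₂ L₃) (derC-mul₃ P L₁ L₂ L₃))
            (Product₃.𝟙-val-der (valL P L₁) (valL P L₂) (valL P L₃) (derL P L₁) (derL P L₂) (derL P L₃)
                                (derL≢0-at-root L₁ L₁≢0 P) (derL≢0-at-root L₂ L₂≢0 P) (derL≢0-at-root L₃ L₃≢0 P))

    distinct-roots : ∀ L L′ → ¬ Prop p L L′ → ∀ P → vanishes? P L ≡ true → vanishes? P L′ ≡ true → ⊥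
    distinct-roots L L′ ¬prop P v v′ with valL P L ≟ 0' | valL P L′ ≟ 0'
    ... | yes e | yes e′ = ¬prop (common-root⇒Prop L L′ P e e′)

    same-roots : ∀ L L′ → NonzeroLin p L → NonzeroLin p L′ → Prop p L L′ → ∀ P → vanishes? P L ≡ vanishes? P L′
    same-roots L L′ L≢0 L′≢0 prop P with valL P L ≟ 0' | valL P L′ ≟ 0'
    ... | yes _ | yes _  = refl
    ... | no _  | no _   = refl
    ... | yes e | no ¬e′ = ⊥-elim (¬e′ (Prop⇒root L L′ L≢0 prop P e))
    ... | no ¬e | yes e′ = ⊥-elim (¬e (Prop⇒root L′ L L′≢0 (Prop-sym L L′ prop) P e′))

    ∑ℙ-+₃ : ∀ (f g h : ℙ¹ → ℚ) → ∑ℙ (λ P → f P ⊕ g P ⊕ h P) ≡ ∑ℙ f ⊕ ∑ℙ g ⊕ ∑ℙ h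
    ∑ℙ-+₃ f g h = trans (∑ℙ-+ (λ P → f P ⊕ g P) h) (cong (_⊕ ∑ℙ h) (∑ℙ-+ f g))

    Counts : SplitType → Cubic p → Set
    Counts σ f = #roots f ≡ fromℕ (rootCount σ) × #multipleRoots f ≡ fromℕ (multipleRootCount σ)

    counts-111 : ∀ f → HasType p s111 f → Counts s111 f
    counts-111 f (L₁ , L₂ , L₃ , L₁≢0 , L₂≢0 , L₃≢0 , ¬p₁₂ , ¬p₁₃ , ¬p₂₃ , refl) =
      (begin
        ∑ℙ (λ P → 𝟙 (valC P f ≟ 0'))
          ≡⟨ ∑ℙ-cong (λ P → trans (𝟙-root-mul₃ L₁ L₂ L₃ P) (proj₁ (bools P))) ⟩
        ∑ℙ (λ P → χ (vanishes? P L₁) ⊕ χ (vanishes? P L₂) ⊕ χ (vanishes? P L₃))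
          ≡⟨ ∑ℙ-+₃ (λ P → χ (vanishes? P L₁)) (λ P → χ (vanishes? P L₂)) (λ P → χ (vanishes? P L₃)) ⟩
        ∑ℙ (λ P → χ (vanishes? P L₁)) ⊕ ∑ℙ (λ P → χ (vanishes? P L₂)) ⊕ ∑ℙ (λ P → χ (vanishes? P L₃))
          ≡⟨ cong₂ _⊕_ (cong₂ _⊕_ (∑ℙ-roots-lin L₁ L₁≢0) (∑ℙ-roots-lin L₂ L₂≢0)) (∑ℙ-roots-lin L₃ L₃≢0) ⟩
        fromℕ 3 ∎) ,
      trans (∑ℙ-cong (λ P → trans (𝟙-multipleRoot-mul₃ L₁ L₂ L₃ L₁≢0 L₂≢0 L₃≢0 P) (proj₂ (bools P)))) ∑ℙ-0
      where
      disjoint : ∀ b₁ b₂ b₃ → (b₁ ≡ true → b₂ ≡ true → ⊥) → (b₁ ≡ true → b₃ ≡ true → ⊥) → (b₂ ≡ true → b₃ ≡ true → ⊥) →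
        (χ (any₃ b₁ b₂ b₃) ≡ χ b₁ ⊕ χ b₂ ⊕ χ b₃) × (χ (twoOf₃ b₁ b₂ b₃) ≡ 0ℚ)
      disjoint true  true  _     h _ _ = ⊥-elim (h refl refl)
      disjoint true  false true  _ h _ = ⊥-elim (h refl refl)
      disjoint false true  true  _ _ h = ⊥-elim (h refl refl)
      disjoint true  false false _ _ _ = refl , refl
      disjoint false true  false _ _ _ = refl , refl
      disjoint false false true  _ _ _ = refl , refl
      disjoint false false false _ _ _ = refl , refl
      bools : ∀ P → _
      bools P = disjoint (vanishes? P L₁) (vanishes? P L₂) (vanishes? P L₃)
                         (distinct-roots L₁ L₂ ¬p₁₂ P) (distinct-roots L₁ L₃ ¬p₁₃ P) (distinct-roots L₂ L₃ ¬p₂₃ P)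

    counts-1²1 : ∀ f → HasType p s1²1 f → Counts s1²1 f
    counts-1²1 f (L₁ , L₂ , L₃ , L₁≢0 , L₂≢0 , L₃≢0 , p₁₂ , ¬p₁₃ , refl) =
      (begin
        ∑ℙ (λ P → 𝟙 (valC P f ≟ 0'))                        ≡⟨ ∑ℙ-cong (λ P → trans (𝟙-root-mul₃ L₁ L₂ L₃ P) (proj₁ (bools P))) ⟩
        ∑ℙ (λ P → χ (vanishes? P L₁) ⊕ χ (vanishes? P L₃))   ≡⟨ ∑ℙ-+ (λ P → χ (vanishes? P L₁)) (λ P → χ (vanishes? P L₃)) ⟩
        ∑ℙ (λ P → χ (vanishes? P L₁)) ⊕ ∑ℙ (λ P → χ (vanishes? P L₃))
                                                            ≡⟨ cong₂ _⊕_ (∑ℙ-roots-lin L₁ L₁≢0) (∑ℙ-roots-lin L₃ L₃≢0) ⟩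
        fromℕ 2                                             ∎) ,
      trans (∑ℙ-cong (λ P → trans (𝟙-multipleRoot-mul₃ L₁ L₂ L₃ L₁≢0 L₂≢0 L₃≢0 P) (proj₂ (bools P)))) (∑ℙ-roots-lin L₁ L₁≢0)
      where
      double : ∀ b₁ b₂ b₃ → b₁ ≡ b₂ → (b₁ ≡ true → b₃ ≡ true → ⊥) →
        (χ (any₃ b₁ b₂ b₃) ≡ χ b₁ ⊕ χ b₃) × (χ (twoOf₃ b₁ b₂ b₃) ≡ χ b₁)
      double true  .true true  refl h = ⊥-elim (h refl refl)
      double true  .true false refl h = refl , refl
      double false .false true  refl h = refl , refl
      double false .false false refl h = refl , refl
      bools : ∀ P → _
      bools P = double (vanishes? P L₁) (vanishes? P L₂) (vanishes? P L₃)
                       (same-roots L₁ L₂ L₁≢0 L₂≢0 p₁₂ P) (distinct-roots L₁ L₃ ¬p₁₃ P)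

    counts-1³ : ∀ f → HasType p s1³ f → Counts s1³ f
    counts-1³ f (L₁ , L₂ , L₃ , L₁≢0 , L₂≢0 , L₃≢0 , p₁₂ , p₁₃ , refl) =
      trans (∑ℙ-cong (λ P → trans (𝟙-root-mul₃ L₁ L₂ L₃ P) (proj₁ (bools P)))) (∑ℙ-roots-lin L₁ L₁≢0) ,
      trans (∑ℙ-cong (λ P → trans (𝟙-multipleRoot-mul₃ L₁ L₂ L₃ L₁≢0 L₂≢0 L₃≢0 P) (proj₂ (bools P)))) (∑ℙ-roots-lin L₁ L₁≢0)
      where
      triple : ∀ b₁ b₂ b₃ → b₁ ≡ b₂ → b₁ ≡ b₃ → (χ (any₃ b₁ b₂ b₃) ≡ χ b₁) × (χ (twoOf₃ b₁ b₂ b₃) ≡ χ b₁)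
      triple true  .true  .true  refl refl = refl , refl
      triple false .false .false refl refl = refl , refl
      bools : ∀ P → _
      bools P = triple (vanishes? P L₁) (vanishes? P L₂) (vanishes? P L₃)
                       (same-roots L₁ L₂ L₁≢0 L₂≢0 p₁₂ P) (same-roots L₁ L₃ L₁≢0 L₃≢0 p₁₃ P)

    irreducible⇒no-root : ∀ q → IrredQ p q → ∀ P → valQ P q ≢ 0'
    irreducible⇒no-root q (_ , irreducible) P e = irreducible (vanishingAt P , quotientQ P q , factorQ P q e)

    counts-12 : ∀ f → HasType p s12 f → Counts s12 f
    counts-12 f (L , q , L≢0 , irr , refl) =
      trans (∑ℙ-cong root-of-L) (∑ℙ-roots-lin L L≢0) ,
      trans (∑ℙ-cong (λ P → 𝟙-no (simple P) ((valC P (mulLQ p L q) ≟ 0') ×-dec (derC P (mulLQ p L q) ≟ 0')))) ∑ℙ-0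
      where
      noRoot = irreducible⇒no-root q irr
      root-of-L : ∀ P → 𝟙 (valC P (mulLQ p L q) ≟ 0') ≡ 𝟙 (valL P L ≟ 0')
      root-of-L P = trans (cong (λ w → 𝟙 (w ≟ 0')) (valC-mulLQ P L q))
        (𝟙-cong (λ e → [ (λ e′ → e′) , (λ e′ → ⊥-elim (noRoot P e′)) ] (*-≡0 (valL P L) (valQ P q) e))
                (λ e → trans (cong (_*' valQ P q) e) (solve 1 (λ a → con (+ 0) :* a := con (+ 0)) refl (valQ P q)))
                (valL P L *' valQ P q ≟ 0') (valL P L ≟ 0'))
      simple : ∀ P → ¬ (valC P (mulLQ p L q) ≡ 0' × derC P (mulLQ p L q) ≡ 0')
      simple P (e , e′) = [ at-root-of-L , noRoot P ] (*-≡0 (valL P L) (valQ P q) (trans (sym (valC-mulLQ P L q)) e))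
        where
        at-root-of-L : valL P L ≡ 0' → ⊥
        at-root-of-L z = *-≢0 (derL≢0-at-root L L≢0 P z) (noRoot P) (begin
          derL P L *' valQ P q                          ≡⟨ solve 3 (λ a b c → a :* b := a :* b :+ con (+ 0) :* c) refl (derL P L) (valQ P q) (derQ P q) ⟩
          derL P L *' valQ P q +' 0' *' derQ P q        ≡⟨ cong (λ w → derL P L *' valQ P q +' w *' derQ P q) (sym z) ⟩
          derL P L *' valQ P q +' valL P L *' derQ P q  ≡⟨ sym (derC-mulLQ P L q) ⟩
          derC P (mulLQ p L q)                          ≡⟨ e′ ⟩
          0'                                            ∎)

    counts-3 : ∀ f → HasType p s3 f → Counts s3 f
    counts-3 f (_ , irreducible) =
      trans (∑ℙ-cong (λ P → 𝟙-no (noRoot P) (valC P f ≟ 0'))) ∑ℙ-0 ,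
      trans (∑ℙ-cong (λ P → 𝟙-no (λ (e , _) → noRoot P e) ((valC P f ≟ 0') ×-dec (derC P f ≟ 0')))) ∑ℙ-0
      where
      noRoot : ∀ P → valC P f ≢ 0'
      noRoot P e = irreducible (vanishingAt P , quotientC P f , factorC P f e)

    counts-0 : ∀ f → HasType p s0 f → Counts s0 f
    counts-0 f refl =
      trans (∑ℙ-cong (λ P → 𝟙-yes (valC-0 P) (valC P (zeroC p) ≟ 0'))) (trans (∑ℙ-const 1ℚ) p+1≡) ,
      trans (∑ℙ-cong (λ P → 𝟙-yes (valC-0 P , derC-0 P) ((valC P (zeroC p) ≟ 0') ×-dec (derC P (zeroC p) ≟ 0')))) (trans (∑ℙ-const 1ℚ) p+1≡)
      where
      valC-0 : ∀ P → valC P (zeroC p) ≡ 0'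
      valC-0 (fin x) = solve 1 (λ x → con (+ 0) :* x :* x :* x :+ con (+ 0) :* x :* x :+ con (+ 0) :* x :+ con (+ 0) := con (+ 0)) refl x
      valC-0 ∞ = refl
      derC-0 : ∀ P → derC P (zeroC p) ≡ 0'
      derC-0 (fin x) = solve 1 (λ x → con (+ 3) :* con (+ 0) :* x :* x :+ con (+ 2) :* con (+ 0) :* x :+ con (+ 0) := con (+ 0)) refl x
      derC-0 ∞ = refl
      p+1≡ : (pℚ p ⊕ 1ℚ) ⊛ 1ℚ ≡ fromℕ (suc p)
      p+1≡ = trans (ℚ.*-identityʳ (pℚ p ⊕ 1ℚ)) (trans (ℚ.+-comm (pℚ p) 1ℚ) (sym (fromℕ-suc p)))

  counts : ∀ σ f → HasType p σ f → #roots f ≡ fromℕ (rootCount σ) × #multipleRoots f ≡ fromℕ (multipleRootCount σ)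
  counts s111 = counts-111
  counts s12  = counts-12
  counts s3   = counts-3
  counts s1²1 = counts-1²1
  counts s1³  = counts-1³
  counts s0   = counts-0

  -- δ(0) = p + 1 exceeds the number of multiple roots of any nonzero cubic.
  HasType⇒≢0 : ∀ σ f → HasType p σ f → σ ≢ s0 → f ≢ zeroC p
  HasType⇒≢0 σ f h σ≢s0 refl =
    impossible σ σ≢s0 (fromℕ-injective (trans (sym (proj₂ (counts σ f h))) (proj₂ (counts s0 f refl))))
    where
    impossible : ∀ σ → σ ≢ s0 → multipleRootCount σ ≢ suc p
    impossible s111 _ ()
    impossible s12  _ ()
    impossible s3   _ ()
    impossible s1²1 _ e = ℕ.≢-nonZero⁻¹ p (sym (ℕ.suc-injective e))
    impossible s1³  _ e = ℕ.≢-nonZero⁻¹ p (sym (ℕ.suc-injective e))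
    impossible s0   σ≢s0 _ = σ≢s0 refl

  s1³-unique : ∀ σ f → HasType p s1³ f → HasType p σ f → σ ≡ s1³
  s1³-unique s0 f h₁³ refl = ⊥-elim (HasType⇒≢0 s1³ f h₁³ (λ ()) refl)
  s1³-unique σ f h₁³ h = distinguish σ (fromℕ-injective (trans (sym (proj₁ (counts σ f h))) (proj₁ (counts s1³ f h₁³))))
                                       (fromℕ-injective (trans (sym (proj₂ (counts σ f h))) (proj₂ (counts s1³ f h₁³))))
    where
    distinguish : ∀ σ → rootCount σ ≡ 1 → multipleRootCount σ ≡ 1 → σ ≡ s1³
    distinguish s111 () _
    distinguish s12  _ ()
    distinguish s3   () _
    distinguish s1²1 () _
    distinguish s1³  _ _ = refl
    distinguish s0   _ e = ⊥-elim (ℕ.≢-nonZero⁻¹ p (ℕ.suc-injective e))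

module Classification (p : ℕ) .{{_ : NonZero p}} (prime : Prime p) where

  open ZMod p
  open ProjectiveLine p prime
  open Solver
  open ≡-Reasoning

  root? : (g : ℙ¹ → F) → Dec (∃ λ P → g P ≡ 0')
  root? g with any? (λ x → g (fin x) ≟ 0') | g ∞ ≟ 0'
  ... | yes (x , e) | _      = yes (fin x , e)
  ... | no _        | yes e  = yes (∞ , e)
  ... | no ¬fin     | no ¬∞  = no λ { (fin x , e) → ¬fin (x , e) ; (∞ , e) → ¬∞ e }

  zero? : ∀ (f : Cubic p) → Dec (f ≡ zeroC p)
  zero? (cubic a b c d) = map′ (λ { (refl , refl , refl , refl) → refl }) (λ { refl → refl , refl , refl , refl })
                               ((a ≟ 0') ×-dec (b ≟ 0') ×-dec (c ≟ 0') ×-dec (d ≟ 0'))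

  nonzero? : ∀ L → Dec (NonzeroLin p L)
  nonzero? (lin u v) = ¬? ((u ≟ 0') ×-dec (v ≟ 0'))

  Prop? : ∀ L₁ L₂ → Dec (Prop p L₁ L₂)
  Prop? (lin u₁ v₁) (lin u₂ v₂) = u₁ *' v₂ ≟ u₂ *' v₁

  private
    zeroLin : ∀ L → ¬ NonzeroLin p L → L ≡ lin 0' 0'
    zeroLin (lin u v) L≡0 with u ≟ 0' | v ≟ 0'
    ... | yes refl | yes refl = refl
    ... | no u≢0   | _        = ⊥-elim (L≡0 (λ (u≡0 , _) → u≢0 u≡0))
    ... | yes _    | no v≢0   = ⊥-elim (L≡0 (λ (_ , v≡0) → v≢0 v≡0))

  mulLQ-zeroˡ : ∀ L Q → ¬ NonzeroLin p L → mulLQ p L Q ≡ zeroC p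
  mulLQ-zeroˡ L (quad r s t) L≡0 rewrite zeroLin L L≡0 = cubic-cong
    (solve 1 (λ r → con (+ 0) :* r := con (+ 0)) refl r)
    (solve 2 (λ s r → con (+ 0) :* s :+ con (+ 0) :* r := con (+ 0)) refl s r)
    (solve 2 (λ t s → con (+ 0) :* t :+ con (+ 0) :* s := con (+ 0)) refl t s)
    (solve 1 (λ t → con (+ 0) :* t := con (+ 0)) refl t)

  mulLQ-zeroʳ : ∀ L → mulLQ p L (zeroQ p) ≡ zeroC p
  mulLQ-zeroʳ (lin u v) = cubic-cong
    (solve 1 (λ u → u :* con (+ 0) := con (+ 0)) refl u)
    (solve 2 (λ u v → u :* con (+ 0) :+ v :* con (+ 0) := con (+ 0)) refl u v)
    (solve 2 (λ u v → u :* con (+ 0) :+ v :* con (+ 0) := con (+ 0)) refl u v)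
    (solve 1 (λ v → v :* con (+ 0) := con (+ 0)) refl v)

  mulLL-zeroʳ : ∀ L₁ L₂ → ¬ NonzeroLin p L₂ → mulLL p L₁ L₂ ≡ zeroQ p
  mulLL-zeroʳ (lin u v) L₂ L₂≡0 rewrite zeroLin L₂ L₂≡0 = quad-cong
    (solve 1 (λ u → u :* con (+ 0) := con (+ 0)) refl u)
    (solve 2 (λ u v → u :* con (+ 0) :+ v :* con (+ 0) := con (+ 0)) refl u v)
    (solve 1 (λ v → v :* con (+ 0) := con (+ 0)) refl v)

  mulLL-comm : ∀ L₁ L₂ → mulLL p L₁ L₂ ≡ mulLL p L₂ L₁
  mulLL-comm (lin a b) (lin c d) = quad-cong (*-comm a c) (solve 4 (λ a b c d → a :* d :+ b :* c := c :* b :+ d :* a) refl a b c d) (*-comm b d)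

  mul₃-rotate : ∀ L₁ L₂ L₃ → mulLQ p L₁ (mulLL p L₂ L₃) ≡ mulLQ p L₂ (mulLL p L₃ L₁)
  mul₃-rotate (lin a b) (lin c d) (lin e g) = cubic-cong
    (solve 3 (λ a c e → a :* (c :* e) := c :* (e :* a)) refl a c e)
    (solve 6 (λ a b c d e g → a :* (c :* g :+ d :* e) :+ b :* (c :* e) := c :* (e :* b :+ g :* a) :+ d :* (e :* a)) refl a b c d e g)
    (solve 6 (λ a b c d e g → a :* (d :* g) :+ b :* (c :* g :+ d :* e) := c :* (g :* b) :+ d :* (e :* b :+ g :* a)) refl a b c d e g)
    (solve 3 (λ b d g → b :* (d :* g) := d :* (g :* b)) refl b d g)

  valQ-at-root : ∀ L₁ L₂ → NonzeroLin p L₁ → valQ (root L₁) (mulLL p L₁ L₂) ≡ 0'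
  valQ-at-root L₁ L₂ L₁≢0 = begin
    valQ (root L₁) (mulLL p L₁ L₂)               ≡⟨ valQ-mulLL (root L₁) L₁ L₂ ⟩
    valL (root L₁) L₁ *' valL (root L₁) L₂       ≡⟨ cong (_*' valL (root L₁) L₂) (root-vanishes L₁ L₁≢0) ⟩
    0' *' valL (root L₁) L₂                      ≡⟨ zeroˡ _ ⟩
    0'                                           ∎

  valC-at-root : ∀ L Q → NonzeroLin p L → valC (root L) (mulLQ p L Q) ≡ 0'
  valC-at-root L Q L≢0 = begin
    valC (root L) (mulLQ p L Q)           ≡⟨ valC-mulLQ (root L) L Q ⟩
    valL (root L) L *' valQ (root L) Q    ≡⟨ cong (_*' valQ (root L) Q) (root-vanishes L L≢0) ⟩
    0' *' valQ (root L) Q                 ≡⟨ zeroˡ _ ⟩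
    0'                                    ∎

  -- Split off roots one at a time, then compare the three linear factors.
  private
    classify-linear : ∀ f L₁ L₂ L₃ → NonzeroLin p L₁ → NonzeroLin p L₂ → NonzeroLin p L₃ →
      f ≡ mulLQ p L₁ (mulLL p L₂ L₃) →
      Dec (Prop p L₁ L₂) → Dec (Prop p L₁ L₃) → Dec (Prop p L₂ L₃) → Σ SplitType λ σ → HasType p σ f
    classify-linear f L₁ L₂ L₃ n₁ n₂ n₃ e (yes p₁₂) (yes p₁₃) _ = s1³ , L₁ , L₂ , L₃ , n₁ , n₂ , n₃ , p₁₂ , p₁₃ , e
    classify-linear f L₁ L₂ L₃ n₁ n₂ n₃ e (yes p₁₂) (no ¬p₁₃) _ = s1²1 , L₁ , L₂ , L₃ , n₁ , n₂ , n₃ , p₁₂ , ¬p₁₃ , e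
    classify-linear f L₁ L₂ L₃ n₁ n₂ n₃ e (no ¬p₁₂) (yes p₁₃) _ =
      s1²1 , L₁ , L₃ , L₂ , n₁ , n₃ , n₂ , p₁₃ , ¬p₁₂ , trans e (cong (mulLQ p L₁) (mulLL-comm L₂ L₃))
    classify-linear f L₁ L₂ L₃ n₁ n₂ n₃ e (no ¬p₁₂) (no ¬p₁₃) (no ¬p₂₃) = s111 , L₁ , L₂ , L₃ , n₁ , n₂ , n₃ , ¬p₁₂ , ¬p₁₃ , ¬p₂₃ , e
    classify-linear f L₁ L₂ L₃ n₁ n₂ n₃ e (no ¬p₁₂) (no ¬p₁₃) (yes p₂₃) =
      s1²1 , L₂ , L₃ , L₁ , n₂ , n₃ , n₁ , p₂₃ , (λ p₂₁ → ¬p₁₂ (Prop-sym L₂ L₁ p₂₁)) , trans e (mul₃-rotate L₁ L₂ L₃)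

    classify-quadratic : ∀ f P q → f ≢ zeroC p → f ≡ mulLQ p (vanishingAt P) q →
      Dec (∃ λ P′ → valQ P′ q ≡ 0') → Σ SplitType λ σ → HasType p σ f
    classify-quadratic f P q f≢0 f≡Mq (no noRoot) = s12 , vanishingAt P , q , vanishingAt-nonzero P , (q≢0 , irreducible) , f≡Mq
      where
      q≢0 : q ≢ zeroQ p
      q≢0 refl = f≢0 (trans f≡Mq (mulLQ-zeroʳ (vanishingAt P)))
      irreducible : ¬ (∃ λ L₁ → ∃ λ L₂ → q ≡ mulLL p L₁ L₂)
      irreducible (L₁ , L₂ , refl) with nonzero? L₁
      ... | yes L₁≢0 = noRoot (root L₁ , valQ-at-root L₁ L₂ L₁≢0)
      ... | no L₁≡0  = q≢0 (trans (mulLL-comm L₁ L₂) (mulLL-zeroʳ L₂ L₁ L₁≡0))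
    classify-quadratic f P q f≢0 f≡Mq (yes (P′ , e)) with nonzero? (quotientQ P′ q)
    ... | no L≡0 = ⊥-elim (f≢0 (begin
      f                                                               ≡⟨ f≡Mq ⟩
      mulLQ p (vanishingAt P) q                                       ≡⟨ cong (mulLQ p (vanishingAt P)) (factorQ P′ q e) ⟩
      mulLQ p (vanishingAt P) (mulLL p (vanishingAt P′) (quotientQ P′ q)) ≡⟨ cong (mulLQ p (vanishingAt P)) (mulLL-zeroʳ (vanishingAt P′) (quotientQ P′ q) L≡0) ⟩
      mulLQ p (vanishingAt P) (zeroQ p)                               ≡⟨ mulLQ-zeroʳ (vanishingAt P) ⟩
      zeroC p                                                         ∎))
    ... | yes L≢0 = classify-linear f (vanishingAt P) (vanishingAt P′) (quotientQ P′ q)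
                      (vanishingAt-nonzero P) (vanishingAt-nonzero P′) L≢0
                      (trans f≡Mq (cong (mulLQ p (vanishingAt P)) (factorQ P′ q e)))
                      (Prop? (vanishingAt P) (vanishingAt P′)) (Prop? (vanishingAt P) (quotientQ P′ q))
                      (Prop? (vanishingAt P′) (quotientQ P′ q))

    classify-nonzero : ∀ f → f ≢ zeroC p → Dec (∃ λ P → valC P f ≡ 0') → Σ SplitType λ σ → HasType p σ f
    classify-nonzero f f≢0 (no noRoot) = s3 , f≢0 , reducible⇒root
      where
      reducible⇒root : ¬ (∃ λ L → ∃ λ Q → f ≡ mulLQ p L Q)
      reducible⇒root (L , Q , refl) with nonzero? L
      ... | yes L≢0 = noRoot (root L , valC-at-root L Q L≢0)
      ... | no L≡0  = f≢0 (mulLQ-zeroˡ L Q L≡0)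
    classify-nonzero f f≢0 (yes (P , e)) =
      classify-quadratic f P (quotientC P f) f≢0 (factorC P f e) (root? (λ P′ → valQ P′ (quotientC P f)))

  classify : ∀ f → Σ SplitType λ σ → HasType p σ f
  classify f with zero? f
  ... | yes f≡0 = s0 , f≡0
  ... | no f≢0  = classify-nonzero f f≢0 (root? (λ P → valC P f))

module SplitTypeValues (p : ℕ) .{{_ : NonZero p}} (prime : Prime p) where

  open Sums
  open ZMod p
  open RootCounts p prime
  open Classification p prime using (classify)
  open +-*-Solver
  open ≡-Reasoning

  -- Written as a product of coordinate indicators so that sums against it can
  -- be evaluated one coordinate at a time.
  𝟙₀ : Cubic p → ℚ
  𝟙₀ (cubic a b c d) = 𝟙 (a ≟ 0') ⊛ 𝟙 (b ≟ 0') ⊛ 𝟙 (c ≟ 0') ⊛ 𝟙 (d ≟ 0')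

  𝟙₀-≢0 : ∀ f → f ≢ zeroC p → 𝟙₀ f ≡ 0ℚ
  𝟙₀-≢0 (cubic a b c d) f≢0 with a ≟ 0' | b ≟ 0' | c ≟ 0' | d ≟ 0'
  ... | yes refl | yes refl | yes refl | yes refl = ⊥-elim (f≢0 refl)
  ... | da    | db    | dc    | no _  = ℚ.*-zeroʳ (𝟙 da ⊛ 𝟙 db ⊛ 𝟙 dc)
  ... | da    | db    | no _  | yes _ = trans (ℚ.*-identityʳ (𝟙 da ⊛ 𝟙 db ⊛ 0ℚ)) (ℚ.*-zeroʳ (𝟙 da ⊛ 𝟙 db))
  ... | da    | no _  | yes _ | yes _ = trans (ℚ.*-identityʳ (𝟙 da ⊛ 0ℚ ⊛ 1ℚ)) (trans (ℚ.*-identityʳ (𝟙 da ⊛ 0ℚ)) (ℚ.*-zeroʳ (𝟙 da)))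
  ... | no _  | yes _ | yes _ | yes _ = refl

  𝟙₀-zero : 𝟙₀ (zeroC p) ≡ 1ℚ
  𝟙₀-zero with 0' ≟ 0'
  ... | yes _   = refl
  ... | no 0≢0 = ⊥-elim (0≢0 refl)

  s0? : ∀ σ → Dec (σ ≡ s0)
  s0? s111 = no λ ()
  s0? s12  = no λ ()
  s0? s3   = no λ ()
  s0? s1²1 = no λ ()
  s0? s1³  = no λ ()
  s0? s0   = yes refl

  private
    cong₃ : ∀ {A B C D : Set} (g : A → B → C → D) {a a′ b b′ c c′} → a ≡ a′ → b ≡ b′ → c ≡ c′ → g a b c ≡ g a′ b′ c′
    cong₃ g refl refl refl = refl

  λFormula θFormula : Cubic p → ℚ
  λFormula f = #roots f ⊖ 1ℚ ⊖ pℚ p ⊛ 𝟙₀ f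
  θFormula f = fromℕ 2 ⊛ (#roots f ⊖ #multipleRoots f) ⊖ (#roots f ⊖ 1ℚ) ⊛ (#roots f ⊖ 1ℚ) ⊕ pℚ p ⊛ pℚ p ⊛ 𝟙₀ f

  private
    λp-nonzero : ∀ σ → σ ≢ s0 → toℚ (λp σ) ≡ fromℕ (rootCount σ) ⊖ 1ℚ
    λp-nonzero s111 _ = refl
    λp-nonzero s12  _ = refl
    λp-nonzero s3   _ = refl
    λp-nonzero s1²1 _ = refl
    λp-nonzero s1³  _ = refl
    λp-nonzero s0 σ≢s0 = ⊥-elim (σ≢s0 refl)

    θp²-nonzero : ∀ σ → σ ≢ s0 → toℚ (θp² σ) ≡
      fromℕ 2 ⊛ (fromℕ (rootCount σ) ⊖ fromℕ (multipleRootCount σ)) ⊖ (fromℕ (rootCount σ) ⊖ 1ℚ) ⊛ (fromℕ (rootCount σ) ⊖ 1ℚ)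
    θp²-nonzero s111 _ = refl
    θp²-nonzero s12  _ = refl
    θp²-nonzero s3   _ = refl
    θp²-nonzero s1²1 _ = refl
    θp²-nonzero s1³  _ = refl
    θp²-nonzero s0 σ≢s0 = ⊥-elim (σ≢s0 refl)

    λp≡λFormula-zero : ∀ f → f ≡ zeroC p → toℚ (λp s0) ≡ λFormula f
    λp≡λFormula-zero f refl = begin
      0ℚ
        ≡⟨ solve 1 (λ q → con 0ℚ := (con 1ℚ :+ q) :- con 1ℚ :- q :* con 1ℚ) refl (pℚ p) ⟩
      (1ℚ ⊕ pℚ p) ⊖ 1ℚ ⊖ pℚ p ⊛ 1ℚ
        ≡⟨ cong₂ (λ r z → r ⊖ 1ℚ ⊖ pℚ p ⊛ z) (sym (trans (proj₁ (counts s0 f refl)) (fromℕ-suc p))) (sym 𝟙₀-zero) ⟩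
      λFormula f ∎

    θp²≡θFormula-zero : ∀ f → f ≡ zeroC p → toℚ (θp² s0) ≡ θFormula f
    θp²≡θFormula-zero f refl = begin
      0ℚ
        ≡⟨ solve 1 (λ q → con 0ℚ := con (fromℕ 2) :* ((con 1ℚ :+ q) :- (con 1ℚ :+ q))
                                    :- ((con 1ℚ :+ q) :- con 1ℚ) :* ((con 1ℚ :+ q) :- con 1ℚ) :+ q :* q :* con 1ℚ) refl (pℚ p) ⟩
      fromℕ 2 ⊛ ((1ℚ ⊕ pℚ p) ⊖ (1ℚ ⊕ pℚ p)) ⊖ ((1ℚ ⊕ pℚ p) ⊖ 1ℚ) ⊛ ((1ℚ ⊕ pℚ p) ⊖ 1ℚ) ⊕ pℚ p ⊛ pℚ p ⊛ 1ℚ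
        ≡⟨ cong₃ (λ r d z → fromℕ 2 ⊛ (r ⊖ d) ⊖ (r ⊖ 1ℚ) ⊛ (r ⊖ 1ℚ) ⊕ pℚ p ⊛ pℚ p ⊛ z)
                 (sym (trans (proj₁ (counts s0 f refl)) (fromℕ-suc p))) (sym (trans (proj₂ (counts s0 f refl)) (fromℕ-suc p))) (sym 𝟙₀-zero) ⟩
      θFormula f ∎

  λp≡λFormula : ∀ σ f → HasType p σ f → toℚ (λp σ) ≡ λFormula f
  λp≡λFormula σ f h with s0? σ
  ... | yes refl = λp≡λFormula-zero f h
  ... | no σ≢s0 = begin
    toℚ (λp σ)
      ≡⟨ λp-nonzero σ σ≢s0 ⟩
    fromℕ (rootCount σ) ⊖ 1ℚ
      ≡⟨ solve 2 (λ r q → r :- con 1ℚ := r :- con 1ℚ :- q :* con 0ℚ) refl (fromℕ (rootCount σ)) (pℚ p) ⟩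
    fromℕ (rootCount σ) ⊖ 1ℚ ⊖ pℚ p ⊛ 0ℚ
      ≡⟨ cong₂ (λ r z → r ⊖ 1ℚ ⊖ pℚ p ⊛ z) (sym (proj₁ (counts σ f h))) (sym (𝟙₀-≢0 f (HasType⇒≢0 σ f h σ≢s0))) ⟩
    λFormula f ∎

  θp²≡θFormula : ∀ σ f → HasType p σ f → toℚ (θp² σ) ≡ θFormula f
  θp²≡θFormula σ f h with s0? σ
  ... | yes refl = θp²≡θFormula-zero f h
  ... | no σ≢s0 = begin
    toℚ (θp² σ)
      ≡⟨ θp²-nonzero σ σ≢s0 ⟩
    fromℕ 2 ⊛ (R ⊖ D) ⊖ (R ⊖ 1ℚ) ⊛ (R ⊖ 1ℚ)
      ≡⟨ solve 3 (λ r d q → con (fromℕ 2) :* (r :- d) :- (r :- con 1ℚ) :* (r :- con 1ℚ)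
                            := con (fromℕ 2) :* (r :- d) :- (r :- con 1ℚ) :* (r :- con 1ℚ) :+ q :* q :* con 0ℚ) refl R D (pℚ p) ⟩
    fromℕ 2 ⊛ (R ⊖ D) ⊖ (R ⊖ 1ℚ) ⊛ (R ⊖ 1ℚ) ⊕ pℚ p ⊛ pℚ p ⊛ 0ℚ
      ≡⟨ cong₃ (λ r d z → fromℕ 2 ⊛ (r ⊖ d) ⊖ (r ⊖ 1ℚ) ⊛ (r ⊖ 1ℚ) ⊕ pℚ p ⊛ pℚ p ⊛ z)
               (sym (proj₁ (counts σ f h))) (sym (proj₂ (counts σ f h))) (sym (𝟙₀-≢0 f (HasType⇒≢0 σ f h σ≢s0))) ⟩
    θFormula f ∎
    where
    R = fromℕ (rootCount σ)
    D = fromℕ (multipleRootCount σ)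

  φ≡λFormula : ∀ (φ : Cubic p → ℚ) → (∀ σ f → HasType p σ f → φ f ≡ toℚ (λp σ)) → ∀ f → φ f ≡ λFormula f
  φ≡λFormula φ hφ f with classify f
  ... | σ , h = trans (hφ σ f h) (λp≡λFormula σ f h)

  θ≡θFormula : ∀ (θ : Cubic p → ℚ) → (∀ σ f → HasType p σ f → θ f ≡ toℚ (θp² σ)) → ∀ f → θ f ≡ θFormula f
  θ≡θFormula θ hθ f with classify f
  ... | σ , h = trans (hθ σ f h) (θp²≡θFormula σ f h)

module PairingCounts (p : ℕ) .{{_ : NonZero p}} (prime : Prime p) (i3 : Fp p) where

  open Sums
  open RationalIdentities
  open ZMod p
  open PrimeField p prime
  open AffineCounts p prime
  open ProjectiveLine p prime
  open RootCounts p prime using (#roots)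
  open SplitTypeValues p prime using (𝟙₀; λFormula)
  open Solver
  open ≡-Reasoning

  ∑V : (Cubic p → ℚ) → ℚ
  ∑V = sumV p

  ∑V-cong : ∀ {g h : Cubic p → ℚ} → (∀ f → g f ≡ h f) → ∑V g ≡ ∑V h
  ∑V-cong e = sumFin-cong λ a → sumFin-cong λ b → sumFin-cong λ c → sumFin-cong λ d → e (cubic a b c d)

  private
    on₄ : (Cubic p → ℚ) → F → F → F → F → ℚ
    on₄ g a b c d = g (cubic a b c d)

  ∑V-hom : ∀ (_∙_ : ℚ → ℚ → ℚ) → (∀ {n} (g h : Fin n → ℚ) → sumFin (λ i → g i ∙ h i) ≡ sumFin g ∙ sumFin h) →
    ∀ (g h : Cubic p → ℚ) → ∑V (λ f → g f ∙ h f) ≡ ∑V g ∙ ∑V h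
  ∑V-hom _∙_ hom g h =
    trans (sumFin-cong λ a →
      trans (sumFin-cong λ b →
        trans (sumFin-cong λ c → hom (G a b c) (H a b c))
              (hom (λ c → ∑ (G a b c)) (λ c → ∑ (H a b c))))
            (hom (λ b → ∑ λ c → ∑ (G a b c)) (λ b → ∑ λ c → ∑ (H a b c))))
          (hom (λ a → ∑ λ b → ∑ λ c → ∑ (G a b c)) (λ a → ∑ λ b → ∑ λ c → ∑ (H a b c)))
    where G = on₄ g
          H = on₄ h

  ∑V-+ : ∀ (g h : Cubic p → ℚ) → ∑V (λ f → g f ⊕ h f) ≡ ∑V g ⊕ ∑V h
  ∑V-+ = ∑V-hom _⊕_ sumFin-+

  ∑V-⊖ : ∀ (g h : Cubic p → ℚ) → ∑V (λ f → g f ⊖ h f) ≡ ∑V g ⊖ ∑V h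
  ∑V-⊖ = ∑V-hom _⊖_ sumFin-⊖

  ∑V-* : ∀ k (g : Cubic p → ℚ) → ∑V (λ f → k ⊛ g f) ≡ k ⊛ ∑V g
  ∑V-* k g =
    trans (sumFin-cong λ a →
      trans (sumFin-cong λ b →
        trans (sumFin-cong λ c → sumFin-* k (G a b c))
              (sumFin-* k (λ c → ∑ (G a b c))))
            (sumFin-* k (λ b → ∑ λ c → ∑ (G a b c))))
          (sumFin-* k (λ a → ∑ λ b → ∑ λ c → ∑ (G a b c)))
    where G = on₄ g

  ∑V-∑ℙ : ∀ (g : Cubic p → ℙ¹ → ℚ) → ∑V (λ f → ∑ℙ (g f)) ≡ ∑ℙ (λ P → ∑V (λ f → g f P))
  ∑V-∑ℙ g = trans (∑V-+ (λ f → ∑ (λ x → g f (fin x))) (λ f → g f ∞)) (cong (_⊕ ∑V (λ f → g f ∞)) swap)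
    where
    G : F → F → F → F → F → ℚ
    G a b c d x = g (cubic a b c d) (fin x)
    swap : ∑V (λ f → ∑ (λ x → g f (fin x))) ≡ ∑ (λ x → ∑V (λ f → g f (fin x)))
    swap = trans (sumFin-cong λ a →
             trans (sumFin-cong λ b →
               trans (sumFin-cong λ c → sumFin-swap (G a b c))
                     (sumFin-swap λ c x → ∑ λ d → G a b c d x))
                   (sumFin-swap λ b x → ∑ λ c → ∑ λ d → G a b c d x))
                 (sumFin-swap λ a x → ∑ λ b → ∑ λ c → ∑ λ d → G a b c d x)

  ∑V-𝟙₀ : ∀ (g : Cubic p → ℚ) → ∑V (λ f → 𝟙₀ f ⊛ g f) ≡ g (zeroC p)
  ∑V-𝟙₀ g =
    trans (sumFin-cong λ a →
      trans (sumFin-cong λ b →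
        trans (sumFin-cong λ c → sift (𝟙 (a ≟ 0') ⊛ 𝟙 (b ≟ 0') ⊛ 𝟙 (c ≟ 0')) (G a b c))
              (sift (𝟙 (a ≟ 0') ⊛ 𝟙 (b ≟ 0')) λ c → G a b c 0'))
            (sift (𝟙 (a ≟ 0')) λ b → G a b 0' 0'))
          (sumFin-𝟙≟ 0' λ a → G a 0' 0' 0')
    where
    G = on₄ g
    sift : ∀ k (h : F → ℚ) → ∑ (λ y → k ⊛ 𝟙 (y ≟ 0') ⊛ h y) ≡ k ⊛ h 0'
    sift k h = begin
      ∑ (λ y → k ⊛ 𝟙 (y ≟ 0') ⊛ h y)     ≡⟨ sumFin-cong (λ y → ℚ.*-assoc k (𝟙 (y ≟ 0')) (h y)) ⟩
      ∑ (λ y → k ⊛ (𝟙 (y ≟ 0') ⊛ h y))   ≡⟨ sumFin-* k (λ y → 𝟙 (y ≟ 0') ⊛ h y) ⟩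
      k ⊛ ∑ (λ y → 𝟙 (y ≟ 0') ⊛ h y)     ≡⟨ cong (k ⊛_) (sumFin-𝟙≟ 0' h) ⟩
      k ⊛ h 0'                           ∎

  -- The cubics vanishing at P, parametrised by three free coordinates.
  through : ℙ¹ → F → F → F → Cubic p
  through (fin x) a b c = cubic a b c (-' (a *' x *' x *' x +' b *' x *' x +' c *' x))
  through ∞       b c d = cubic 0' b c d

  ∑V-through : ∀ P (g : Cubic p → ℚ) → ∑V (λ f → 𝟙 (valC P f ≟ 0') ⊛ g f) ≡ ∑ λ y₁ → ∑ λ y₂ → ∑ λ y₃ → g (through P y₁ y₂ y₃)
  ∑V-through (fin x) g = sumFin-cong λ a → sumFin-cong λ b → sumFin-cong λ c →
    trans (sumFin-cong λ d → cong (_⊛ g (cubic a b c d)) (𝟙-cong (solved a b c d) (solves a b c d) (valC (fin x) (cubic a b c d) ≟ 0') (d ≟ d₀ a b c)))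
          (sumFin-𝟙≟ (d₀ a b c) (λ d → g (cubic a b c d)))
    where
    d₀ : F → F → F → F
    d₀ a b c = -' (a *' x *' x *' x +' b *' x *' x +' c *' x)
    solved : ∀ a b c d → valC (fin x) (cubic a b c d) ≡ 0' → d ≡ d₀ a b c
    solved a b c d e = begin
      d                  ≡⟨ solve 2 (λ S d → d := (S :+ d) :- S) refl S d ⟩
      (S +' d) +' -' S   ≡⟨ cong (_+' -' S) e ⟩
      0' +' -' S         ≡⟨ +-identityˡ (-' S) ⟩
      d₀ a b c         ∎
      where S = a *' x *' x *' x +' b *' x *' x +' c *' x
    solves : ∀ a b c d → d ≡ d₀ a b c → valC (fin x) (cubic a b c d) ≡ 0'
    solves a b c d refl = solve 1 (λ S → S :+ (:- S) := con (+ 0)) refl (a *' x *' x *' x +' b *' x *' x +' c *' x)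
  ∑V-through ∞ g = begin
    ∑V (λ f → 𝟙 (valC ∞ f ≟ 0') ⊛ g f)
      ≡⟨ sumFin-cong (λ a →
           trans (sumFin-cong λ b → trans (sumFin-cong λ c → sumFin-* (𝟙 (a ≟ 0')) (G a b c))
                                          (sumFin-* (𝟙 (a ≟ 0')) λ c → ∑ (G a b c)))
                 (sumFin-* (𝟙 (a ≟ 0')) λ b → ∑ λ c → ∑ (G a b c))) ⟩
    ∑ (λ a → 𝟙 (a ≟ 0') ⊛ ∑ λ b → ∑ λ c → ∑ (G a b c))
      ≡⟨ sumFin-𝟙≟ 0' (λ a → ∑ λ b → ∑ λ c → ∑ (G a b c)) ⟩
    ∑ (λ b → ∑ λ c → ∑ λ d → g (cubic 0' b c d)) ∎
    where G = on₄ g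

  pair : Cubic p → Cubic p → F
  pair f* f = pairing p i3 f f*

  -- The coefficients of the linear form f ↦ pair f* f on the cubics through P,
  -- in the coordinates of through P.
  hyperplaneCoefficients : ℙ¹ → Cubic p → F × F × F
  hyperplaneCoefficients (fin x) (cubic a₂ b₂ c₂ d₂) =
    -' (x *' x *' x *' a₂) +' -' d₂ , i3 *' c₂ +' -' (x *' x *' a₂) , -' (i3 *' b₂) +' -' (x *' a₂)
  hyperplaneCoefficients ∞ (cubic a₂ b₂ c₂ d₂) = i3 *' c₂ , -' (i3 *' b₂) , a₂

  AllZero : F × F × F → Set
  AllZero (α₁ , α₂ , α₃) = α₁ ≡ 0' × α₂ ≡ 0' × α₃ ≡ 0'

  allZero? : ∀ α → Dec (AllZero α)
  allZero? (α₁ , α₂ , α₃) = (α₁ ≟ 0') ×-dec (α₂ ≟ 0') ×-dec (α₃ ≟ 0')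

  -- f* annihilates the hyperplane of cubics vanishing at P.
  Annihilates : ℙ¹ → Cubic p → Set
  Annihilates P f* = AllZero (hyperplaneCoefficients P f*)

  annihilates? : ∀ P f* → Dec (Annihilates P f*)
  annihilates? P f* = allZero? (hyperplaneCoefficients P f*)

  linear₃ : F × F × F → F → F → F → F
  linear₃ (α₁ , α₂ , α₃) y₁ y₂ y₃ = α₁ *' y₁ +' α₂ *' y₂ +' α₃ *' y₃ +' 0'

  count-linear₃ : ∀ α t (d : Dec (AllZero α)) → ∑ (λ y₁ → ∑ λ y₂ → ∑ λ y₃ → 𝟙 (linear₃ α y₁ y₂ y₃ ≟ t))
                            ≡ (if does d then pℚ p ⊛ (pℚ p ⊛ (pℚ p ⊛ 𝟙 (0' ≟ t))) else p^ 2)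
  count-linear₃ (α₁ , α₂ , α₃) t (yes (e₁ , e₂ , e₃)) = count₃-≡0 α₁ α₂ α₃ 0' t e₁ e₂ e₃
  count-linear₃ (α₁ , α₂ , α₃) t (no ¬α≡0)            = count₃-≢0 α₁ α₂ α₃ 0' t ¬α≡0

  private
    pair-through : ∀ P f* y₁ y₂ y₃ → pair f* (through P y₁ y₂ y₃) ≡ linear₃ (hyperplaneCoefficients P f*) y₁ y₂ y₃
    pair-through (fin x) (cubic a₂ b₂ c₂ d₂) a b c =
      solve 9 (λ a b c x a₂ b₂ c₂ d₂ i → (:- (a :* x :* x :* x :+ b :* x :* x :+ c :* x)) :* a₂ :- i :* c :* b₂ :+ i :* b :* c₂ :- a :* d₂
                                         := (:- (x :* x :* x :* a₂) :- d₂) :* a :+ (i :* c₂ :- x :* x :* a₂) :* b :+ (:- (i :* b₂) :- x :* a₂) :* c :+ con (+ 0))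
              refl a b c x a₂ b₂ c₂ d₂ i3
    pair-through ∞ (cubic a₂ b₂ c₂ d₂) b c d =
      solve 8 (λ b c d a₂ b₂ c₂ d₂ i → d :* a₂ :- i :* c :* b₂ :+ i :* b :* c₂ :- con (+ 0) :* d₂
                                       := (i :* c₂) :* b :+ (:- (i :* b₂)) :* c :+ a₂ :* d :+ con (+ 0))
              refl b c d a₂ b₂ c₂ d₂ i3

  hyperplaneLevel : ℙ¹ → Cubic p → F → ℚ
  hyperplaneLevel P f* t = ∑V (λ f → 𝟙 (valC P f ≟ 0') ⊛ 𝟙 (pair f* f ≟ t))

  hyperplaneLevel≡ : ∀ P f* t → hyperplaneLevel P f* t ≡
    (if does (annihilates? P f*) then pℚ p ⊛ (pℚ p ⊛ (pℚ p ⊛ 𝟙 (0' ≟ t))) else p^ 2)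
  hyperplaneLevel≡ P f* t = begin
    hyperplaneLevel P f* t
      ≡⟨ ∑V-through P (λ f → 𝟙 (pair f* f ≟ t)) ⟩
    ∑ (λ y₁ → ∑ λ y₂ → ∑ λ y₃ → 𝟙 (pair f* (through P y₁ y₂ y₃) ≟ t))
      ≡⟨ sumFin-cong (λ y₁ → sumFin-cong λ y₂ → sumFin-cong λ y₃ → cong (λ w → 𝟙 (w ≟ t)) (pair-through P f* y₁ y₂ y₃)) ⟩
    ∑ (λ y₁ → ∑ λ y₂ → ∑ λ y₃ → 𝟙 (linear₃ (hyperplaneCoefficients P f*) y₁ y₂ y₃ ≟ t))
      ≡⟨ count-linear₃ (hyperplaneCoefficients P f*) t (annihilates? P f*) ⟩
    _ ∎

  level : Cubic p → F → ℚ
  level f* t = ∑V (λ f → 𝟙 (pair f* f ≟ t))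

  private
    pair≡linear₄ : ∀ f* a b c d → pair f* (cubic a b c d) ≡
      (-' Cubic.d f*) *' a +' (i3 *' Cubic.c f*) *' b +' (-' (i3 *' Cubic.b f*)) *' c +' Cubic.a f* *' d +' 0'
    pair≡linear₄ (cubic a₂ b₂ c₂ d₂) a b c d =
      solve 9 (λ a b c d a₂ b₂ c₂ d₂ i → d :* a₂ :- i :* c :* b₂ :+ i :* b :* c₂ :- a :* d₂
                                         := (:- d₂) :* a :+ (i :* c₂) :* b :+ (:- (i :* b₂)) :* c :+ a₂ :* d :+ con (+ 0))
              refl a b c d a₂ b₂ c₂ d₂ i3

    level≡count₄ : ∀ f* t → level f* t ≡
      ∑ (λ a → ∑ λ b → ∑ λ c → ∑ λ d → 𝟙 ((-' Cubic.d f*) *' a +' (i3 *' Cubic.c f*) *' b +' (-' (i3 *' Cubic.b f*)) *' c +' Cubic.a f* *' d +' 0' ≟ t))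
    level≡count₄ f* t = sumFin-cong λ a → sumFin-cong λ b → sumFin-cong λ c → sumFin-cong λ d →
      cong (λ w → 𝟙 (w ≟ t)) (pair≡linear₄ f* a b c d)

  level-≢0 : ⟦ + 3 ⟧ℤ *' i3 ≡ 1' → ∀ f* t → f* ≢ zeroC p → level f* t ≡ p^ 3
  level-≢0 3i3≡1 f*@(cubic a₂ b₂ c₂ d₂) t f*≢0 =
    trans (level≡count₄ f* t) (count₄-≢0 (-' d₂) (i3 *' c₂) (-' (i3 *' b₂)) a₂ 0' t coefficients≢0)
    where
    cancel-i3 : ∀ y → i3 *' y ≡ 0' → y ≡ 0'
    cancel-i3 y e = begin
      y                       ≡⟨ solve 1 (λ y → y := con (+ 1) :* y) refl y ⟩
      1' *' y                 ≡⟨ cong (_*' y) (sym 3i3≡1) ⟩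
      ⟦ + 3 ⟧ℤ *' i3 *' y     ≡⟨ solve 3 (λ t i y → t :* i :* y := t :* (i :* y)) refl ⟦ + 3 ⟧ℤ i3 y ⟩
      ⟦ + 3 ⟧ℤ *' (i3 *' y)   ≡⟨ cong (⟦ + 3 ⟧ℤ *'_) e ⟩
      ⟦ + 3 ⟧ℤ *' 0'          ≡⟨ zeroʳ ⟦ + 3 ⟧ℤ ⟩
      0'                      ∎
    neg≡0 : ∀ y → -' y ≡ 0' → y ≡ 0'
    neg≡0 y e = trans (solve 1 (λ y → y := :- (:- y)) refl y) (trans (cong -'_ e) (solve 0 (:- con (+ 0) := con (+ 0)) refl))
    coefficients≢0 : ¬ (-' d₂ ≡ 0' × i3 *' c₂ ≡ 0' × -' (i3 *' b₂) ≡ 0' × a₂ ≡ 0')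
    coefficients≢0 (e₁ , e₂ , e₃ , e₄) = f*≢0 (cubic-cong e₄ (cancel-i3 b₂ (neg≡0 _ e₃)) (cancel-i3 c₂ e₂) (neg≡0 d₂ e₁))

  level-zero : ∀ t → level (zeroC p) t ≡ pℚ p ⊛ (pℚ p ⊛ (pℚ p ⊛ (pℚ p ⊛ 𝟙 (0' ≟ t))))
  level-zero t = trans (level≡count₄ (zeroC p) t)
    (count₄-≡0 (-' 0') (i3 *' 0') (-' (i3 *' 0')) 0' 0' t
               (solve 0 (:- con (+ 0) := con (+ 0)) refl) (zeroʳ i3) (solve 1 (λ i → :- (i :* con (+ 0)) := con (+ 0)) refl i3) refl)

  pair-zeroʳ : ∀ f* → pair f* (zeroC p) ≡ 0'
  pair-zeroʳ (cubic a₂ b₂ c₂ d₂) =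
    solve 5 (λ a b c d i → con (+ 0) :* a :- i :* con (+ 0) :* b :+ i :* con (+ 0) :* c :- con (+ 0) :* d := con (+ 0)) refl a₂ b₂ c₂ d₂ i3

  pair-zeroˡ : ∀ f → pair (zeroC p) f ≡ 0'
  pair-zeroˡ (cubic a b c d) =
    solve 5 (λ a b c d i → d :* con (+ 0) :- i :* c :* con (+ 0) :+ i :* b :* con (+ 0) :- a :* con (+ 0) := con (+ 0)) refl a b c d i3

  -- The numerator of the Fourier coefficient of ζ^t.
  levelSum : (Cubic p → ℚ) → Cubic p → F → ℚ
  levelSum φ f* t = ∑V (λ f → if does (pair f* f ≟ t) then φ f else 0ℚ)

  -- Swapping the sum over f with the sum over the roots of f.
  levelSum-λFormula : ∀ f* t →
    levelSum λFormula f* t ≡ ∑ℙ (λ P → hyperplaneLevel P f* t) ⊖ level f* t ⊖ pℚ p ⊛ 𝟙 (0' ≟ t)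
  levelSum-λFormula f* t = begin
    ∑V (λ f → if does (pair f* f ≟ t) then λFormula f else 0ℚ)
      ≡⟨ ∑V-cong (λ f → trans (if-then-0≡𝟙* (pair f* f ≟ t) (λFormula f)) (distrib-λFormula (pℚ p) (𝟙 (pair f* f ≟ t)) (#roots f) (𝟙₀ f))) ⟩
    ∑V (λ f → 𝟙 (pair f* f ≟ t) ⊛ #roots f ⊖ 𝟙 (pair f* f ≟ t) ⊖ pℚ p ⊛ (𝟙₀ f ⊛ 𝟙 (pair f* f ≟ t)))
      ≡⟨ trans (∑V-⊖ _ _) (cong₂ _⊖_ (∑V-⊖ _ _) (∑V-* (pℚ p) (λ f → 𝟙₀ f ⊛ 𝟙 (pair f* f ≟ t)))) ⟩
    ∑V (λ f → 𝟙 (pair f* f ≟ t) ⊛ #roots f) ⊖ level f* t ⊖ pℚ p ⊛ ∑V (λ f → 𝟙₀ f ⊛ 𝟙 (pair f* f ≟ t))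
      ≡⟨ cong₂ (λ a b → a ⊖ level f* t ⊖ pℚ p ⊛ b) roots-first (trans (∑V-𝟙₀ (λ f → 𝟙 (pair f* f ≟ t))) (cong (λ w → 𝟙 (w ≟ t)) (pair-zeroʳ f*))) ⟩
    ∑ℙ (λ P → hyperplaneLevel P f* t) ⊖ level f* t ⊖ pℚ p ⊛ 𝟙 (0' ≟ t) ∎
    where
    roots-first : ∑V (λ f → 𝟙 (pair f* f ≟ t) ⊛ #roots f) ≡ ∑ℙ (λ P → hyperplaneLevel P f* t)
    roots-first = begin
      ∑V (λ f → 𝟙 (pair f* f ≟ t) ⊛ #roots f)
        ≡⟨ ∑V-cong (λ f → trans (sym (∑ℙ-* (𝟙 (pair f* f ≟ t)) (λ P → 𝟙 (valC P f ≟ 0'))))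
                                (∑ℙ-cong (λ P → ℚ.*-comm (𝟙 (pair f* f ≟ t)) (𝟙 (valC P f ≟ 0'))))) ⟩
      ∑V (λ f → ∑ℙ (λ P → 𝟙 (valC P f ≟ 0') ⊛ 𝟙 (pair f* f ≟ t)))
        ≡⟨ ∑V-∑ℙ (λ f P → 𝟙 (valC P f ≟ 0') ⊛ 𝟙 (pair f* f ≟ t)) ⟩
      ∑ℙ (λ P → hyperplaneLevel P f* t) ∎

module DualCubes (p : ℕ) .{{_ : NonZero p}} (prime : Prime p) (i3 : Fp p)
                 (3i3≡1 : ZMod._*'_ p (ZMod.⟦_⟧ℤ p (+ 3)) i3 ≡ ZMod.1' p) where

  open ZMod p
  open PrimeField p prime
  open ProjectiveLine p prime
  open RootCounts p prime using (HasType⇒≢0; s1³-unique)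
  open PairingCounts p prime i3 using (Annihilates; annihilates?)
  open Solver
  open ≡-Reasoning

  -- μ times the cube of vanishingAt P, i.e. μ (X - x Y)³ or μ Y³.
  cube : F → ℙ¹ → Cubic p
  cube μ (fin x) = cubic μ (-' (⟦ + 3 ⟧ℤ *' μ *' x)) (⟦ + 3 ⟧ℤ *' μ *' x *' x) (-' (μ *' x *' x *' x))
  cube μ ∞       = cubic 0' 0' 0' μ

  scale : F → Lin p → Lin p
  scale μ (lin u v) = lin (μ *' u) (μ *' v)

  private
    three≢0 : ⟦ + 3 ⟧ℤ ≢ 0'
    three≢0 e = 1'≢0' (trans (sym 3i3≡1) (trans (cong (_*' i3) e) (zeroˡ i3)))

    thirds : ∀ y z → i3 *' y ≡ z → y ≡ ⟦ + 3 ⟧ℤ *' z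
    thirds y z e = begin
      y                      ≡⟨ solve 1 (λ y → y := con (+ 1) :* y) refl y ⟩
      1' *' y                ≡⟨ cong (_*' y) (sym 3i3≡1) ⟩
      ⟦ + 3 ⟧ℤ *' i3 *' y    ≡⟨ solve 3 (λ t i y → t :* i :* y := t :* (i :* y)) refl ⟦ + 3 ⟧ℤ i3 y ⟩
      ⟦ + 3 ⟧ℤ *' (i3 *' y)  ≡⟨ cong (⟦ + 3 ⟧ℤ *'_) e ⟩
      ⟦ + 3 ⟧ℤ *' z          ∎

    ≡-from-difference : ∀ y z → y +' -' z ≡ 0' → y ≡ z
    ≡-from-difference y z e = begin
      y                   ≡⟨ solve 2 (λ y z → y := (y :- z) :+ z) refl y z ⟩
      (y +' -' z) +' z    ≡⟨ cong (_+' z) e ⟩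
      0' +' z             ≡⟨ +-identityˡ z ⟩
      z                   ∎

  -- The coefficient μ of a cube annihilating P.
  leading : ℙ¹ → Cubic p → F
  leading (fin x) f* = Cubic.a f*
  leading ∞       f* = Cubic.d f*

  annihilates⇒cube : ∀ P f* → Annihilates P f* → f* ≡ cube (leading P f*) P
  annihilates⇒cube (fin x) (cubic a b c d) (e₁ , e₂ , e₃) = cubic-cong refl
    (trans (thirds b (-' (a *' x)) (begin
       i3 *' b                                         ≡⟨ solve 3 (λ i b w → i :* b := :- (:- (i :* b) :- w) :- w) refl i3 b (x *' a) ⟩
       -' (-' (i3 *' b) +' -' (x *' a)) +' -' (x *' a) ≡⟨ cong (λ w → -' w +' -' (x *' a)) e₃ ⟩
       -' 0' +' -' (x *' a)                            ≡⟨ solve 2 (λ x a → :- con (+ 0) :- x :* a := :- (a :* x)) refl x a ⟩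
       -' (a *' x)                                     ∎))
           (solve 3 (λ t a x → t :* (:- (a :* x)) := :- (t :* a :* x)) refl ⟦ + 3 ⟧ℤ a x))
    (trans (thirds c (x *' x *' a) (≡-from-difference (i3 *' c) (x *' x *' a) e₂))
           (solve 3 (λ t a x → t :* (x :* x :* a) := t :* a :* x :* x) refl ⟦ + 3 ⟧ℤ a x))
    (begin
       d                                                         ≡⟨ solve 3 (λ d a x → d := :- (:- (x :* x :* x :* a) :- d) :- a :* x :* x :* x) refl d a x ⟩
       -' (-' (x *' x *' x *' a) +' -' d) +' -' (a *' x *' x *' x) ≡⟨ cong (λ w → -' w +' -' (a *' x *' x *' x)) e₁ ⟩
       -' 0' +' -' (a *' x *' x *' x)                            ≡⟨ solve 1 (λ w → :- con (+ 0) :+ w := w) refl (-' (a *' x *' x *' x)) ⟩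
       -' (a *' x *' x *' x)                                     ∎)
  annihilates⇒cube ∞ (cubic a b c d) (e₁ , e₂ , e₃) = cubic-cong e₃
    (trans (thirds b 0' (trans (solve 1 (λ w → w := :- (:- w)) refl (i3 *' b)) (trans (cong -'_ e₂) (solve 0 (:- con (+ 0) := con (+ 0)) refl))))
           (zeroʳ ⟦ + 3 ⟧ℤ))
    (trans (thirds c 0' e₁) (zeroʳ ⟦ + 3 ⟧ℤ))
    refl

  cube-annihilates : ∀ μ P → Annihilates P (cube μ P)
  cube-annihilates μ (fin x) =
    solve 2 (λ m x → :- (x :* x :* x :* m) :- (:- (m :* x :* x :* x)) := con (+ 0)) refl μ x ,
    trans (solve 3 (λ i m x → i :* (con (+ 3) :* m :* x :* x) :- x :* x :* m := (con (+ 3) :* i :- con (+ 1)) :* (m :* x :* x)) refl i3 μ x)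
          (3i3-1-kills (μ *' x *' x)) ,
    trans (solve 3 (λ i m x → :- (i :* (:- (con (+ 3) :* m :* x))) :- x :* m := (con (+ 3) :* i :- con (+ 1)) :* (m :* x)) refl i3 μ x)
          (3i3-1-kills (μ *' x))
    where
    3i3-1-kills : ∀ w → (⟦ + 3 ⟧ℤ *' i3 +' -' 1') *' w ≡ 0'
    3i3-1-kills w = trans (cong (λ z → (z +' -' 1') *' w) 3i3≡1) (solve 1 (λ w → (con (+ 1) :- con (+ 1)) :* w := con (+ 0)) refl w)
  cube-annihilates μ ∞ = zeroʳ i3 , solve 1 (λ i → :- (i :* con (+ 0)) := con (+ 0)) refl i3 , refl

  cube-zero : ∀ P → cube 0' P ≡ zeroC p
  cube-zero (fin x) = cubic-cong refl
    (solve 1 (λ x → :- (con (+ 3) :* con (+ 0) :* x) := con (+ 0)) refl x)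
    (solve 1 (λ x → con (+ 3) :* con (+ 0) :* x :* x := con (+ 0)) refl x)
    (solve 1 (λ x → :- (con (+ 0) :* x :* x :* x) := con (+ 0)) refl x)
  cube-zero ∞ = refl

  scaled-cube : ∀ c₁ c₂ c₃ P → mulLQ p (scale c₁ (vanishingAt P)) (mulLL p (scale c₂ (vanishingAt P)) (scale c₃ (vanishingAt P)))
                              ≡ cube (c₁ *' (c₂ *' c₃)) P
  scaled-cube c₁ c₂ c₃ (fin x) = cubic-cong
    (solve 3 (λ a b c → (a :* con (+ 1)) :* ((b :* con (+ 1)) :* (c :* con (+ 1))) := a :* (b :* c)) refl c₁ c₂ c₃)
    (solve 4 (λ a b c x → (a :* con (+ 1)) :* ((b :* con (+ 1)) :* (c :* (:- x)) :+ (b :* (:- x)) :* (c :* con (+ 1)))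
                          :+ (a :* (:- x)) :* ((b :* con (+ 1)) :* (c :* con (+ 1))) := :- (con (+ 3) :* (a :* (b :* c)) :* x)) refl c₁ c₂ c₃ x)
    (solve 4 (λ a b c x → (a :* con (+ 1)) :* ((b :* (:- x)) :* (c :* (:- x)))
                          :+ (a :* (:- x)) :* ((b :* con (+ 1)) :* (c :* (:- x)) :+ (b :* (:- x)) :* (c :* con (+ 1)))
                          := con (+ 3) :* (a :* (b :* c)) :* x :* x) refl c₁ c₂ c₃ x)
    (solve 4 (λ a b c x → (a :* (:- x)) :* ((b :* (:- x)) :* (c :* (:- x))) := :- (a :* (b :* c) :* x :* x :* x)) refl c₁ c₂ c₃ x)
  scaled-cube c₁ c₂ c₃ ∞ = cubic-cong
    (solve 3 (λ a b c → (a :* con (+ 0)) :* ((b :* con (+ 0)) :* (c :* con (+ 0))) := con (+ 0)) refl c₁ c₂ c₃)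
    (solve 3 (λ a b c → (a :* con (+ 0)) :* ((b :* con (+ 0)) :* (c :* con (+ 1)) :+ (b :* con (+ 1)) :* (c :* con (+ 0)))
                        :+ (a :* con (+ 1)) :* ((b :* con (+ 0)) :* (c :* con (+ 0))) := con (+ 0)) refl c₁ c₂ c₃)
    (solve 3 (λ a b c → (a :* con (+ 0)) :* ((b :* con (+ 1)) :* (c :* con (+ 1)))
                        :+ (a :* con (+ 1)) :* ((b :* con (+ 0)) :* (c :* con (+ 1)) :+ (b :* con (+ 1)) :* (c :* con (+ 0))) := con (+ 0)) refl c₁ c₂ c₃)
    (solve 3 (λ a b c → (a :* con (+ 1)) :* ((b :* con (+ 1)) :* (c :* con (+ 1))) := a :* (b :* c)) refl c₁ c₂ c₃)

  cube-1³ : ∀ μ P → μ ≢ 0' → HasType p s1³ (cube μ P)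
  cube-1³ μ P μ≢0 = scale μ M , scale 1' M , scale 1' M , scale-nonzero μ≢0 , scale-nonzero 1'≢0' , scale-nonzero 1'≢0' ,
                    Prop-scale μ 1' , Prop-scale μ 1' ,
                    trans (cong (λ m → cube m P) (solve 1 (λ m → m := m :* (con (+ 1) :* con (+ 1))) refl μ)) (sym (scaled-cube μ 1' 1' P))
    where
    M = vanishingAt P
    scale-nonzero : ∀ {c} → c ≢ 0' → NonzeroLin p (scale c M)
    scale-nonzero {c} c≢0 (e₁ , e₂) = vanishingAt-nonzero P
      ( [ (λ c≡0 → ⊥-elim (c≢0 c≡0)) , id ]′ (*-≡0 c (Lin.u M) e₁)
      , [ (λ c≡0 → ⊥-elim (c≢0 c≡0)) , id ]′ (*-≡0 c (Lin.v M) e₂) )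
    Prop-scale : ∀ c c′ → Prop p (scale c M) (scale c′ M)
    Prop-scale c c′ = solve 4 (λ c c′ u v → (c :* u) :* (c′ :* v) := (c′ :* u) :* (c :* v)) refl c c′ (Lin.u M) (Lin.v M)

  cube-injective : ∀ {μ μ′} P Q → μ ≢ 0' → cube μ P ≡ cube μ′ Q → P ≡ Q
  cube-injective {μ} (fin x) (fin y) μ≢0 e with cong Cubic.a e
  ... | refl = cong fin (≡-from-difference x y ([ (λ 3μ≡0 → ⊥-elim ([ three≢0 , μ≢0 ]′ (*-≡0 _ μ 3μ≡0))) , id ]′ (*-≡0 (⟦ + 3 ⟧ℤ *' μ) (x +' -' y) 3μ[x-y]≡0)))
    where
    3μ[x-y]≡0 : ⟦ + 3 ⟧ℤ *' μ *' (x +' -' y) ≡ 0'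
    3μ[x-y]≡0 = begin
      ⟦ + 3 ⟧ℤ *' μ *' (x +' -' y)                          ≡⟨ solve 3 (λ m x y → con (+ 3) :* m :* (x :- y) := :- (con (+ 3) :* m :* y) :- (:- (con (+ 3) :* m :* x))) refl μ x y ⟩
      -' (⟦ + 3 ⟧ℤ *' μ *' y) +' -' (-' (⟦ + 3 ⟧ℤ *' μ *' x)) ≡⟨ cong (λ w → -' (⟦ + 3 ⟧ℤ *' μ *' y) +' -' w) (cong Cubic.b e) ⟩
      -' (⟦ + 3 ⟧ℤ *' μ *' y) +' -' (-' (⟦ + 3 ⟧ℤ *' μ *' y)) ≡⟨ solve 1 (λ w → :- w :- (:- w) := con (+ 0)) refl (⟦ + 3 ⟧ℤ *' μ *' y) ⟩
      0'                                                   ∎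
  cube-injective (fin x) ∞ μ≢0 e = ⊥-elim (μ≢0 (cong Cubic.a e))
  cube-injective {μ} {μ′} ∞ (fin y) μ≢0 e = ⊥-elim (μ≢0 (trans (cong Cubic.d e) (begin
    -' (μ′ *' y *' y *' y)   ≡⟨ cong (λ m → -' (m *' y *' y *' y)) (sym (cong Cubic.a e)) ⟩
    -' (0' *' y *' y *' y)   ≡⟨ solve 1 (λ y → :- (con (+ 0) :* y :* y :* y) := con (+ 0)) refl y ⟩
    0'                       ∎)))
  cube-injective ∞ ∞ μ≢0 e = refl

  private
    lead : Lin p → F
    lead (lin u v) with u ≟ 0'
    ... | yes _ = v
    ... | no _  = u

    scale-root : ∀ L → L ≡ scale (lead L) (vanishingAt (root L))
    scale-root (lin u v) with u ≟ 0'
    ... | yes refl = cong₂ lin (solve 1 (λ v → con (+ 0) := v :* con (+ 0)) refl v) (solve 1 (λ v → v := v :* con (+ 1)) refl v)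
    ... | no u≢0   = cong₂ lin (solve 1 (λ u → u := u :* con (+ 1)) refl u) (begin
      v                        ≡⟨ solve 1 (λ v → v := con (+ 1) :* v) refl v ⟩
      1' *' v                  ≡⟨ cong (_*' v) (sym (⁻¹-inverseʳ u u≢0)) ⟩
      u *' u ⁻¹ *' v           ≡⟨ solve 3 (λ u i v → u :* i :* v := u :* (:- (:- v :* i))) refl u (u ⁻¹) v ⟩
      u *' -' (-' v *' u ⁻¹)   ∎)

    Prop⇒same-root : ∀ L₁ L → NonzeroLin p L₁ → NonzeroLin p L → Prop p L₁ L → root L ≡ root L₁
    Prop⇒same-root L₁ L L₁≢0 L≢0 prop =
      sym (vanishes⇒≡root L L≢0 (root L₁) (Prop⇒root L₁ L L₁≢0 prop (root L₁) (root-vanishes L₁ L₁≢0)))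

  1³⇒cube : ∀ f* → HasType p s1³ f* → Σ F λ μ → Σ ℙ¹ λ P₀ → f* ≡ cube μ P₀
  1³⇒cube f* (L₁ , L₂ , L₃ , L₁≢0 , L₂≢0 , L₃≢0 , p₁₂ , p₁₃ , refl) = lead L₁ *' (lead L₂ *' lead L₃) , root L₁ , (begin
    mulLQ p L₁ (mulLL p L₂ L₃)
      ≡⟨ cong₂ (mulLQ p) (scale-root L₁) (cong₂ (mulLL p) (at-root L₂ L₂≢0 p₁₂) (at-root L₃ L₃≢0 p₁₃)) ⟩
    mulLQ p (scale (lead L₁) M) (mulLL p (scale (lead L₂) M) (scale (lead L₃) M))
      ≡⟨ scaled-cube (lead L₁) (lead L₂) (lead L₃) (root L₁) ⟩
    cube (lead L₁ *' (lead L₂ *' lead L₃)) (root L₁) ∎)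
    where
    M = vanishingAt (root L₁)
    at-root : ∀ L → NonzeroLin p L → Prop p L₁ L → L ≡ scale (lead L) M
    at-root L L≢0 prop = trans (scale-root L) (cong (λ Q → scale (lead L) (vanishingAt Q)) (Prop⇒same-root L₁ L L₁≢0 L≢0 prop))

  zero-annihilated : ∀ P → Annihilates P (zeroC p)
  zero-annihilated P = subst (Annihilates P) (cube-zero P) (cube-annihilates 0' P)

  1³-annihilated-once : ∀ f* → HasType p s1³ f* → Σ ℙ¹ λ P₀ → Annihilates P₀ f* × (∀ P → Annihilates P f* → P ≡ P₀)
  1³-annihilated-once f* h with 1³⇒cube f* h
  ... | μ , P₀ , refl = P₀ , cube-annihilates μ P₀ , λ P a → sym (cube-injective P₀ P μ≢0 (annihilates⇒cube P (cube μ P₀) a))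
    where
    μ≢0 : μ ≢ 0'
    μ≢0 refl = HasType⇒≢0 s1³ (cube 0' P₀) h (λ ()) (cube-zero P₀)

  never-annihilated : ∀ σ f* → HasType p σ f* → σ ≢ s0 → σ ≢ s1³ → ∀ P → ¬ Annihilates P f*
  never-annihilated σ f* h σ≢s0 σ≢s1³ P a = by-leading (leading P f* ≟ 0')
    where
    f*≡cube = annihilates⇒cube P f* a
    by-leading : Dec (leading P f* ≡ 0') → ⊥
    by-leading (yes μ≡0) = HasType⇒≢0 σ f* h σ≢s0 (trans f*≡cube (trans (cong (λ μ → cube μ P) μ≡0) (cube-zero P)))
    by-leading (no μ≢0)  = σ≢s1³ (s1³-unique σ f* (subst (HasType p s1³) (sym f*≡cube) (cube-1³ (leading P f*) P μ≢0)) h)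

module LambdaTransform (p : ℕ) .{{_ : NonZero p}} (prime : Prime p) (i3 : Fp p)
                       (3i3≡1 : ZMod._*'_ p (ZMod.⟦_⟧ℤ p (+ 3)) i3 ≡ ZMod.1' p) where

  open Sums
  open RationalIdentities
  open ZMod p
  open AffineCounts p prime using (p^_)
  open ProjectiveLine p prime
  open RootCounts p prime using (HasType⇒≢0)
  open SplitTypeValues p prime using (λFormula)
  open PairingCounts p prime i3
  open DualCubes p prime i3 3i3≡1
  open ≡-Reasoning

  private
    u = pinv p

    δ : F → ℚ
    δ t = 𝟙 (0' ≟ t)

    X : F → ℚ
    X t = pℚ p ⊛ (pℚ p ⊛ (pℚ p ⊛ δ t))

    ∑ℙ-levels-none : ∀ f* t → (∀ P → ¬ Annihilates P f*) → ∑ℙ (λ P → hyperplaneLevel P f* t) ≡ (pℚ p ⊕ 1ℚ) ⊛ p^ 2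
    ∑ℙ-levels-none f* t none = trans (∑ℙ-cong (λ P → trans (hyperplaneLevel≡ P f* t) (else-branch (annihilates? P f*) (none P)))) (∑ℙ-const (p^ 2))
      where
      else-branch : ∀ {A : Set} (d : Dec A) → ¬ A → (if does d then X t else p^ 2) ≡ p^ 2
      else-branch (yes a) ¬a = ⊥-elim (¬a a)
      else-branch (no _)  _  = refl

    ∑ℙ-levels-all : ∀ f* t → (∀ P → Annihilates P f*) → ∑ℙ (λ P → hyperplaneLevel P f* t) ≡ (pℚ p ⊕ 1ℚ) ⊛ X t
    ∑ℙ-levels-all f* t all = trans (∑ℙ-cong (λ P → trans (hyperplaneLevel≡ P f* t) (then-branch (annihilates? P f*) (all P)))) (∑ℙ-const (X t))
      where
      then-branch : ∀ {A : Set} (d : Dec A) → A → (if does d then X t else p^ 2) ≡ X t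
      then-branch (yes _) _ = refl
      then-branch (no ¬a) a = ⊥-elim (¬a a)

    ∑ℙ-levels-one : ∀ f* t P₀ → Annihilates P₀ f* → (∀ P → Annihilates P f* → P ≡ P₀) →
      ∑ℙ (λ P → hyperplaneLevel P f* t) ≡ (pℚ p ⊕ 1ℚ) ⊛ p^ 2 ⊕ (X t ⊖ p^ 2)
    ∑ℙ-levels-one f* t P₀ a₀ only = begin
      ∑ℙ (λ P → hyperplaneLevel P f* t)                     ≡⟨ ∑ℙ-cong (λ P → trans (hyperplaneLevel≡ P f* t) (split P (annihilates? P f*) (P ≟ℙ P₀))) ⟩
      ∑ℙ (λ P → p^ 2 ⊕ 𝟙 (P ≟ℙ P₀) ⊛ (X t ⊖ p^ 2))          ≡⟨ ∑ℙ-+ (λ _ → p^ 2) (λ P → 𝟙 (P ≟ℙ P₀) ⊛ (X t ⊖ p^ 2)) ⟩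
      ∑ℙ (λ _ → p^ 2) ⊕ ∑ℙ (λ P → 𝟙 (P ≟ℙ P₀) ⊛ (X t ⊖ p^ 2)) ≡⟨ cong₂ _⊕_ (∑ℙ-const (p^ 2)) (∑ℙ-𝟙≟ P₀ (λ _ → X t ⊖ p^ 2)) ⟩
      (pℚ p ⊕ 1ℚ) ⊛ p^ 2 ⊕ (X t ⊖ p^ 2)                     ∎
      where
      split : ∀ P (d : Dec (Annihilates P f*)) (e : Dec (P ≡ P₀)) → (if does d then X t else p^ 2) ≡ p^ 2 ⊕ 𝟙 e ⊛ (X t ⊖ p^ 2)
      split P (yes _) (yes _)    = sym (trans (cong (p^ 2 ⊕_) (ℚ.*-identityˡ (X t ⊖ p^ 2))) (y+[x-y]≡x (X t) (p^ 2)))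
      split P (yes a) (no P≢P₀)  = ⊥-elim (P≢P₀ (only P a))
      split P (no ¬a) (yes refl) = ⊥-elim (¬a a₀)
      split P (no _)  (no _)     = sym (trans (cong (p^ 2 ⊕_) (ℚ.*-zeroˡ (X t ⊖ p^ 2))) (ℚ.+-identityʳ (p^ 2)))

    fourier-difference : ∀ φ → (∀ f → φ f ≡ λFormula f) → ∀ f* r t →
      fourier p i3 φ f* t ⊖ ratC p r t ≡ u ⊛ u ⊛ u ⊛ u ⊛ (∑ℙ (λ P → hyperplaneLevel P f* t) ⊖ level f* t ⊖ pℚ p ⊛ δ t) ⊖ δ t ⊛ r
    fourier-difference φ φ≡λ f* r t = cong₂ (λ a b → u ⊛ u ⊛ u ⊛ u ⊛ a ⊖ b)
      (trans (∑V-cong (λ f → cong (λ w → if does (pair f* f ≟ t) then w else 0ℚ) (φ≡λ f))) (levelSum-λFormula f* t))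
      (trans (if-then-0≡𝟙* (t ≟ 0') r) (cong (_⊛ r) (𝟙-cong sym sym (t ≟ 0') (0' ≟ t))))

    uP≡1 : u ⊛ pℚ p ≡ 1ℚ
    uP≡1 = 1/n*n≡1 p

  λ̂-generic : ∀ φ → (∀ f → φ f ≡ λFormula f) → ∀ σ f* → HasType p σ f* → σ ≢ s0 → σ ≢ s1³ →
    fourier p i3 φ f* ≈ᶜ ratC p (ℚ.- (u ⊛ u ⊛ u))
  λ̂-generic φ φ≡λ σ f* h σ≢s0 σ≢s1³ = u ⊛ u ⊛ u ⊛ u ⊛ (pℚ p ⊛ pℚ p) , λ t → begin
    fourier p i3 φ f* t ⊖ ratC p (ℚ.- (u ⊛ u ⊛ u)) t
      ≡⟨ fourier-difference φ φ≡λ f* _ t ⟩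
    u ⊛ u ⊛ u ⊛ u ⊛ (∑ℙ (λ P → hyperplaneLevel P f* t) ⊖ level f* t ⊖ pℚ p ⊛ δ t) ⊖ δ t ⊛ ℚ.- (u ⊛ u ⊛ u)
      ≡⟨ cong₂ (λ a b → u ⊛ u ⊛ u ⊛ u ⊛ (a ⊖ b ⊖ pℚ p ⊛ δ t) ⊖ δ t ⊛ ℚ.- (u ⊛ u ⊛ u))
               (∑ℙ-levels-none f* t (never-annihilated σ f* h σ≢s0 σ≢s1³)) (level-≢0 3i3≡1 f* t (HasType⇒≢0 σ f* h σ≢s0)) ⟩
    u ⊛ u ⊛ u ⊛ u ⊛ ((pℚ p ⊕ 1ℚ) ⊛ p^ 2 ⊖ p^ 3 ⊖ pℚ p ⊛ δ t) ⊖ δ t ⊛ ℚ.- (u ⊛ u ⊛ u)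
      ≡⟨ fourier-generic u (pℚ p) (δ t) uP≡1 ⟩
    u ⊛ u ⊛ u ⊛ u ⊛ (pℚ p ⊛ pℚ p) ∎

  λ̂-1³ : ∀ φ → (∀ f → φ f ≡ λFormula f) → ∀ f* → HasType p s1³ f* →
    fourier p i3 φ f* ≈ᶜ ratC p ((pℚ p ⊛ pℚ p ⊖ 1ℚ) ⊛ (u ⊛ u ⊛ u))
  λ̂-1³ φ φ≡λ f* h with 1³-annihilated-once f* h
  ... | P₀ , a₀ , only = 0ℚ , λ t → begin
    fourier p i3 φ f* t ⊖ ratC p r t
      ≡⟨ fourier-difference φ φ≡λ f* r t ⟩
    u ⊛ u ⊛ u ⊛ u ⊛ (∑ℙ (λ P → hyperplaneLevel P f* t) ⊖ level f* t ⊖ pℚ p ⊛ δ t) ⊖ δ t ⊛ r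
      ≡⟨ cong₂ (λ a b → u ⊛ u ⊛ u ⊛ u ⊛ (a ⊖ b ⊖ pℚ p ⊛ δ t) ⊖ δ t ⊛ r)
               (∑ℙ-levels-one f* t P₀ a₀ only) (level-≢0 3i3≡1 f* t (HasType⇒≢0 s1³ f* h (λ ()))) ⟩
    u ⊛ u ⊛ u ⊛ u ⊛ ((pℚ p ⊕ 1ℚ) ⊛ p^ 2 ⊕ (X t ⊖ p^ 2) ⊖ p^ 3 ⊖ pℚ p ⊛ δ t) ⊖ δ t ⊛ r
      ≡⟨ fourier-1³ u (pℚ p) (δ t) uP≡1 ⟩
    0ℚ ∎
    where r = (pℚ p ⊛ pℚ p ⊖ 1ℚ) ⊛ (u ⊛ u ⊛ u)

  λ̂-0 : ∀ φ → (∀ f → φ f ≡ λFormula f) → fourier p i3 φ (zeroC p) ≈ᶜ ratC p ((pℚ p ⊛ pℚ p ⊖ 1ℚ) ⊛ (u ⊛ u ⊛ u))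
  λ̂-0 φ φ≡λ = 0ℚ , λ t → begin
    fourier p i3 φ (zeroC p) t ⊖ ratC p r t
      ≡⟨ fourier-difference φ φ≡λ (zeroC p) r t ⟩
    u ⊛ u ⊛ u ⊛ u ⊛ (∑ℙ (λ P → hyperplaneLevel P (zeroC p) t) ⊖ level (zeroC p) t ⊖ pℚ p ⊛ δ t) ⊖ δ t ⊛ r
      ≡⟨ cong₂ (λ a b → u ⊛ u ⊛ u ⊛ u ⊛ (a ⊖ b ⊖ pℚ p ⊛ δ t) ⊖ δ t ⊛ r) (∑ℙ-levels-all (zeroC p) t zero-annihilated) (level-zero t) ⟩
    u ⊛ u ⊛ u ⊛ u ⊛ ((pℚ p ⊕ 1ℚ) ⊛ X t ⊖ pℚ p ⊛ (pℚ p ⊛ (pℚ p ⊛ (pℚ p ⊛ δ t))) ⊖ pℚ p ⊛ δ t) ⊖ δ t ⊛ r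
      ≡⟨ fourier-0 u (pℚ p) (δ t) uP≡1 ⟩
    0ℚ ∎
    where r = (pℚ p ⊛ pℚ p ⊖ 1ℚ) ⊛ (u ⊛ u ⊛ u)

module ThetaTransform (p : ℕ) .{{_ : NonZero p}} (prime : Prime p) (i3 : Fp p) where

  open Sums
  open RationalIdentities
  open ZMod p
  open PrimeField p prime using (1'≢0')
  open AffineCounts p prime using (∑; ∑-const; p^_)
  open ProjectiveLine p prime
  open RootCounts p prime using (#roots; #multipleRoots)
  open SplitTypeValues p prime using (𝟙₀; θFormula)
  open PairingCounts p prime i3
  open Solver
  open ≡-Reasoning

  private
    ∑³-1 : (∑ λ a → ∑ λ b → ∑ λ c → 1ℚ) ≡ p^ 3
    ∑³-1 = trans (sumFin-cong {p} λ a → trans (sumFin-cong {p} λ b → ∑-const 1ℚ) (∑-const (p^ 1))) (∑-const (p^ 2))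

    ∑V-1 : ∑V (λ _ → 1ℚ) ≡ p^ 4
    ∑V-1 = trans (sumFin-cong {p} λ a → ∑³-1) (∑-const (p^ 3))

    ∑V-vanishingAt : ∀ P → ∑V (λ f → 𝟙 (valC P f ≟ 0')) ≡ p^ 3
    ∑V-vanishingAt P = trans (∑V-cong (λ f → sym (ℚ.*-identityʳ (𝟙 (valC P f ≟ 0'))))) (trans (∑V-through P (λ _ → 1ℚ)) ∑³-1)

    derC-through : ℙ¹ → F × F × F
    derC-through (fin x) = ⟦ + 3 ⟧ℤ *' x *' x , ⟦ + 2 ⟧ℤ *' x , 1'
    derC-through ∞       = 1' , 0' , 0'

    derC∘through : ∀ P y₁ y₂ y₃ → derC P (through P y₁ y₂ y₃) ≡ linear₃ (derC-through P) y₁ y₂ y₃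
    derC∘through (fin x) a b c = solve 4 (λ a b c x → con (+ 3) :* a :* x :* x :+ con (+ 2) :* b :* x :+ c
                                                    := con (+ 3) :* x :* x :* a :+ con (+ 2) :* x :* b :+ con (+ 1) :* c :+ con (+ 0)) refl a b c x
    derC∘through ∞ b c d = solve 3 (λ b c d → b := con (+ 1) :* b :+ con (+ 0) :* c :+ con (+ 0) :* d :+ con (+ 0)) refl b c d

    derC-through≢0 : ∀ P → ¬ AllZero (derC-through P)
    derC-through≢0 (fin x) (_ , _ , e) = 1'≢0' e
    derC-through≢0 ∞       (e , _ , _) = 1'≢0' e

    ∑V-multipleRootAt : ∀ P → ∑V (λ f → 𝟙 ((valC P f ≟ 0') ×-dec (derC P f ≟ 0'))) ≡ p^ 2
    ∑V-multipleRootAt P = begin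
      ∑V (λ f → 𝟙 ((valC P f ≟ 0') ×-dec (derC P f ≟ 0')))
        ≡⟨ ∑V-cong (λ f → 𝟙-× (valC P f ≟ 0') (derC P f ≟ 0')) ⟩
      ∑V (λ f → 𝟙 (valC P f ≟ 0') ⊛ 𝟙 (derC P f ≟ 0'))
        ≡⟨ ∑V-through P (λ f → 𝟙 (derC P f ≟ 0')) ⟩
      ∑ (λ y₁ → ∑ λ y₂ → ∑ λ y₃ → 𝟙 (derC P (through P y₁ y₂ y₃) ≟ 0'))
        ≡⟨ sumFin-cong (λ y₁ → sumFin-cong λ y₂ → sumFin-cong λ y₃ → cong (λ w → 𝟙 (w ≟ 0')) (derC∘through P y₁ y₂ y₃)) ⟩
      ∑ (λ y₁ → ∑ λ y₂ → ∑ λ y₃ → 𝟙 (linear₃ (derC-through P) y₁ y₂ y₃ ≟ 0'))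
        ≡⟨ count-linear₃ (derC-through P) 0' (no (derC-through≢0 P)) ⟩
      p^ 2 ∎

    -- f ↦ f(Q) on the cubics through P, in the coordinates of through P
    valC-through : ℙ¹ → ℙ¹ → F × F × F
    valC-through (fin x) (fin y) = y *' y *' y +' -' (x *' x *' x) , y *' y +' -' (x *' x) , y +' -' x
    valC-through (fin x) ∞       = 1' , 0' , 0'
    valC-through ∞       (fin y) = y *' y , y , 1'
    valC-through ∞       ∞       = 0' , 0' , 0'

    valC∘through : ∀ P Q y₁ y₂ y₃ → valC Q (through P y₁ y₂ y₃) ≡ linear₃ (valC-through P Q) y₁ y₂ y₃
    valC∘through (fin x) (fin y) a b c =
      solve 5 (λ a b c x y → a :* y :* y :* y :+ b :* y :* y :+ c :* y :+ (:- (a :* x :* x :* x :+ b :* x :* x :+ c :* x))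
                             := (y :* y :* y :- x :* x :* x) :* a :+ (y :* y :- x :* x) :* b :+ (y :- x) :* c :+ con (+ 0)) refl a b c x y
    valC∘through (fin x) ∞ a b c = solve 3 (λ a b c → a := con (+ 1) :* a :+ con (+ 0) :* b :+ con (+ 0) :* c :+ con (+ 0)) refl a b c
    valC∘through ∞ (fin y) b c d =
      solve 4 (λ b c d y → con (+ 0) :* y :* y :* y :+ b :* y :* y :+ c :* y :+ d := y :* y :* b :+ y :* c :+ con (+ 1) :* d :+ con (+ 0)) refl b c d y
    valC∘through ∞ ∞ b c d = solve 3 (λ b c d → con (+ 0) := con (+ 0) :* b :+ con (+ 0) :* c :+ con (+ 0) :* d :+ con (+ 0)) refl b c d

    valC-through-zero : ∀ P Q → AllZero (valC-through P Q) → Q ≡ P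
    valC-through-zero (fin x) (fin y) (_ , _ , e) = cong fin (begin
      y                  ≡⟨ solve 2 (λ y x → y := (y :- x) :+ x) refl y x ⟩
      (y +' -' x) +' x   ≡⟨ cong (_+' x) e ⟩
      0' +' x            ≡⟨ +-identityˡ x ⟩
      x                  ∎)
    valC-through-zero (fin x) ∞       (e , _ , _) = ⊥-elim (1'≢0' e)
    valC-through-zero ∞       (fin y) (_ , _ , e) = ⊥-elim (1'≢0' e)
    valC-through-zero ∞       ∞       _           = refl

    valC-through-diagonal : ∀ P → AllZero (valC-through P P)
    valC-through-diagonal (fin x) = solve 1 (λ x → x :* x :* x :- x :* x :* x := con (+ 0)) refl x ,
                                    solve 1 (λ x → x :* x :- x :* x := con (+ 0)) refl x ,
                                    solve 1 (λ x → x :- x := con (+ 0)) refl x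
    valC-through-diagonal ∞ = refl , refl , refl

    ∑V-vanishingAtBoth : ∀ P Q → ∑V (λ f → 𝟙 (valC P f ≟ 0') ⊛ 𝟙 (valC Q f ≟ 0')) ≡ p^ 2 ⊕ 𝟙 (Q ≟ℙ P) ⊛ (p^ 3 ⊖ p^ 2)
    ∑V-vanishingAtBoth P Q = begin
      ∑V (λ f → 𝟙 (valC P f ≟ 0') ⊛ 𝟙 (valC Q f ≟ 0'))
        ≡⟨ ∑V-through P (λ f → 𝟙 (valC Q f ≟ 0')) ⟩
      ∑ (λ y₁ → ∑ λ y₂ → ∑ λ y₃ → 𝟙 (valC Q (through P y₁ y₂ y₃) ≟ 0'))
        ≡⟨ sumFin-cong (λ y₁ → sumFin-cong λ y₂ → sumFin-cong λ y₃ → cong (λ w → 𝟙 (w ≟ 0')) (valC∘through P Q y₁ y₂ y₃)) ⟩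
      ∑ (λ y₁ → ∑ λ y₂ → ∑ λ y₃ → 𝟙 (linear₃ (valC-through P Q) y₁ y₂ y₃ ≟ 0'))
        ≡⟨ count-linear₃ (valC-through P Q) 0' (allZero? (valC-through P Q)) ⟩
      (if does (allZero? (valC-through P Q)) then pℚ p ⊛ (pℚ p ⊛ (pℚ p ⊛ 𝟙 (0' ≟ 0'))) else p^ 2)
        ≡⟨ split (allZero? (valC-through P Q)) (Q ≟ℙ P) ⟩
      p^ 2 ⊕ 𝟙 (Q ≟ℙ P) ⊛ (p^ 3 ⊖ p^ 2) ∎
      where
      split : ∀ (d : Dec (AllZero (valC-through P Q))) (e : Dec (Q ≡ P)) →
        (if does d then pℚ p ⊛ (pℚ p ⊛ (pℚ p ⊛ 𝟙 (0' ≟ 0'))) else p^ 2) ≡ p^ 2 ⊕ 𝟙 e ⊛ (p^ 3 ⊖ p^ 2)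
      split (yes _) (yes _) = begin
        pℚ p ⊛ (pℚ p ⊛ (pℚ p ⊛ 𝟙 (0' ≟ 0')))  ≡⟨ cong (λ w → pℚ p ⊛ (pℚ p ⊛ (pℚ p ⊛ w))) (𝟙-yes refl (0' ≟ 0')) ⟩
        p^ 3                                 ≡⟨ sym (y+[x-y]≡x (p^ 3) (p^ 2)) ⟩
        p^ 2 ⊕ (p^ 3 ⊖ p^ 2)                 ≡⟨ cong (p^ 2 ⊕_) (sym (ℚ.*-identityˡ (p^ 3 ⊖ p^ 2))) ⟩
        p^ 2 ⊕ 1ℚ ⊛ (p^ 3 ⊖ p^ 2)            ∎
      split (yes z)  (no Q≢P) = ⊥-elim (Q≢P (valC-through-zero P Q z))
      split (no ¬z) (yes refl) = ⊥-elim (¬z (valC-through-diagonal P))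
      split (no _)  (no _)    = sym (trans (cong (p^ 2 ⊕_) (ℚ.*-zeroˡ (p^ 3 ⊖ p^ 2))) (ℚ.+-identityʳ (p^ 2)))

    ∑V-#roots : ∑V #roots ≡ (pℚ p ⊕ 1ℚ) ⊛ p^ 3
    ∑V-#roots = trans (∑V-∑ℙ (λ f P → 𝟙 (valC P f ≟ 0'))) (trans (∑ℙ-cong ∑V-vanishingAt) (∑ℙ-const (p^ 3)))

    ∑V-#multipleRoots : ∑V #multipleRoots ≡ (pℚ p ⊕ 1ℚ) ⊛ p^ 2
    ∑V-#multipleRoots = trans (∑V-∑ℙ (λ f P → 𝟙 ((valC P f ≟ 0') ×-dec (derC P f ≟ 0')))) (trans (∑ℙ-cong ∑V-multipleRootAt) (∑ℙ-const (p^ 2)))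

    ∑V-#roots² : ∑V (λ f → #roots f ⊛ #roots f) ≡ (pℚ p ⊕ 1ℚ) ⊛ ((pℚ p ⊕ 1ℚ) ⊛ p^ 2 ⊕ (p^ 3 ⊖ p^ 2))
    ∑V-#roots² = begin
      ∑V (λ f → #roots f ⊛ #roots f)
        ≡⟨ ∑V-cong square ⟩
      ∑V (λ f → ∑ℙ λ P → ∑ℙ λ Q → 𝟙 (valC P f ≟ 0') ⊛ 𝟙 (valC Q f ≟ 0'))
        ≡⟨ trans (∑V-∑ℙ (λ f P → ∑ℙ λ Q → 𝟙 (valC P f ≟ 0') ⊛ 𝟙 (valC Q f ≟ 0')))
                 (∑ℙ-cong λ P → ∑V-∑ℙ (λ f Q → 𝟙 (valC P f ≟ 0') ⊛ 𝟙 (valC Q f ≟ 0'))) ⟩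
      ∑ℙ (λ P → ∑ℙ λ Q → ∑V (λ f → 𝟙 (valC P f ≟ 0') ⊛ 𝟙 (valC Q f ≟ 0')))
        ≡⟨ ∑ℙ-cong (λ P → trans (∑ℙ-cong (∑V-vanishingAtBoth P)) (row P)) ⟩
      ∑ℙ (λ P → (pℚ p ⊕ 1ℚ) ⊛ p^ 2 ⊕ (p^ 3 ⊖ p^ 2))
        ≡⟨ ∑ℙ-const ((pℚ p ⊕ 1ℚ) ⊛ p^ 2 ⊕ (p^ 3 ⊖ p^ 2)) ⟩
      (pℚ p ⊕ 1ℚ) ⊛ ((pℚ p ⊕ 1ℚ) ⊛ p^ 2 ⊕ (p^ 3 ⊖ p^ 2)) ∎
      where
      square : ∀ f → #roots f ⊛ #roots f ≡ ∑ℙ λ P → ∑ℙ λ Q → 𝟙 (valC P f ≟ 0') ⊛ 𝟙 (valC Q f ≟ 0')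
      square f = begin
        #roots f ⊛ #roots f
          ≡⟨ sym (∑ℙ-* (#roots f) (λ P → 𝟙 (valC P f ≟ 0'))) ⟩
        ∑ℙ (λ P → #roots f ⊛ 𝟙 (valC P f ≟ 0'))
          ≡⟨ ∑ℙ-cong (λ P → trans (ℚ.*-comm (#roots f) (𝟙 (valC P f ≟ 0'))) (sym (∑ℙ-* (𝟙 (valC P f ≟ 0')) (λ Q → 𝟙 (valC Q f ≟ 0'))))) ⟩
        ∑ℙ (λ P → ∑ℙ λ Q → 𝟙 (valC P f ≟ 0') ⊛ 𝟙 (valC Q f ≟ 0')) ∎
      row : ∀ P → ∑ℙ (λ Q → p^ 2 ⊕ 𝟙 (Q ≟ℙ P) ⊛ (p^ 3 ⊖ p^ 2)) ≡ (pℚ p ⊕ 1ℚ) ⊛ p^ 2 ⊕ (p^ 3 ⊖ p^ 2)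
      row P = trans (∑ℙ-+ (λ _ → p^ 2) (λ Q → 𝟙 (Q ≟ℙ P) ⊛ (p^ 3 ⊖ p^ 2)))
                    (cong₂ _⊕_ (∑ℙ-const (p^ 2)) (∑ℙ-𝟙≟ P (λ _ → p^ 3 ⊖ p^ 2)))

    ∑V-𝟙₀-1 : ∑V 𝟙₀ ≡ 1ℚ
    ∑V-𝟙₀-1 = trans (∑V-cong (λ f → sym (ℚ.*-identityʳ (𝟙₀ f)))) (∑V-𝟙₀ (λ _ → 1ℚ))

    ∑V-θFormula : ∑V θFormula ≡
      fromℕ 4 ⊛ ((pℚ p ⊕ 1ℚ) ⊛ p^ 3) ⊖ fromℕ 2 ⊛ ((pℚ p ⊕ 1ℚ) ⊛ p^ 2)
        ⊖ (pℚ p ⊕ 1ℚ) ⊛ ((pℚ p ⊕ 1ℚ) ⊛ p^ 2 ⊕ (p^ 3 ⊖ p^ 2)) ⊖ p^ 4 ⊕ pℚ p ⊛ pℚ p ⊛ 1ℚ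
    ∑V-θFormula = begin
      ∑V θFormula
        ≡⟨ ∑V-cong (λ f → θFormula-expanded (pℚ p) (#roots f) (#multipleRoots f) (𝟙₀ f)) ⟩
      ∑V (λ f → fromℕ 4 ⊛ #roots f ⊖ fromℕ 2 ⊛ #multipleRoots f ⊖ #roots f ⊛ #roots f ⊖ 1ℚ ⊕ pℚ p ⊛ pℚ p ⊛ 𝟙₀ f)
        ≡⟨ trans (∑V-+ _ _) (cong₂ _⊕_ (trans (∑V-⊖ _ _) (cong₂ _⊖_ (trans (∑V-⊖ _ _) (cong₂ _⊖_ (∑V-⊖ _ _) refl)) refl)) refl) ⟩
      ∑V (λ f → fromℕ 4 ⊛ #roots f) ⊖ ∑V (λ f → fromℕ 2 ⊛ #multipleRoots f) ⊖ ∑V (λ f → #roots f ⊛ #roots f) ⊖ ∑V (λ _ → 1ℚ)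
        ⊕ ∑V (λ f → pℚ p ⊛ pℚ p ⊛ 𝟙₀ f)
        ≡⟨ cong₂ _⊕_ (cong₂ _⊖_ (cong₂ _⊖_ (cong₂ _⊖_ (trans (∑V-* (fromℕ 4) #roots) (cong (fromℕ 4 ⊛_) ∑V-#roots))
                                                      (trans (∑V-* (fromℕ 2) #multipleRoots) (cong (fromℕ 2 ⊛_) ∑V-#multipleRoots)))
                                            ∑V-#roots²)
                                ∑V-1)
                     (trans (∑V-* (pℚ p ⊛ pℚ p) 𝟙₀) (cong (pℚ p ⊛ pℚ p ⊛_) ∑V-𝟙₀-1)) ⟩
      fromℕ 4 ⊛ ((pℚ p ⊕ 1ℚ) ⊛ p^ 3) ⊖ fromℕ 2 ⊛ ((pℚ p ⊕ 1ℚ) ⊛ p^ 2)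
        ⊖ (pℚ p ⊕ 1ℚ) ⊛ ((pℚ p ⊕ 1ℚ) ⊛ p^ 2 ⊕ (p^ 3 ⊖ p^ 2)) ⊖ p^ 4 ⊕ pℚ p ⊛ pℚ p ⊛ 1ℚ ∎

  θ̂-0 : ∀ θ → (∀ f → θ f ≡ θFormula f) → fourier p i3 θ (zeroC p) ≈ᶜ ratC p (1ℚ ⊖ pinv p ⊛ pinv p)
  θ̂-0 θ θ≡θF = 0ℚ , λ t → begin
    fourier p i3 θ (zeroC p) t ⊖ ratC p (1ℚ ⊖ u ⊛ u) t
      ≡⟨ cong₂ (λ a b → u ⊛ u ⊛ u ⊛ u ⊛ a ⊖ b) (levelSum-at-0 t)
               (trans (if-then-0≡𝟙* (t ≟ 0') (1ℚ ⊖ u ⊛ u)) (cong (_⊛ (1ℚ ⊖ u ⊛ u)) (𝟙-cong sym sym (t ≟ 0') (0' ≟ t)))) ⟩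
    u ⊛ u ⊛ u ⊛ u ⊛ (𝟙 (0' ≟ t) ⊛ ∑V θFormula) ⊖ 𝟙 (0' ≟ t) ⊛ (1ℚ ⊖ u ⊛ u)
      ≡⟨ cong (λ w → u ⊛ u ⊛ u ⊛ u ⊛ (𝟙 (0' ≟ t) ⊛ w) ⊖ 𝟙 (0' ≟ t) ⊛ (1ℚ ⊖ u ⊛ u)) ∑V-θFormula ⟩
    _ ≡⟨ fourier-θ-at-0 u (pℚ p) (𝟙 (0' ≟ t)) (1/n*n≡1 p) ⟩
    0ℚ ∎
    where
    u = pinv p
    levelSum-at-0 : ∀ t → levelSum θ (zeroC p) t ≡ 𝟙 (0' ≟ t) ⊛ ∑V θFormula
    levelSum-at-0 t = trans (∑V-cong (λ f → trans (if-then-0≡𝟙* (pair (zeroC p) f ≟ t) (θ f))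
                                                   (cong₂ _⊛_ (cong (λ w → 𝟙 (w ≟ t)) (pair-zeroˡ f)) (θ≡θF f))))
                            (∑V-* (𝟙 (0' ≟ t)) θFormula)

proposition3p8 : (p : ℕ) .{{_ : NonZero p}} → Prime p → p ≢ 3 →
    (i3 : Fp p) → (3 Data.Nat.* toℕ i3) % p ≡ 1 →
    ((φ : Cubic p → ℚ) → (∀ σ f → HasType p σ f → φ f ≡ toℚ (λp σ)) →
      ((f* : Cubic p) →
        (HasType p s111 f* ⊎ HasType p s12 f* ⊎ HasType p s3 f* ⊎ HasType p s1²1 f*) →
        fourier p i3 φ f* ≈ᶜ ratC p (ℚ.- (pinv p ℚ.* pinv p ℚ.* pinv p)))
      × ((f* : Cubic p) → (HasType p s1³ f* ⊎ HasType p s0 f*) →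
        fourier p i3 φ f* ≈ᶜ ratC p ((pℚ p ℚ.* pℚ p ℚ.- 1ℚ) ℚ.* (pinv p ℚ.* pinv p ℚ.* pinv p))))
    × ((θ : Cubic p → ℚ) → (∀ σ f → HasType p σ f → θ f ≡ toℚ (θp² σ)) →
      fourier p i3 θ (zeroC p) ≈ᶜ ratC p (1ℚ ℚ.- pinv p ℚ.* pinv p))
proposition3p8 p p-prime _ i3 3i3%p≡1 =
  (λ φ hφ → nonsingular φ (φ≡λFormula φ hφ) , singular φ (φ≡λFormula φ hφ)) ,
  (λ θ hθ → θ̂-0 θ (θ≡θFormula θ hθ))
  where
  open SplitTypeValues p p-prime using (λFormula; φ≡λFormula; θ≡θFormula)
  open LambdaTransform p p-prime i3 (PrimeField.⟦3⟧-inverse p p-prime i3 3i3%p≡1)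
  open ThetaTransform p p-prime i3 using (θ̂-0)
  nonsingular : ∀ φ → (∀ f → φ f ≡ λFormula f) → (f* : Cubic p) →
    HasType p s111 f* ⊎ HasType p s12 f* ⊎ HasType p s3 f* ⊎ HasType p s1²1 f* →
    fourier p i3 φ f* ≈ᶜ ratC p (ℚ.- (pinv p ℚ.* pinv p ℚ.* pinv p))
  nonsingular φ φ≡λ f* (inj₁ h)               = λ̂-generic φ φ≡λ s111 f* h (λ ()) (λ ())
  nonsingular φ φ≡λ f* (inj₂ (inj₁ h))        = λ̂-generic φ φ≡λ s12  f* h (λ ()) (λ ())
  nonsingular φ φ≡λ f* (inj₂ (inj₂ (inj₁ h))) = λ̂-generic φ φ≡λ s3   f* h (λ ()) (λ ())
  nonsingular φ φ≡λ f* (inj₂ (inj₂ (inj₂ h))) = λ̂-generic φ φ≡λ s1²1 f* h (λ ()) (λ ())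
  singular : ∀ φ → (∀ f → φ f ≡ λFormula f) → (f* : Cubic p) → HasType p s1³ f* ⊎ HasType p s0 f* →
    fourier p i3 φ f* ≈ᶜ ratC p ((pℚ p ℚ.* pℚ p ℚ.- 1ℚ) ℚ.* (pinv p ℚ.* pinv p ℚ.* pinv p))
  singular φ φ≡λ f* (inj₁ h)    = λ̂-1³ φ φ≡λ f* h
  singular φ φ≡λ f* (inj₂ refl) = λ̂-0 φ φ≡λ
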